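{- Let $n\ge2$ and let $\mathcal{H}(n)$ be the group with generators $x_1,\dots,x_n,y_1,\dots,y_n$ and defining relations, for all $x,x'\in X_0=\{x_1,\dots,x_n\}$, $y,y'\in Y_0=\{y_1,\dots,y_n\}$, $z,z',z'',z'''\in X_0\cup Y_0$: $z^2=1$, $[x,x']=[y,y']=1$, $[x,y]^2=1$, $[[y,x],y']=1$, $[[x,y],z]^2=1$, $[[[z,z'],z''],z''']=1$. Let $X=\langle X_0\rangle$, $Y=\langle Y_0\rangle$, and let $\mathcal{H}(n)_3=[[\mathcal{H}(n),\mathcal{H}(n)],\mathcal{H}(n)]$ be the third term of the lower central series. Then: (1) for all $x,x'\in X_0$ and $y\in Y_0$, $[[x,y],x']=[[x',y],x]$; (2) $\mathcal{H}(n)/\mathcal{H}(n)'\cong C_2^{2n}$, and $\mathcal{H}(n)$ is an $n$-dimensional mixed dihedral group relative to $X$ and $Y$; (3) $\mathcal{H}(n)'=W\times\mathcal{H}(n)_3\cong C_2^{n^2(n+1)/2}$, where (a) $W=\langle [x_i,y_j]:1\le i,j\le n\rangle\cong C_2^{n^2}$, and (b) $\mathcal{H}(n)_3=\langle [[x_i,y_j],x_k]: 1\le i,j\le n,\ i<k\le n\rangle\cong C_2^{n^2(n-1)/2}$; moreover $\mathcal{H}(n)_3\le Z(\mathcal{H}(n))$; (4) for all $a\in\mathcal{H}(n)$ and $b,b'\in Y$, $[[b,a],b']=1$ and $[[a,b],b']=1$; (5) for every $(g_1,g_2)\in\mathrm{Aut}(X)\times\mathrm{Aut}(Y)$, the map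 $x_i\mapsto x_i^{g_1}$, $y_i\mapsto y_i^{g_2}$ ($1\le i\le n$) extends to an automorphism of $\mathcal{H}(n)$; (6) if $c\in X$ and $d\in Y$ are written as $c=x_{i_1}x_{i_2}\cdots x_{i_k}$ and $d=y_{j_1}y_{j_2}\cdots y_{j_\ell}$ with $x_{i_u}\in X_0$, $y_{j_v}\in Y_0$ and $k,\ell$ minimal, then \[ [c,d]\,\mathcal{H}(n)_3=\prod_{1\le u\le k,\ 1\le v\le \ell}[x_{i_u},y_{j_v}]\,\mathcal{H}(n)_3. \]
   Context: Commutators: $[a,b]=a^{ -1}b^{ -1}ab$; $\mathcal{H}(n)'$ is the derived subgroup; $Z(\cdot)$ is the centre. A finite group $H$ with subgroups $X,Y$ is an $n$-dimensional mixed dihedral group relative to $X$ and $Y$ if $X\cong Y\cong C_2^n$, $H=\langle X,Y\rangle$ and $H/H'\cong C_2^{2n}$. -}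

module Defs where

open import Data.Nat using (ℕ)
open import Data.Fin using (Fin) renaming (_<_ to _<ᶠ_)
open import Data.Bool using (Bool; true; false; not; _xor_)
open import Data.Vec using (Vec; zipWith)
open import Data.List using (List; []; _∷_; _++_; reverse; map; concat; length)
open import Data.List.Relation.Unary.Any using (Any)
open import Data.Sum using (_⊎_; inj₁; inj₂)
open import Data.Product using (Σ; ∃; _×_; _,_)
open import Data.Unit using (⊤)
open import Relation.Binary.PropositionalEquality using (_≡_)

-- Elementary abelian 2-group C₂^m, realised as Vec Bool m under xor.

_⊕_ : {m : ℕ} → Vec Bool m → Vec Bool m → Vec Bool m
_⊕_ = zipWith _xor_

-- Elements are words in the letters x_i^{±1}, y_j^{±1}; equality of
-- group elements is the congruence _≈_ generated by free cancellation
-- and the defining relators.  Subgroups are predicates on words closed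
-- under the group operations and under _≈_.

module 𝓗 (n : ℕ) where

  -- generators: inj₁ i = x_i , inj₂ j = y_j
  Gen : Set
  Gen = Fin n ⊎ Fin n

  -- a letter: a generator together with an exponent flag (true = inverse)
  Letter : Set
  Letter = Gen × Bool

  Word : Set
  Word = List Letter

  flipL : Letter → Letter
  flipL (g , b) = (g , not b)

  ε : Word
  ε = []

  _·_ : Word → Word → Word
  _·_ = _++_
  infixl 7 _·_

  inv : Word → Word
  inv w = reverse (map flipL w)

  ⟦_,_⟧ : Word → Word → Word
  ⟦ a , b ⟧ = inv a · inv b · a · b

  gen : Gen → Word
  gen g = (g , false) ∷ []

  x : Fin n → Word
  x i = gen (inj₁ i)

  y : Fin n → Word
  y j = gen (inj₂ j)

  data Relator : Word → Set where
    r-sq    : (z : Gen) → Relator (gen z · gen z)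
    r-xx    : (i i' : Fin n) → Relator ⟦ x i , x i' ⟧
    r-yy    : (j j' : Fin n) → Relator ⟦ y j , y j' ⟧
    r-xy²   : (i j : Fin n) → Relator (⟦ x i , y j ⟧ · ⟦ x i , y j ⟧)
    r-yxy   : (j i j' : Fin n) → Relator ⟦ ⟦ y j , x i ⟧ , y j' ⟧
    r-xyz²  : (i j : Fin n) (z : Gen) →
              Relator (⟦ ⟦ x i , y j ⟧ , gen z ⟧ · ⟦ ⟦ x i , y j ⟧ , gen z ⟧)
    r-zzzz  : (z z' z'' z''' : Gen) →
              Relator ⟦ ⟦ ⟦ gen z , gen z' ⟧ , gen z'' ⟧ , gen z''' ⟧

  data _≈_ : Word → Word → Set where
    ≈-refl   : ∀ {u} → u ≈ u
    ≈-sym    : ∀ {u v} → u ≈ v → v ≈ u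
    ≈-trans  : ∀ {u v w} → u ≈ v → v ≈ w → u ≈ w
    ≈-cong   : ∀ {u u' v v'} → u ≈ u' → v ≈ v' → (u · v) ≈ (u' · v')
    ≈-cancel : (l : Letter) → (l ∷ flipL l ∷ []) ≈ ε
    ≈-rel    : ∀ {r} → Relator r → r ≈ ε
  infix 4 _≈_

  Pred : Set₁
  Pred = Word → Set

  _⊆_ : Pred → Pred → Set
  A ⊆ B = ∀ w → A w → B w

  Whole : Pred
  Whole _ = ⊤

  data ⟨_⟩ (S : Pred) : Pred where
    base : ∀ {w} → S w → ⟨ S ⟩ w
    one  : ⟨ S ⟩ ε
    mul  : ∀ {u v} → ⟨ S ⟩ u → ⟨ S ⟩ v → ⟨ S ⟩ (u · v)
    neg  : ∀ {u} → ⟨ S ⟩ u → ⟨ S ⟩ (inv u)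
    resp : ∀ {u v} → ⟨ S ⟩ u → u ≈ v → ⟨ S ⟩ v

  X₀ : Pred
  X₀ w = ∃ λ i → w ≡ x i

  Y₀ : Pred
  Y₀ w = ∃ λ j → w ≡ y j

  X : Pred
  X = ⟨ X₀ ⟩

  Y : Pred
  Y = ⟨ Y₀ ⟩

  _∪_ : Pred → Pred → Pred
  (A ∪ B) w = A w ⊎ B w

  Comm : Pred → Pred → Pred
  Comm A B = ⟨ (λ w → Σ Word λ a → Σ Word λ b → A a × B b × (w ≡ ⟦ a , b ⟧)) ⟩

  Der : Pred
  Der = Comm Whole Whole

  LC₃ : Pred
  LC₃ = Comm Der Whole

  Z : Pred
  Z a = ∀ b → a · b ≈ b · a

  NormalIn : Pred → Pred → Set
  NormalIn A K = ∀ a k → A a → K k → A (inv k · a · k)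

  InternalDirectProduct : Pred → Pred → Pred → Set
  InternalDirectProduct K A B =
    (A ⊆ K) × (B ⊆ K) × NormalIn A K × NormalIn B K ×
    (∀ w → A w → B w → w ≈ ε) ×
    (∀ w → K w → Σ Word λ a → Σ Word λ b → A a × B b × (w ≈ a · b))

  -- "K, with elements compared by _∼_, is isomorphic to C₂^m":
  -- an injective and surjective homomorphism ψ : C₂^m → K.
  -- (For a subgroup K take _∼_ = _≈_; for a quotient 𝓗/N take
  --  u ∼ v  iff  u⁻¹v ∈ N.)
  record IsoC₂^ (m : ℕ) (K : Pred) (_∼_ : Word → Word → Set) : Set where
    field
      ψ    : Vec Bool m → Word
      into : ∀ v → K (ψ v)
      hom  : ∀ u v → ψ (u ⊕ v) ∼ (ψ u · ψ v)
      inj  : ∀ u v → ψ u ∼ ψ v → u ≡ v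
      surj : ∀ w → K w → Σ (Vec Bool m) λ v → ψ v ∼ w

  ModN : Pred → Word → Word → Set
  ModN N u v = N (inv u · v)

  ≅C₂^ : Pred → ℕ → Set
  ≅C₂^ K m = IsoC₂^ m K _≈_

  Finite : Set
  Finite = Σ (List Word) λ L → ∀ w → Any (w ≈_) L

  MixedDihedral : ℕ → Pred → Pred → Set
  MixedDihedral m A B =
    Finite × ≅C₂^ A m × ≅C₂^ B m × (Whole ⊆ ⟨ A ∪ B ⟩) ×
    IsoC₂^ (m Data.Nat.+ m) Whole (ModN Der)

  record IsAut (K : Pred) (f : (w : Word) → K w → Word) : Set where
    field
      into  : ∀ w (p : K w) → K (f w p)
      respects : ∀ u v (p : K u) (q : K v) → u ≈ v → f u p ≈ f v q
      hom   : ∀ u v (p : K u) (q : K v) (r : K (u · v)) →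
              f (u · v) r ≈ f u p · f v q
      inj   : ∀ u v (p : K u) (q : K v) → f u p ≈ f v q → u ≈ v
      surj  : ∀ w → K w → Σ Word λ u → Σ (K u) λ p → f u p ≈ w

  prodX : List (Fin n) → Word
  prodX is = concat (map x is)

  prodY : List (Fin n) → Word
  prodY js = concat (map y js)

  -- ∏_{u,v} [x_{i_u}, y_{j_v}]  (u outer, v inner)
  prodComm : List (Fin n) → List (Fin n) → Word
  prodComm is js = concat (map (λ i → concat (map (λ j → ⟦ x i , y j ⟧) js)) is)

  W : Pred
  W = ⟨ (λ w → ∃ λ i → ∃ λ j → w ≡ ⟦ x i , y j ⟧) ⟩

  T : Pred
  T = ⟨ (λ w → ∃ λ i → ∃ λ j → ∃ λ k → (i <ᶠ k) × (w ≡ ⟦ ⟦ x i , y j ⟧ , x k ⟧)) ⟩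

module Submission where

-- 𝓗(n) is identified with an explicit group M of tuples (a, b, c, t): a, b ∈ C₂ⁿ record the
-- exponents of the x's and the y's, c ∈ C₂^{n×n} those of the commutators [x_i, y_j], and
-- t_ijl (i < l) those of [[x_i, y_j], x_l], multiplied as the collected words
-- x^a y^b ∏ [x_i,y_j]^c_ij ∏ [[x_i,y_j],x_l]^t_ijl multiply.  The relators hold in M, so
-- evaluation φ is a homomorphism from 𝓗(n) to M; conversely the collection process rewrites
-- every word into the normal form of its value, so φ is injective.  Each part of the theorem
-- is then read off the coordinates: 𝓗(n)' = {a = b = 0}, W = {a = b = 0, t = 0},
-- 𝓗(n)₃ = {a = b = c = 0}, X = {b = c = t = 0} and Y = {a = c = t = 0}.  At a triple
-- (i, j, l) the group law of M involves only the six bits a_i, a_l, b_j, c_ij, c_lj, t_ijl,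
-- so every identity needed in M is verified by exhaustive evaluation on this local group.

open import Data.Nat using (ℕ)

module LocalGroup where

  open import Data.Nat using (zero; suc)
  open import Data.Bool using (Bool; true; false; not; _xor_; _∧_; _∨_; T)
  open import Data.Bool.Properties using (xor-∧-commutativeRing; xor-assoc)
  open import Data.Unit using (tt)
  open import Data.Maybe using (just; nothing)
  open import Data.Vec using (Vec; []; _∷_)
  open import Relation.Binary.PropositionalEquality
  open import Tactic.RingSolver
  open import Tactic.RingSolver.Core.AlmostCommutativeRing

  Bool-ring : AlmostCommutativeRing _ _
  Bool-ring = fromCommutativeRing xor-∧-commutativeRing (λ { false → just refl ; true → nothing })

  ∧-T₁ : ∀ {a b} → T (a ∧ b) → T a
  ∧-T₁ {true} {true} _ = tt

  ∧-T₂ : ∀ {a b} → T (a ∧ b) → T b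
  ∧-T₂ {true} {true} _ = tt

  implies : Bool → Bool → Bool
  implies p q = not p ∨ q

  implies-T : ∀ {p q} → T (implies p q) → T p → T q
  implies-T {true} {true} _ _ = tt

  allBool : (Bool → Bool) → Bool
  allBool p = p true ∧ p false

  allBool-T : ∀ p → T (allBool p) → ∀ x → T (p x)
  allBool-T p h true = ∧-T₁ h
  allBool-T p h false = ∧-T₂ h

  eqB : Bool → Bool → Bool
  eqB x y = not (x xor y)

  eqB-T : ∀ {x y} → T (eqB x y) → x ≡ y
  eqB-T {true} {true} _ = refl
  eqB-T {false} {false} _ = refl

  -- The Bool argument of the operations below is [i < l]; t is meaningless (masked) when it fails.
  record Loc : Set where
    constructor loc
    field ai al bj cij clj tijl : Bool
  open Loc public

  eqL : Loc → Loc → Bool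
  eqL (loc a b c d e f) (loc a' b' c' d' e' f') =
    eqB a a' ∧ (eqB b b' ∧ (eqB c c' ∧ (eqB d d' ∧ (eqB e e' ∧ eqB f f'))))

  loc≡ : ∀ {a b c d e f a' b' c' d' e' f'} → a ≡ a' → b ≡ b' → c ≡ c' → d ≡ d' → e ≡ e' → f ≡ f' →
         loc a b c d e f ≡ loc a' b' c' d' e' f'
  loc≡ refl refl refl refl refl refl = refl

  eqL-T : ∀ {x y} → T (eqL x y) → x ≡ y
  eqL-T {loc a b c d e f} {loc a' b' c' d' e' f'} h with eqB a a' in e1 | eqB b b' in e2 | eqB c c' in e3 | eqB d d' in e4 | eqB e e' in e5 | eqB f f' in e6
  ... | true | true | true | true | true | true =
    loc≡ (eqB-T (subst T (sym e1) tt)) (eqB-T (subst T (sym e2) tt)) (eqB-T (subst T (sym e3) tt))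
         (eqB-T (subst T (sym e4) tt)) (eqB-T (subst T (sym e5) tt)) (eqB-T (subst T (sym e6) tt))

  allLoc : (Loc → Bool) → Bool
  allLoc p = allBool λ a → allBool λ b → allBool λ c → allBool λ d → allBool λ e → allBool λ f → p (loc a b c d e f)

  allLoc-T : ∀ p → T (allLoc p) → ∀ x → T (p x)
  allLoc-T p h (loc a b c d e f) =
    allBool-T (λ f → p (loc a b c d e f))
    (allBool-T (λ e → allBool λ f → p (loc a b c d e f))
    (allBool-T (λ d → allBool λ e → allBool λ f → p (loc a b c d e f))
    (allBool-T (λ c → allBool λ d → allBool λ e → allBool λ f → p (loc a b c d e f))
    (allBool-T (λ b → allBool λ c → allBool λ d → allBool λ e → allBool λ f → p (loc a b c d e f))
    (allBool-T (λ a → allBool λ b → allBool λ c → allBool λ d → allBool λ e → allBool λ f → p (loc a b c d e f))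
      h a) b) c) d) e) f

  loc-ε : Loc
  loc-ε = loc false false false false false false

  mask : Bool → Loc → Loc
  mask b (loc ai al bj cij clj t) = loc ai al bj cij clj (b ∧ t)

  loc-mul : Bool → Loc → Loc → Loc
  loc-mul lt (loc ai al bj cij clj t) (loc ai' al' bj' cij' clj' t') =
    loc (ai xor ai') (al xor al') (bj xor bj') (cij xor cij' xor (ai' ∧ bj)) (clj xor clj' xor (al' ∧ bj))
        (lt ∧ (t xor t' xor (cij ∧ al') xor (clj ∧ ai') xor (ai' ∧ al' ∧ bj)))

  loc-inv : Bool → Loc → Loc
  loc-inv lt (loc ai al bj cij clj t) =
    loc ai al bj (cij xor (ai ∧ bj)) (clj xor (al ∧ bj))
        (lt ∧ (t xor (cij ∧ al) xor (clj ∧ ai) xor (ai ∧ al ∧ bj)))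

  loc-comm : Bool → Loc → Loc → Loc
  loc-comm lt x y = loc-mul lt (loc-mul lt (loc-mul lt (loc-inv lt x) (loc-inv lt y)) x) y

  exhaust-T₁ : (P Q : Bool → Loc → Bool) →
    T (allBool λ b → allLoc λ x → implies (P b x) (Q b x)) →
    ∀ b x → T (P b x) → T (Q b x)
  exhaust-T₁ P Q h b x = implies-T {P b x}
    (allLoc-T (λ x → implies (P b x) (Q b x)) (allBool-T (λ b → allLoc λ x → implies (P b x) (Q b x)) h b) x)

  exhaust-T₂ : (P Q : Bool → Loc → Loc → Bool) →
    T (allBool λ b → allLoc λ x → allLoc λ y → implies (P b x y) (Q b x y)) →
    ∀ b x y → T (P b x y) → T (Q b x y)
  exhaust-T₂ P Q h b x y = implies-T {P b x y}
    (allLoc-T (λ y → implies (P b x y) (Q b x y))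
      (allLoc-T (λ x → allLoc λ y → implies (P b x y) (Q b x y))
        (allBool-T (λ b → allLoc λ x → allLoc λ y → implies (P b x y) (Q b x y)) h b) x) y)

  exhaust-≡₁ : (P : Bool → Loc → Bool) (F G : Bool → Loc → Loc) →
    T (allBool λ b → allLoc λ x → implies (P b x) (eqL (mask b (F b x)) (mask b (G b x)))) →
    ∀ b x → T (P b x) → mask b (F b x) ≡ mask b (G b x)
  exhaust-≡₁ P F G h b x p = eqL-T (exhaust-T₁ P (λ b x → eqL (mask b (F b x)) (mask b (G b x))) h b x p)

  exhaust-≡₂ : (P : Bool → Loc → Loc → Bool) (F G : Bool → Loc → Loc → Loc) →
    T (allBool λ b → allLoc λ x → allLoc λ y → implies (P b x y) (eqL (mask b (F b x y)) (mask b (G b x y)))) →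
    ∀ b x y → T (P b x y) → mask b (F b x y) ≡ mask b (G b x y)
  exhaust-≡₂ P F G h b x y p = eqL-T (exhaust-T₂ P (λ b x y → eqL (mask b (F b x y)) (mask b (G b x y))) h b x y p)

  isD : Bool → Loc → Bool
  isD b (loc ai al bj _ _ _) = not ai ∧ (not al ∧ not bj)

  isL3 : Bool → Loc → Bool
  isL3 b (loc ai al bj cij clj _) = not ai ∧ (not al ∧ (not bj ∧ (not cij ∧ not clj)))

  isX : Bool → Loc → Bool
  isX b (loc ai al bj cij clj t) = not bj ∧ (not cij ∧ (not clj ∧ not (b ∧ t)))

  isY : Bool → Loc → Bool
  isY b (loc ai al bj cij clj t) = not ai ∧ (not al ∧ (not cij ∧ (not clj ∧ not (b ∧ t))))

  isW : Bool → Loc → Bool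
  isW b (loc ai al bj cij clj t) = not ai ∧ (not al ∧ (not bj ∧ not (b ∧ t)))

  loc-assoc-c : ∀ a₂ a₃ b₁ b₂ c₁ c₂ c₃ →
    (c₁ xor c₂ xor (a₂ ∧ b₁)) xor c₃ xor (a₃ ∧ (b₁ xor b₂))
    ≡ c₁ xor (c₂ xor c₃ xor (a₃ ∧ b₂)) xor ((a₂ xor a₃) ∧ b₁)
  loc-assoc-c = solve-∀ Bool-ring

  loc-assoc-t : ∀ a₂ a₃ l₂ l₃ b₁ b₂ c₁ c₂ d₁ d₂ t₁ t₂ t₃ →
    (t₁ xor t₂ xor (c₁ ∧ l₂) xor (d₁ ∧ a₂) xor (a₂ ∧ l₂ ∧ b₁)) xor t₃
      xor ((c₁ xor c₂ xor (a₂ ∧ b₁)) ∧ l₃) xor ((d₁ xor d₂ xor (l₂ ∧ b₁)) ∧ a₃) xor (a₃ ∧ l₃ ∧ (b₁ xor b₂))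
    ≡ t₁ xor (t₂ xor t₃ xor (c₂ ∧ l₃) xor (d₂ ∧ a₃) xor (a₃ ∧ l₃ ∧ b₂))
      xor (c₁ ∧ (l₂ xor l₃)) xor (d₁ ∧ (a₂ xor a₃)) xor ((a₂ xor a₃) ∧ (l₂ xor l₃) ∧ b₁)
  loc-assoc-t = solve-∀ Bool-ring

  loc-assoc : ∀ b x y z → mask b (loc-mul b (loc-mul b x y) z) ≡ mask b (loc-mul b x (loc-mul b y z))
  loc-assoc false (loc a₁ l₁ b₁ c₁ d₁ t₁) (loc a₂ l₂ b₂ c₂ d₂ t₂) (loc a₃ l₃ b₃ c₃ d₃ t₃) =
    loc≡ (xor-assoc a₁ a₂ a₃) (xor-assoc l₁ l₂ l₃) (xor-assoc b₁ b₂ b₃)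
         (loc-assoc-c a₂ a₃ b₁ b₂ c₁ c₂ c₃) (loc-assoc-c l₂ l₃ b₁ b₂ d₁ d₂ d₃) refl
  loc-assoc true (loc a₁ l₁ b₁ c₁ d₁ t₁) (loc a₂ l₂ b₂ c₂ d₂ t₂) (loc a₃ l₃ b₃ c₃ d₃ t₃) =
    loc≡ (xor-assoc a₁ a₂ a₃) (xor-assoc l₁ l₂ l₃) (xor-assoc b₁ b₂ b₃)
         (loc-assoc-c a₂ a₃ b₁ b₂ c₁ c₂ c₃) (loc-assoc-c l₂ l₃ b₁ b₂ d₁ d₂ d₃)
         (loc-assoc-t a₂ a₃ l₂ l₃ b₁ b₂ c₁ c₂ d₁ d₂ t₁ t₂ t₃)

  loc-mul-cong : ∀ b x x' y y' → mask b x ≡ mask b x' → mask b y ≡ mask b y' → mask b (loc-mul b x y) ≡ mask b (loc-mul b x' y')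
  loc-mul-cong true (loc _ _ _ _ _ _) (loc _ _ _ _ _ _) (loc _ _ _ _ _ _) (loc _ _ _ _ _ _) refl refl = refl
  loc-mul-cong false (loc _ _ _ _ _ _) (loc _ _ _ _ _ _) (loc _ _ _ _ _ _) (loc _ _ _ _ _ _) refl refl = refl

  loc-inv-cong : ∀ b x x' → mask b x ≡ mask b x' → mask b (loc-inv b x) ≡ mask b (loc-inv b x')
  loc-inv-cong true (loc _ _ _ _ _ _) (loc _ _ _ _ _ _) refl = refl
  loc-inv-cong false (loc _ _ _ _ _ _) (loc _ _ _ _ _ _) refl = refl

  T-pair : ∀ {u v} → T u → T v → T (u ∧ v)
  T-pair {true} {true} _ _ = tt

  ≡⇒eqB : ∀ {x y} → x ≡ y → T (eqB x y)
  ≡⇒eqB {true} refl = tt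
  ≡⇒eqB {false} refl = tt

  both : (Bool → Loc → Bool) → (Bool → Loc → Bool) → Bool → Loc → Loc → Bool
  both P Q b x y = P b x ∧ Q b y

  loc-identityˡ : ∀ b x → mask b (loc-mul b loc-ε x) ≡ mask b x
  loc-identityˡ b x = exhaust-≡₁ (λ _ _ → true) (λ b x → loc-mul b loc-ε x) (λ _ x → x) tt b x tt

  loc-identityʳ : ∀ b x → mask b (loc-mul b x loc-ε) ≡ mask b x
  loc-identityʳ b x = exhaust-≡₁ (λ _ _ → true) (λ b x → loc-mul b x loc-ε) (λ _ x → x) tt b x tt

  loc-inverseʳ : ∀ b x → mask b (loc-mul b x (loc-inv b x)) ≡ mask b loc-ε
  loc-inverseʳ b x = exhaust-≡₁ (λ _ _ → true) (λ b x → loc-mul b x (loc-inv b x)) (λ _ _ → loc-ε) tt b x tt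

  loc-comm-D : ∀ b x y → T (isD b (loc-comm b x y))
  loc-comm-D b x y = exhaust-T₂ (λ _ _ _ → true) (λ b x y → isD b (loc-comm b x y)) tt b x y tt

  loc-comm-L3 : ∀ b x y → T (isD b x) → T (isL3 b (loc-comm b x y))
  loc-comm-L3 = exhaust-T₂ (λ b x _ → isD b x) (λ b x y → isL3 b (loc-comm b x y)) tt

  loc-comm-L3-trivial : ∀ b x y → T (isL3 b x) → mask b (loc-comm b x y) ≡ mask b loc-ε
  loc-comm-L3-trivial = exhaust-≡₂ (λ b x _ → isL3 b x) (λ b x y → loc-comm b x y) (λ _ _ _ → loc-ε) tt

  loc-L3-central : ∀ b x y → T (isL3 b x) → mask b (loc-mul b x y) ≡ mask b (loc-mul b y x)
  loc-L3-central = exhaust-≡₂ (λ b x _ → isL3 b x) (λ b x y → loc-mul b x y) (λ b x y → loc-mul b y x) tt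

  loc-conj-L3 : ∀ b x y → T (isL3 b x) → T (isL3 b (loc-mul b (loc-mul b (loc-inv b y) x) y))
  loc-conj-L3 = exhaust-T₂ (λ b x _ → isL3 b x) (λ b x y → isL3 b (loc-mul b (loc-mul b (loc-inv b y) x) y)) tt

  loc-sq-D : ∀ b x → T (isD b x) → mask b (loc-mul b x x) ≡ mask b loc-ε
  loc-sq-D = exhaust-≡₁ isD (λ b x → loc-mul b x x) (λ _ _ → loc-ε) tt

  loc-sq-X : ∀ b x → T (isX b x) → mask b (loc-mul b x x) ≡ mask b loc-ε
  loc-sq-X = exhaust-≡₁ isX (λ b x → loc-mul b x x) (λ _ _ → loc-ε) tt

  loc-sq-Y : ∀ b x → T (isY b x) → mask b (loc-mul b x x) ≡ mask b loc-ε
  loc-sq-Y = exhaust-≡₁ isY (λ b x → loc-mul b x x) (λ _ _ → loc-ε) tt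

  loc-comm-D-Y : ∀ b x y → T (isD b x) → T (isY b y) → mask b (loc-comm b x y) ≡ mask b loc-ε
  loc-comm-D-Y b x y p q = exhaust-≡₂ (both isD isY) (λ b x y → loc-comm b x y) (λ _ _ _ → loc-ε) tt b x y (T-pair p q)

  loc-comm-X-X : ∀ b x y → T (isX b x) → T (isX b y) → mask b (loc-comm b x y) ≡ mask b loc-ε
  loc-comm-X-X b x y p q = exhaust-≡₂ (both isX isX) (λ b x y → loc-comm b x y) (λ _ _ _ → loc-ε) tt b x y (T-pair p q)

  loc-comm-Y-Y : ∀ b x y → T (isY b x) → T (isY b y) → mask b (loc-comm b x y) ≡ mask b loc-ε
  loc-comm-Y-Y b x y p q = exhaust-≡₂ (both isY isY) (λ b x y → loc-comm b x y) (λ _ _ _ → loc-ε) tt b x y (T-pair p q)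

  loc-comm-X-Y-c : ∀ b x y → T (isX b x) → T (isY b y) → cij (loc-comm b x y) ≡ ai x ∧ bj y
  loc-comm-X-Y-c b x y p q =
    eqB-T (exhaust-T₂ (both isX isY) (λ b x y → eqB (cij (loc-comm b x y)) (ai x ∧ bj y)) tt b x y (T-pair p q))

  loc-conj-W : ∀ b x y → T (isW b x) → T (isD b y) → T (isW b (loc-mul b (loc-mul b (loc-inv b y) x) y))
  loc-conj-W b x y p q = exhaust-T₂ (both isW isD) (λ b x y → isW b (loc-mul b (loc-mul b (loc-inv b y) x) y)) tt b x y (T-pair p q)

  loc-W∩L3-trivial : ∀ b x → T (isW b x) → T (isL3 b x) → mask b x ≡ mask b loc-ε
  loc-W∩L3-trivial b x p q = exhaust-≡₁ (λ b x → isW b x ∧ isL3 b x) (λ _ x → x) (λ _ _ → loc-ε) tt b x (T-pair p q)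

  loc-mul-X : ∀ b x y → T (isX b x) → T (isX b y) → T (isX b (loc-mul b x y))
  loc-mul-X b x y p q = exhaust-T₂ (both isX isX) (λ b x y → isX b (loc-mul b x y)) tt b x y (T-pair p q)

  loc-mul-Y : ∀ b x y → T (isY b x) → T (isY b y) → T (isY b (loc-mul b x y))
  loc-mul-Y b x y p q = exhaust-T₂ (both isY isY) (λ b x y → isY b (loc-mul b x y)) tt b x y (T-pair p q)

  loc-mul-D : ∀ b x y → T (isD b x) → T (isD b y) → T (isD b (loc-mul b x y))
  loc-mul-D b x y p q = exhaust-T₂ (both isD isD) (λ b x y → isD b (loc-mul b x y)) tt b x y (T-pair p q)

  loc-mul-L3 : ∀ b x y → T (isL3 b x) → T (isL3 b y) → T (isL3 b (loc-mul b x y))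
  loc-mul-L3 b x y p q = exhaust-T₂ (both isL3 isL3) (λ b x y → isL3 b (loc-mul b x y)) tt b x y (T-pair p q)

  loc-mul-W : ∀ b x y → T (isW b x) → T (isW b y) → T (isW b (loc-mul b x y))
  loc-mul-W b x y p q = exhaust-T₂ (both isW isW) (λ b x y → isW b (loc-mul b x y)) tt b x y (T-pair p q)

  loc-inv-X : ∀ b x → T (isX b x) → T (isX b (loc-inv b x))
  loc-inv-X = exhaust-T₁ isX (λ b x → isX b (loc-inv b x)) tt
  loc-inv-Y : ∀ b x → T (isY b x) → T (isY b (loc-inv b x))
  loc-inv-Y = exhaust-T₁ isY (λ b x → isY b (loc-inv b x)) tt
  loc-inv-D : ∀ b x → T (isD b x) → T (isD b (loc-inv b x))
  loc-inv-D = exhaust-T₁ isD (λ b x → isD b (loc-inv b x)) tt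
  loc-inv-L3 : ∀ b x → T (isL3 b x) → T (isL3 b (loc-inv b x))
  loc-inv-L3 = exhaust-T₁ isL3 (λ b x → isL3 b (loc-inv b x)) tt
  loc-inv-W : ∀ b x → T (isW b x) → T (isW b (loc-inv b x))
  loc-inv-W = exhaust-T₁ isW (λ b x → isW b (loc-inv b x)) tt

  loc-same-ab-D : ∀ b x y → ai x ≡ ai y → al x ≡ al y → bj x ≡ bj y → T (isD b (loc-mul b (loc-inv b x) y))
  loc-same-ab-D b x y p q r =
    exhaust-T₂ (λ _ x y → eqB (ai x) (ai y) ∧ (eqB (al x) (al y) ∧ eqB (bj x) (bj y)))
               (λ b x y → isD b (loc-mul b (loc-inv b x) y)) tt b x y (T-pair (≡⇒eqB p) (T-pair (≡⇒eqB q) (≡⇒eqB r)))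

  loc-D-same-a : ∀ b x y → T (isD b (loc-mul b (loc-inv b x) y)) → ai x ≡ ai y
  loc-D-same-a b x y p = eqB-T (exhaust-T₂ (λ b x y → isD b (loc-mul b (loc-inv b x) y)) (λ _ x y → eqB (ai x) (ai y)) tt b x y p)

  loc-D-same-b : ∀ b x y → T (isD b (loc-mul b (loc-inv b x) y)) → bj x ≡ bj y
  loc-D-same-b b x y p = eqB-T (exhaust-T₂ (λ b x y → isD b (loc-mul b (loc-inv b x) y)) (λ _ x y → eqB (bj x) (bj y)) tt b x y p)

  loc-same-c-L3 : ∀ b x y → T (isD b x) → T (isD b y) → cij x ≡ cij y → clj x ≡ clj y →
                  T (isL3 b (loc-mul b (loc-inv b x) y))
  loc-same-c-L3 b x y p q r s =
    exhaust-T₂ (λ b x y → isD b x ∧ (isD b y ∧ (eqB (cij x) (cij y) ∧ eqB (clj x) (clj y))))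
               (λ b x y → isL3 b (loc-mul b (loc-inv b x) y)) tt b x y (T-pair p (T-pair q (T-pair (≡⇒eqB r) (≡⇒eqB s))))

  mask-resp : (P : Bool → Loc → Bool) → (∀ b x → P b (mask b x) ≡ P b x) →
          ∀ b x y → mask b x ≡ mask b y → T (P b x) → T (P b y)
  mask-resp P pm b x y e h = subst T (pm b y) (subst (λ z → T (P b z)) e (subst T (sym (pm b x)) h))

  isX-mask : ∀ b x → isX b (mask b x) ≡ isX b x
  isX-mask true (loc _ _ _ _ _ _) = refl
  isX-mask false (loc _ _ _ _ _ _) = refl
  isY-mask : ∀ b x → isY b (mask b x) ≡ isY b x
  isY-mask true (loc _ _ _ _ _ _) = refl
  isY-mask false (loc _ _ _ _ _ _) = refl
  isD-mask : ∀ b x → isD b (mask b x) ≡ isD b x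
  isD-mask true (loc _ _ _ _ _ _) = refl
  isD-mask false (loc _ _ _ _ _ _) = refl
  isL3-mask : ∀ b x → isL3 b (mask b x) ≡ isL3 b x
  isL3-mask true (loc _ _ _ _ _ _) = refl
  isL3-mask false (loc _ _ _ _ _ _) = refl
  isW-mask : ∀ b x → isW b (mask b x) ≡ isW b x
  isW-mask true (loc _ _ _ _ _ _) = refl
  isW-mask false (loc _ _ _ _ _ _) = refl

  -- Local coordinates of x_k and y_k at a triple (i, j, l): u1 = [k = i], u2 = [k = l], v = [k = j].
  loc-x : Bool → Bool → Loc
  loc-x u1 u2 = loc u1 u2 false false false false
  loc-y : Bool → Loc
  loc-y v = loc false false v false false false

  loc-w· : Bool → Bool → Bool → Bool → Loc → Loc
  loc-w· b u1 u2 v R = loc-mul b (loc-x u1 u2) (loc-mul b (loc-y v) (loc-mul b (loc-x u1 u2) (loc-mul b (loc-y v) R)))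

  loc-t· : Bool → Bool → Bool → Bool → Bool → Bool → Loc → Loc
  loc-t· b u1 u2 v w1 w2 R = loc-w· b u1 u2 v (loc-mul b (loc-x w1 w2) (loc-w· b u1 u2 v (loc-mul b (loc-x w1 w2) R)))

  allVec : ∀ k → (Vec Bool k → Bool) → Bool
  allVec zero p = p []
  allVec (suc k) p = allBool (λ x → allVec k (λ v → p (x ∷ v)))

  allVec-T : ∀ k p → T (allVec k p) → ∀ v → T (p v)
  allVec-T zero p h [] = h
  allVec-T (suc k) p h (x ∷ v) = allVec-T k (λ v → p (x ∷ v)) (allBool-T (λ x → allVec k (λ v → p (x ∷ v))) h x) v

  loc-w·-check : Vec Bool 4 → Loc → Bool
  loc-w·-check (b ∷ u1 ∷ u2 ∷ v ∷ []) R =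
    implies (not (b ∧ (u1 ∧ u2)) ∧ isD b R)
            (eqL (mask b (loc-w· b u1 u2 v R)) (mask b (loc false false false ((u1 ∧ v) xor cij R) ((u2 ∧ v) xor clj R) (tijl R))))

  loc-w·-eval : ∀ b u1 u2 v R → T (not (b ∧ (u1 ∧ u2))) → T (isD b R) →
                mask b (loc-w· b u1 u2 v R) ≡ mask b (loc false false false ((u1 ∧ v) xor cij R) ((u2 ∧ v) xor clj R) (tijl R))
  loc-w·-eval b u1 u2 v R p q =
    eqL-T (implies-T {not (b ∧ (u1 ∧ u2)) ∧ isD b R}
      (allLoc-T (loc-w·-check (b ∷ u1 ∷ u2 ∷ v ∷ [])) (allVec-T 4 (λ vs → allLoc (loc-w·-check vs)) tt (b ∷ u1 ∷ u2 ∷ v ∷ [])) R)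
      (T-pair p q))

  loc-t·-check : Vec Bool 6 → Loc → Bool
  loc-t·-check (b ∷ u1 ∷ u2 ∷ v ∷ w1 ∷ w2 ∷ []) R =
    implies (not (b ∧ (u1 ∧ u2)) ∧ (not (b ∧ (w1 ∧ w2)) ∧ isD b R))
            (eqL (mask b (loc-t· b u1 u2 v w1 w2 R)) (mask b (loc false false false (cij R) (clj R) ((v ∧ ((u1 ∧ w2) xor (u2 ∧ w1))) xor tijl R))))

  loc-t·-eval : ∀ b u1 u2 v w1 w2 R → T (not (b ∧ (u1 ∧ u2))) → T (not (b ∧ (w1 ∧ w2))) → T (isD b R) →
                mask b (loc-t· b u1 u2 v w1 w2 R) ≡ mask b (loc false false false (cij R) (clj R) ((v ∧ ((u1 ∧ w2) xor (u2 ∧ w1))) xor tijl R))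
  loc-t·-eval b u1 u2 v w1 w2 R p p' q =
    eqL-T (implies-T {not (b ∧ (u1 ∧ u2)) ∧ (not (b ∧ (w1 ∧ w2)) ∧ isD b R)}
      (allLoc-T (loc-t·-check (b ∷ u1 ∷ u2 ∷ v ∷ w1 ∷ w2 ∷ [])) (allVec-T 6 (λ vs → allLoc (loc-t·-check vs)) tt (b ∷ u1 ∷ u2 ∷ v ∷ w1 ∷ w2 ∷ [])) R)
      (T-pair p (T-pair p' q)))

  isD-ai : ∀ b x → T (isD b x) → ai x ≡ false
  isD-ai b (loc false _ _ _ _ _) _ = refl
  isD-ai b (loc true _ _ _ _ _) ()
  isD-bj : ∀ b x → T (isD b x) → bj x ≡ false
  isD-bj b (loc false false false _ _ _) _ = refl
  isD-bj b (loc true _ _ _ _ _) ()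
  isD-bj b (loc false true _ _ _ _) ()
  isD-bj b (loc false false true _ _ _) ()
  isL3-cij : ∀ b x → T (isL3 b x) → cij x ≡ false
  isL3-cij b (loc false false false false _ _) _ = refl
  isL3-cij b (loc true _ _ _ _ _) ()
  isL3-cij b (loc false true _ _ _ _) ()
  isL3-cij b (loc false false true _ _ _) ()
  isL3-cij b (loc false false false true _ _) ()
  isL3→D : ∀ b x → T (isL3 b x) → T (isD b x)
  isL3→D b (loc false false false _ _ _) _ = tt
  isL3→D b (loc true _ _ _ _ _) ()
  isL3→D b (loc false true _ _ _ _) ()
  isL3→D b (loc false false true _ _ _) ()
  isW→D : ∀ b x → T (isW b x) → T (isD b x)
  isW→D b (loc false false false _ _ _) _ = tt
  isW→D b (loc true _ _ _ _ _) ()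
  isW→D b (loc false true _ _ _ _) ()
  isW→D b (loc false false true _ _ _) ()
  isW-t : ∀ x → T (isW true x) → tijl x ≡ false
  isW-t (loc false false false _ _ false) _ = refl
  isW-t (loc true _ _ _ _ _) ()
  isW-t (loc false true _ _ _ _) ()
  isW-t (loc false false true _ _ _) ()
  isW-t (loc false false false _ _ true) ()
  isX-bj : ∀ b x → T (isX b x) → bj x ≡ false
  isX-bj b (loc _ _ false _ _ _) _ = refl
  isX-bj b (loc _ _ true _ _ _) ()
  isX-cij : ∀ b x → T (isX b x) → cij x ≡ false
  isX-cij b (loc _ _ false false _ _) _ = refl
  isX-cij b (loc _ _ true _ _ _) ()
  isX-cij b (loc _ _ false true _ _) ()
  isX-t : ∀ x → T (isX true x) → tijl x ≡ false
  isX-t (loc _ _ false false false false) _ = refl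
  isX-t (loc _ _ true _ _ _) ()
  isX-t (loc _ _ false true _ _) ()
  isX-t (loc _ _ false false true _) ()
  isX-t (loc _ _ false false false true) ()
  isY-ai : ∀ b x → T (isY b x) → ai x ≡ false
  isY-ai b (loc false _ _ _ _ _) _ = refl
  isY-ai b (loc true _ _ _ _ _) ()
  isY-cij : ∀ b x → T (isY b x) → cij x ≡ false
  isY-cij b (loc false false _ false _ _) _ = refl
  isY-cij b (loc true _ _ _ _ _) ()
  isY-cij b (loc false true _ _ _ _) ()
  isY-cij b (loc false false _ true _ _) ()
  isY-t : ∀ x → T (isY true x) → tijl x ≡ false
  isY-t (loc false false _ false false false) _ = refl
  isY-t (loc true _ _ _ _ _) ()
  isY-t (loc false true _ _ _ _) ()
  isY-t (loc false false _ true _ _) ()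
  isY-t (loc false false _ false true _) ()
  isY-t (loc false false _ false false true) ()

module ConcreteModel (n : ℕ) where

  open LocalGroup
  open import Data.Nat using (_<ᵇ_)
  open import Data.Fin using (Fin; toℕ)
  open import Data.Fin.Properties using (_≟_)
  open import Data.Bool using (Bool; false; _xor_; _∧_; T)
  open import Relation.Nullary using (does)
  open import Relation.Binary.PropositionalEquality

  eqF : Fin n → Fin n → Bool
  eqF i j = does (i ≟ j)

  lt : Fin n → Fin n → Bool
  lt i l = toℕ i <ᵇ toℕ l

  record M : Set where
    constructor mk
    field
      a b : Fin n → Bool
      c : Fin n → Fin n → Bool
      t : Fin n → Fin n → Fin n → Bool
  open M public

  locOf : M → Fin n → Fin n → Fin n → Loc
  locOf g i j l = loc (a g i) (a g l) (b g j) (c g i j) (c g l j) (t g i j l)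

  -- t g i j l is junk unless i < l.
  _≐_ : M → M → Set
  g ≐ h = ∀ i j l → mask (lt i l) (locOf g i j l) ≡ mask (lt i l) (locOf h i j l)
  infix 4 _≐_

  ≐-refl : ∀ {g} → g ≐ g
  ≐-refl i j l = refl
  ≐-sym : ∀ {g h} → g ≐ h → h ≐ g
  ≐-sym p i j l = sym (p i j l)
  ≐-trans : ∀ {g h k} → g ≐ h → h ≐ k → g ≐ k
  ≐-trans p q i j l = trans (p i j l) (q i j l)

  e : M
  e = mk (λ _ → false) (λ _ → false) (λ _ _ → false) (λ _ _ _ → false)

  -- Moving y^b past x^a' creates the commutator exponents a'_i b_j, and moving the resulting
  -- commutators past x^a' creates the t-terms.
  _*_ : M → M → M
  g * h = mk (λ i → a g i xor a h i) (λ j → b g j xor b h j)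
             (λ i j → c g i j xor c h i j xor (a h i ∧ b g j))
             (λ i j l → lt i l ∧ (t g i j l xor t h i j l xor (c g i j ∧ a h l) xor (c g l j ∧ a h i) xor (a h i ∧ a h l ∧ b g j)))
  infixl 7 _*_

  I : M → M
  I g = mk (a g) (b g) (λ i j → c g i j xor (a g i ∧ b g j))
           (λ i j l → lt i l ∧ (t g i j l xor (c g i j ∧ a g l) xor (c g l j ∧ a g i) xor (a g i ∧ a g l ∧ b g j)))

  commᴹ : M → M → M
  commᴹ g h = I g * I h * g * h

  *-cong : ∀ {g g' h h'} → g ≐ g' → h ≐ h' → g * h ≐ g' * h'
  *-cong {g} {g'} {h} {h'} p q i j l = loc-mul-cong (lt i l) (locOf g i j l) (locOf g' i j l) (locOf h i j l) (locOf h' i j l) (p i j l) (q i j l)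

  I-cong : ∀ {g g'} → g ≐ g' → I g ≐ I g'
  I-cong {g} {g'} p i j l = loc-inv-cong (lt i l) (locOf g i j l) (locOf g' i j l) (p i j l)

  *-assoc : ∀ g h k → g * h * k ≐ g * (h * k)
  *-assoc g h k i j l = loc-assoc (lt i l) (locOf g i j l) (locOf h i j l) (locOf k i j l)

  *-idl : ∀ g → e * g ≐ g
  *-idl g i j l = loc-identityˡ (lt i l) (locOf g i j l)
  *-idr : ∀ g → g * e ≐ g
  *-idr g i j l = loc-identityʳ (lt i l) (locOf g i j l)
  *-invr : ∀ g → g * I g ≐ e
  *-invr g i j l = loc-inverseʳ (lt i l) (locOf g i j l)

  Locally : (Bool → Loc → Bool) → M → Set
  Locally P g = ∀ i j l → T (P (lt i l) (locOf g i j l))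

  Xᴹ Yᴹ Derᴹ LC₃ᴹ Wᴹ : M → Set
  Xᴹ = Locally isX
  Yᴹ = Locally isY
  Derᴹ = Locally isD
  LC₃ᴹ = Locally isL3
  Wᴹ = Locally isW

  Locally-resp : (P : Bool → Loc → Bool) → (∀ b x → P b (mask b x) ≡ P b x) → ∀ {g h} → g ≐ h → Locally P g → Locally P h
  Locally-resp P pm {g} {h} p q i j l = mask-resp P pm (lt i l) (locOf g i j l) (locOf h i j l) (p i j l) (q i j l)

  Xᴹ-resp : ∀ {g h} → g ≐ h → Xᴹ g → Xᴹ h
  Xᴹ-resp = Locally-resp isX isX-mask
  Yᴹ-resp : ∀ {g h} → g ≐ h → Yᴹ g → Yᴹ h
  Yᴹ-resp = Locally-resp isY isY-mask
  Derᴹ-resp : ∀ {g h} → g ≐ h → Derᴹ g → Derᴹ h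
  Derᴹ-resp = Locally-resp isD isD-mask
  LC₃ᴹ-resp : ∀ {g h} → g ≐ h → LC₃ᴹ g → LC₃ᴹ h
  LC₃ᴹ-resp = Locally-resp isL3 isL3-mask
  Wᴹ-resp : ∀ {g h} → g ≐ h → Wᴹ g → Wᴹ h
  Wᴹ-resp = Locally-resp isW isW-mask

  commᴹ-Der : ∀ g h → Derᴹ (commᴹ g h)
  commᴹ-Der g h i j l = loc-comm-D (lt i l) (locOf g i j l) (locOf h i j l)

  commᴹ-LC₃ : ∀ g h → Derᴹ g → LC₃ᴹ (commᴹ g h)
  commᴹ-LC₃ g h p i j l = loc-comm-L3 (lt i l) (locOf g i j l) (locOf h i j l) (p i j l)

  commᴹ-LC₃-trivial : ∀ g h → LC₃ᴹ g → commᴹ g h ≐ e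
  commᴹ-LC₃-trivial g h p i j l = loc-comm-L3-trivial (lt i l) (locOf g i j l) (locOf h i j l) (p i j l)

  sqᴹ-Der : ∀ g → Derᴹ g → g * g ≐ e
  sqᴹ-Der g p i j l = loc-sq-D (lt i l) (locOf g i j l) (p i j l)

  LC₃ᴹ-central : ∀ g h → LC₃ᴹ g → g * h ≐ h * g
  LC₃ᴹ-central g h p i j l = loc-L3-central (lt i l) (locOf g i j l) (locOf h i j l) (p i j l)

  commᴹ-Der-Y : ∀ g h → Derᴹ g → Yᴹ h → commᴹ g h ≐ e
  commᴹ-Der-Y g h p q i j l = loc-comm-D-Y (lt i l) (locOf g i j l) (locOf h i j l) (p i j l) (q i j l)

  commᴹ-X-X : ∀ g h → Xᴹ g → Xᴹ h → commᴹ g h ≐ e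
  commᴹ-X-X g h p q i j l = loc-comm-X-X (lt i l) (locOf g i j l) (locOf h i j l) (p i j l) (q i j l)

  commᴹ-Y-Y : ∀ g h → Yᴹ g → Yᴹ h → commᴹ g h ≐ e
  commᴹ-Y-Y g h p q i j l = loc-comm-Y-Y (lt i l) (locOf g i j l) (locOf h i j l) (p i j l) (q i j l)

  sqᴹ-X : ∀ g → Xᴹ g → g * g ≐ e
  sqᴹ-X g p i j l = loc-sq-X (lt i l) (locOf g i j l) (p i j l)
  sqᴹ-Y : ∀ g → Yᴹ g → g * g ≐ e
  sqᴹ-Y g p i j l = loc-sq-Y (lt i l) (locOf g i j l) (p i j l)

  Xᴹ-* : ∀ g h → Xᴹ g → Xᴹ h → Xᴹ (g * h)
  Xᴹ-* g h p q i j l = loc-mul-X (lt i l) (locOf g i j l) (locOf h i j l) (p i j l) (q i j l)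
  Yᴹ-* : ∀ g h → Yᴹ g → Yᴹ h → Yᴹ (g * h)
  Yᴹ-* g h p q i j l = loc-mul-Y (lt i l) (locOf g i j l) (locOf h i j l) (p i j l) (q i j l)
  Derᴹ-* : ∀ g h → Derᴹ g → Derᴹ h → Derᴹ (g * h)
  Derᴹ-* g h p q i j l = loc-mul-D (lt i l) (locOf g i j l) (locOf h i j l) (p i j l) (q i j l)
  LC₃ᴹ-* : ∀ g h → LC₃ᴹ g → LC₃ᴹ h → LC₃ᴹ (g * h)
  LC₃ᴹ-* g h p q i j l = loc-mul-L3 (lt i l) (locOf g i j l) (locOf h i j l) (p i j l) (q i j l)
  Wᴹ-* : ∀ g h → Wᴹ g → Wᴹ h → Wᴹ (g * h)
  Wᴹ-* g h p q i j l = loc-mul-W (lt i l) (locOf g i j l) (locOf h i j l) (p i j l) (q i j l)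
  Xᴹ-I : ∀ g → Xᴹ g → Xᴹ (I g)
  Xᴹ-I g p i j l = loc-inv-X (lt i l) (locOf g i j l) (p i j l)
  Yᴹ-I : ∀ g → Yᴹ g → Yᴹ (I g)
  Yᴹ-I g p i j l = loc-inv-Y (lt i l) (locOf g i j l) (p i j l)
  Derᴹ-I : ∀ g → Derᴹ g → Derᴹ (I g)
  Derᴹ-I g p i j l = loc-inv-D (lt i l) (locOf g i j l) (p i j l)
  LC₃ᴹ-I : ∀ g → LC₃ᴹ g → LC₃ᴹ (I g)
  LC₃ᴹ-I g p i j l = loc-inv-L3 (lt i l) (locOf g i j l) (p i j l)
  Wᴹ-I : ∀ g → Wᴹ g → Wᴹ (I g)
  Wᴹ-I g p i j l = loc-inv-W (lt i l) (locOf g i j l) (p i j l)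

module OrderedPairs where

  open import Data.Nat using (zero; suc; _+_; _*_; _∸_; _<_; _≤_; z<s; s<s)
  open import Data.Fin using (Fin; toℕ) renaming (zero to fz; suc to fs)
  open import Data.Product using (_×_; _,_; proj₁; proj₂)
  open import Data.Sum using (inj₁; inj₂)
  open import Data.List using (List; []; _++_; map; length; tabulate)
  open import Data.List.Properties using (length-++; length-map; length-tabulate)
  open import Data.List.Membership.Propositional using (_∈_)
  open import Data.List.Membership.Propositional.Properties using (∈-tabulate⁺; ∈-tabulate⁻; ∈-map⁺; ∈-map⁻; ∈-++⁺ˡ; ∈-++⁺ʳ; ∈-++⁻)
  open import Data.List.Relation.Unary.Unique.Propositional using (Unique)
  open import Data.List.Relation.Unary.AllPairs using ([])
  open import Data.List.Relation.Unary.Unique.Propositional.Properties using (tabulate⁺; map⁺; ++⁺)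
  open import Relation.Binary.PropositionalEquality
  open import Relation.Nullary using (¬_)
  open import Data.Nat.Tactic.RingSolver using (solve-∀)
  open import Data.Nat.DivMod using (_/_; m*n/n≡m)

  pairsFrom0 : ∀ m → List (Fin (suc m) × Fin (suc m))
  pairsFrom0 m = tabulate (λ k → (fz , fs k))

  shift : ∀ {m} → Fin m × Fin m → Fin (suc m) × Fin (suc m)
  shift p = (fs (proj₁ p) , fs (proj₂ p))

  orderedPairs : ∀ m → List (Fin m × Fin m)
  orderedPairs zero = []
  orderedPairs (suc m) = pairsFrom0 m ++ map shift (orderedPairs m)

  orderedPairs-< : ∀ m {i k} → (i , k) ∈ orderedPairs m → toℕ i < toℕ k
  orderedPairs-< (suc m) h with ∈-++⁻ (pairsFrom0 m) h
  ... | inj₁ h₀ with ∈-tabulate⁻ {f = λ k → (fz {m} , fs k)} h₀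
  ...   | _ , refl = z<s
  orderedPairs-< (suc m) h | inj₂ hₛ with ∈-map⁻ shift hₛ
  ...   | _ , h' , refl = s<s (orderedPairs-< m h')

  orderedPairs-∈ : ∀ m {i k : Fin m} → toℕ i < toℕ k → (i , k) ∈ orderedPairs m
  orderedPairs-∈ (suc m) {fz} {fs k} _ = ∈-++⁺ˡ (∈-tabulate⁺ {f = λ k → (fz , fs k)} k)
  orderedPairs-∈ (suc m) {fs i} {fs k} (s<s i<k) = ∈-++⁺ʳ (pairsFrom0 m) (∈-map⁺ shift (orderedPairs-∈ m i<k))

  orderedPairs-unique : ∀ m → Unique (orderedPairs m)
  orderedPairs-unique zero = []
  orderedPairs-unique (suc m) = ++⁺ (tabulate⁺ (λ { refl → refl })) (map⁺ (λ { refl → refl }) (orderedPairs-unique m)) disjoint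
    where
    disjoint : ∀ {v} → ¬ (v ∈ pairsFrom0 m × v ∈ map shift (orderedPairs m))
    disjoint (h₀ , hₛ) with ∈-tabulate⁻ {f = λ (k : Fin m) → (fz {m} , fs {m} k)} h₀ | ∈-map⁻ shift hₛ
    ... | _ , refl | _ , _ , ()

  orderedPairs-length : ∀ m → length (orderedPairs m) + length (orderedPairs m) ≡ m * (m ∸ 1)
  orderedPairs-length zero = refl
  orderedPairs-length (suc m) = subst (λ L → L + L ≡ suc m * m) (sym length-suc) (step m (length (orderedPairs m)) (orderedPairs-length m))
    where
    length-suc : length (orderedPairs (suc m)) ≡ m + length (orderedPairs m)
    length-suc = trans (length-++ (pairsFrom0 m)) (cong₂ _+_ (length-tabulate {n = m} (λ k → (fz {m} , fs k))) (length-map shift (orderedPairs m)))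
    step : ∀ m L → L + L ≡ m * (m ∸ 1) → m + L + (m + L) ≡ suc m * m
    step zero L h = h
    step (suc m) L h = trans (regroup m L) (trans (cong (λ z → suc m + suc m + z) h) (expand m))
      where
      regroup : ∀ m L → suc m + L + (suc m + L) ≡ suc m + suc m + (L + L)
      regroup = solve-∀
      expand : ∀ m → suc m + suc m + suc m * m ≡ suc (suc m) * suc m
      expand = solve-∀

  LC₃-dimension : ∀ n L → L + L ≡ n * (n ∸ 1) → L * n ≡ n * n * (n ∸ 1) / 2
  LC₃-dimension n L h = sym (trans (cong (_/ 2) doubled) (m*n/n≡m (L * n) 2))
    where
    reassoc : ∀ n k → n * n * k ≡ n * (n * k)
    reassoc = solve-∀
    regroup : ∀ n L → n * (L + L) ≡ L * n * 2
    regroup = solve-∀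
    doubled : n * n * (n ∸ 1) ≡ L * n * 2
    doubled = trans (reassoc n (n ∸ 1)) (trans (cong (n *_) (sym h)) (regroup n L))

  Der-dimension : ∀ n L → 1 ≤ n → L + L ≡ n * (n ∸ 1) → n * n + L * n ≡ n * n * (n + 1) / 2
  Der-dimension (suc n) L _ h = sym (trans (cong (_/ 2) doubled) (m*n/n≡m (suc n * suc n + L * suc n) 2))
    where
    expand : ∀ n → suc n * suc n * (suc n + 1) ≡ suc n * (suc n * n) + suc n * suc n * 2
    expand = solve-∀
    regroup : ∀ n L → suc n * (L + L) + suc n * suc n * 2 ≡ (suc n * suc n + L * suc n) * 2
    regroup = solve-∀
    doubled : suc n * suc n * (suc n + 1) ≡ (suc n * suc n + L * suc n) * 2
    doubled = trans (expand n) (trans (cong (λ z → suc n * z + suc n * suc n * 2) (sym h)) (regroup n L))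

module Presentation (n : ℕ) where

  open LocalGroup
  open import Defs
  open import Data.Fin using (Fin)
  open import Data.Bool using (true; false; not; _∧_) renaming (T to Tt)
  open import Data.Bool.Properties using (not-involutive)
  open import Data.Unit using (tt)
  open import Data.Sum using (inj₁; inj₂)
  open import Data.Product using (_,_)
  open import Data.List using ([]; _∷_; _++_; map)
  open import Data.List.Relation.Unary.All using ([]; _∷_)
  open OrderedPairs
  open import Data.List.Properties using (++-assoc; ++-identityʳ; unfold-reverse)
  open import Relation.Binary.PropositionalEquality

  open 𝓗 n public
  open ConcreteModel n public

  ≡⇒≈ : ∀ {u v} → u ≡ v → u ≈ v
  ≡⇒≈ refl = ≈-refl

  infixr 4 _⟫_
  _⟫_ : ∀ {u v w} → u ≈ v → v ≈ w → u ≈ w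
  _⟫_ = ≈-trans

  ·-assoc : ∀ u v w → u · v · w ≈ u · (v · w)
  ·-assoc u v w = ≡⇒≈ (++-assoc u v w)

  ·-assoc⁻ : ∀ u v w → u · (v · w) ≈ u · v · w
  ·-assoc⁻ u v w = ≈-sym (·-assoc u v w)

  ·-congˡ : ∀ u {v v'} → v ≈ v' → u · v ≈ u · v'
  ·-congˡ u p = ≈-cong (≈-refl {u}) p

  ·-congʳ : ∀ {v v'} → v ≈ v' → ∀ u → v · u ≈ v' · u
  ·-congʳ p u = ≈-cong p (≈-refl {u})

  ·-cong-mid : ∀ u {v v'} → v ≈ v' → ∀ w → u · v · w ≈ u · v' · w
  ·-cong-mid u p w = ≈-cong (≈-cong (≈-refl {u}) p) (≈-refl {w})

  ·-identityʳ : ∀ u → u · ε ≈ u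
  ·-identityʳ u = ≡⇒≈ (++-identityʳ u)

  flipL-involutive : ∀ l → flipL (flipL l) ≡ l
  flipL-involutive (g , b) = cong (g ,_) (not-involutive b)

  inv-∷ : ∀ l u → inv (l ∷ u) ≡ inv u · (flipL l ∷ [])
  inv-∷ l u = unfold-reverse (flipL l) (map flipL u)

  cancel⁻ : ∀ l → (flipL l ∷ l ∷ []) ≈ ε
  cancel⁻ l = ≈-trans (≡⇒≈ (cong (λ z → flipL l ∷ z ∷ []) (sym (flipL-involutive l)))) (≈-cancel (flipL l))

  inverseʳ : ∀ u → u · inv u ≈ ε
  inverseʳ [] = ≈-refl
  inverseʳ (l ∷ u) = ≡⇒≈ (cong (l ∷_) (trans (cong (u ++_) (inv-∷ l u)) (sym (++-assoc u (inv u) _))))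
    ⟫ ·-congˡ (l ∷ []) (·-congʳ (inverseʳ u) (flipL l ∷ [])) ⟫ ≈-cancel l

  inverseˡ : ∀ u → inv u · u ≈ ε
  inverseˡ [] = ≈-refl
  inverseˡ (l ∷ u) = ≡⇒≈ (trans (cong (_++ (l ∷ u)) (inv-∷ l u)) (++-assoc (inv u) (flipL l ∷ []) (l ∷ u)))
    ⟫ ≈-trans (·-congˡ (inv u) (≈-trans (≡⇒≈ refl) (·-congʳ (cancel⁻ l) u))) (inverseˡ u)

  cancelˡ : ∀ a {b c} → a · b ≈ a · c → b ≈ c
  cancelˡ a {b} {c} p = ≈-sym (·-congʳ (inverseˡ a) b) ⟫ ·-assoc (inv a) a b ⟫ ·-congˡ (inv a) p ⟫ ·-assoc⁻ (inv a) a c ⟫ ·-congʳ (inverseˡ a) c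

  commute-of-comm≈ε : ∀ a b → ⟦ a , b ⟧ ≈ ε → a · b ≈ b · a
  commute-of-comm≈ε a b p = cancelˡ (inv a · inv b) (≈-trans (≡⇒≈ (sym (++-assoc (inv a · inv b) a b))) (≈-trans p
     (≈-sym (≈-trans (≡⇒≈ (trans (++-assoc (inv a) (inv b) (b · a)) (cong (inv a ++_) (sym (++-assoc (inv b) b a)))))
        (≈-trans (·-congˡ (inv a) (·-congʳ (inverseˡ b) a)) (inverseˡ a))))))

  inv-of-involution : ∀ u → u · u ≈ ε → inv u ≈ u
  inv-of-involution u p = ≈-sym (·-identityʳ (inv u)) ⟫ ·-congˡ (inv u) (≈-sym p) ⟫ ·-assoc⁻ (inv u) u u ⟫ ·-congʳ (inverseˡ u) u

  inv-resp : ∀ {u v} → u ≈ v → inv u ≈ inv v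
  inv-resp {u} {v} p = ≈-sym (·-identityʳ (inv u)) ⟫ ·-congˡ (inv u) (≈-sym (inverseʳ v)) ⟫ ·-assoc⁻ (inv u) v (inv v)
      ⟫ ·-congʳ (·-congˡ (inv u) (≈-sym p) ⟫ inverseˡ u) (inv v)

  inverse-unique : ∀ {u v} → u · v ≈ ε → u ≈ inv v
  inverse-unique {u} {v} p = ≈-sym (·-identityʳ u) ⟫ ·-congˡ u (≈-sym (inverseʳ v)) ⟫ ·-assoc⁻ u v (inv v) ⟫ ·-congʳ p (inv v)

  gen²≈ε : ∀ z → gen z · gen z ≈ ε
  gen²≈ε z = ≈-rel (r-sq z)

  letter≈gen : ∀ z b → ((z , b) ∷ []) ≈ gen z
  letter≈gen z false = ≈-refl
  letter≈gen z true = ≈-sym (·-identityʳ _) ⟫ ·-congˡ ((z , true) ∷ []) (≈-sym (gen²≈ε z)) ⟫ ·-congʳ (≈-cancel (z , true)) (gen z)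

  infixr 4 _⊚_
  _⊚_ : ∀ {g h k} → g ≐ h → h ≐ k → g ≐ k
  _⊚_ {g} {h} {k} = ≐-trans {g} {h} {k}

  *-congˡ : ∀ g {h h'} → h ≐ h' → g * h ≐ g * h'
  *-congˡ g {h} {h'} p = *-cong {g} {g} {h} {h'} (≐-refl {g}) p
  *-congʳ : ∀ {h h'} → h ≐ h' → ∀ g → h * g ≐ h' * g
  *-congʳ {h} {h'} p g = *-cong {h} {h'} {g} {g} p (≐-refl {g})

  *-assoc⁻ : ∀ g h k → g * (h * k) ≐ g * h * k
  *-assoc⁻ g h k = ≐-sym {g * h * k} {g * (h * k)} (*-assoc g h k)

  I-unique : ∀ m g → m * g ≐ e → m ≐ I g
  I-unique m g p = ≐-sym {m * e} {m} (*-idr m) ⊚ *-congˡ m {e} {g * I g} (≐-sym {g * I g} {e} (*-invr g)) ⊚ *-assoc⁻ m g (I g)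
    ⊚ *-congʳ {m * g} {e} p (I g) ⊚ *-idl (I g)

  not-∧-false : ∀ b → Tt (not (b ∧ false))
  not-∧-false true = tt
  not-∧-false false = tt

  genᴹ : Gen → M
  genᴹ (inj₁ i) = mk (eqF i) (λ _ → false) (λ _ _ → false) (λ _ _ _ → false)
  genᴹ (inj₂ j) = mk (λ _ → false) (eqF j) (λ _ _ → false) (λ _ _ _ → false)

  eval : (Gen → M) → Word → M
  eval f [] = e
  eval f ((z , _) ∷ w) = f z * eval f w

  φ : Word → M
  φ = eval genᴹ

  record Admissible (f : Gen → M) : Set where
    constructor admissible
    field
      gx : ∀ i → Xᴹ (f (inj₁ i))
      gy : ∀ j → Yᴹ (f (inj₂ j))

  genᴹ-admissible : Admissible genᴹ
  genᴹ-admissible = admissible (λ i p j l → not-∧-false (lt p l)) (λ i p j l → not-∧-false (lt p l))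

  admissible-sq : ∀ {f} → Admissible f → ∀ z → f z * f z ≐ e
  admissible-sq {f} (admissible gx gy) (inj₁ i) = sqᴹ-X (f (inj₁ i)) (gx i)
  admissible-sq {f} (admissible gx gy) (inj₂ j) = sqᴹ-Y (f (inj₂ j)) (gy j)

  eval-· : ∀ f u v → eval f (u · v) ≐ eval f u * eval f v
  eval-· f [] v = ≐-sym {e * eval f v} {eval f v} (*-idl (eval f v))
  eval-· f ((z , _) ∷ u) v = *-congˡ (f z) {eval f (u · v)} {eval f u * eval f v} (eval-· f u v) ⊚ *-assoc⁻ (f z) (eval f u) (eval f v)

  eval-inverseˡ : ∀ {f} → Admissible f → ∀ u → eval f (inv u) * eval f u ≐ e
  eval-inverseˡ {f} G [] = *-idl e
  eval-inverseˡ {f} G ((z , b) ∷ u) rewrite inv-∷ (z , b) u =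
    *-congʳ {eval f (inv u · ((z , not b) ∷ []))} {eval f (inv u) * (f z * e)} (eval-· f (inv u) ((z , not b) ∷ [])) (f z * eval f u)
    ⊚ *-congʳ {eval f (inv u) * (f z * e)} {eval f (inv u) * f z} (*-congˡ (eval f (inv u)) {f z * e} {f z} (*-idr (f z))) (f z * eval f u)
    ⊚ *-assoc (eval f (inv u)) (f z) (f z * eval f u)
    ⊚ *-congˡ (eval f (inv u)) {f z * (f z * eval f u)} {eval f u} (*-assoc⁻ (f z) (f z) (eval f u) ⊚ *-congʳ {f z * f z} {e} (admissible-sq G z) (eval f u)
        ⊚ *-idl (eval f u))
    ⊚ eval-inverseˡ G u

  eval-inv : ∀ {f} → Admissible f → ∀ u → eval f (inv u) ≐ I (eval f u)
  eval-inv {f} G u = I-unique (eval f (inv u)) (eval f u) (eval-inverseˡ G u)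

  eval-comm : ∀ {f} → Admissible f → ∀ u v → eval f ⟦ u , v ⟧ ≐ commᴹ (eval f u) (eval f v)
  eval-comm {f} G u v =
    eval-· f (inv u · inv v · u) v
    ⊚ *-congʳ {eval f (inv u · inv v · u)} {I (eval f u) * I (eval f v) * eval f u}
         (eval-· f (inv u · inv v) u ⊚ *-congʳ {eval f (inv u · inv v)} {I (eval f u) * I (eval f v)}
            (eval-· f (inv u) (inv v) ⊚ *-cong {eval f (inv u)} {I (eval f u)} {eval f (inv v)} {I (eval f v)} (eval-inv G u) (eval-inv G v)) (eval f u))
         (eval f v)

  eval-gen : ∀ f z → eval f (gen z) ≐ f z
  eval-gen f z = *-idr (f z)

  eval-resp : ∀ {f} → Admissible f → ∀ {u v} → u ≈ v → eval f u ≐ eval f v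
  eval-resp G ≈-refl = ≐-refl
  eval-resp G (≈-sym p) = ≐-sym (eval-resp G p)
  eval-resp G (≈-trans p q) = ≐-trans (eval-resp G p) (eval-resp G q)
  eval-resp {f} G (≈-cong {u} {u'} {v} {v'} p q) =
    eval-· f u v ⊚ *-cong {eval f u} {eval f u'} {eval f v} {eval f v'} (eval-resp G p) (eval-resp G q)
        ⊚ ≐-sym {eval f (u' · v')} {eval f u' * eval f v'} (eval-· f u' v')
  eval-resp {f} G (≈-cancel (z , b)) = *-congˡ (f z) {f z * e} {f z} (*-idr (f z)) ⊚ admissible-sq G z
  eval-resp {f} G (≈-rel r) = rel r
    where
    gx : ∀ i → Xᴹ (eval f (x i))
    gx i = Xᴹ-resp {f (inj₁ i)} {eval f (x i)} (≐-sym {eval f (x i)} {f (inj₁ i)} (eval-gen f (inj₁ i))) (Admissible.gx G i)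
    gy : ∀ i → Yᴹ (eval f (y i))
    gy i = Yᴹ-resp {f (inj₂ i)} {eval f (y i)} (≐-sym {eval f (y i)} {f (inj₂ i)} (eval-gen f (inj₂ i))) (Admissible.gy G i)
    sqw : ∀ w → Derᴹ (eval f w) → eval f (w · w) ≐ e
    sqw w d = eval-· f w w ⊚ sqᴹ-Der (eval f w) d
    cD : ∀ u v → Derᴹ (eval f ⟦ u , v ⟧)
    cD u v = Derᴹ-resp {commᴹ (eval f u) (eval f v)} {eval f ⟦ u , v ⟧} (≐-sym {eval f ⟦ u , v ⟧} {commᴹ (eval f u) (eval f v)} (eval-comm G u v))
        (commᴹ-Der (eval f u) (eval f v))
    rel : ∀ {r} → Relator r → eval f r ≐ e
    rel (r-sq z) = eval-· f (gen z) (gen z) ⊚ *-cong {eval f (gen z)} {f z} {eval f (gen z)} {f z} (eval-gen f z) (eval-gen f z) ⊚ admissible-sq G z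
    rel (r-xx i i') = eval-comm G (x i) (x i') ⊚ commᴹ-X-X (eval f (x i)) (eval f (x i')) (gx i) (gx i')
    rel (r-yy j j') = eval-comm G (y j) (y j') ⊚ commᴹ-Y-Y (eval f (y j)) (eval f (y j')) (gy j) (gy j')
    rel (r-xy² i j) = sqw ⟦ x i , y j ⟧ (cD (x i) (y j))
    rel (r-yxy j i j') = eval-comm G ⟦ y j , x i ⟧ (y j') ⊚ commᴹ-Der-Y (eval f ⟦ y j , x i ⟧) (eval f (y j')) (cD (y j) (x i)) (gy j')
    rel (r-xyz² i j z) = sqw ⟦ ⟦ x i , y j ⟧ , gen z ⟧ (cD ⟦ x i , y j ⟧ (gen z))
    rel (r-zzzz z z' z'' z''') = eval-comm G ⟦ ⟦ gen z , gen z' ⟧ , gen z'' ⟧ (gen z''')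
      ⊚ commᴹ-LC₃-trivial (eval f ⟦ ⟦ gen z , gen z' ⟧ , gen z'' ⟧) (eval f (gen z''')) (LC₃ᴹ-resp {commᴹ (eval f ⟦ gen z , gen z' ⟧) (eval f (gen z''))}
          {eval f ⟦ ⟦ gen z , gen z' ⟧ , gen z'' ⟧}
                   (≐-sym {eval f ⟦ ⟦ gen z , gen z' ⟧ , gen z'' ⟧} {commᴹ (eval f ⟦ gen z , gen z' ⟧) (eval f (gen z''))} (eval-comm G ⟦ gen z , gen z' ⟧ (gen z'')))
                   (commᴹ-LC₃ (eval f ⟦ gen z , gen z' ⟧) (eval f (gen z'')) (cD (gen z) (gen z'))))

  φ-resp : ∀ {u v} → u ≈ v → φ u ≐ φ v
  φ-resp = eval-resp genᴹ-admissible

  cancel-mid : ∀ u {v} w → v ≈ ε → u · v · w ≈ u · w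
  cancel-mid u {v} w p = ·-cong-mid u p w ⟫ ·-congʳ (·-identityʳ u) w

  insert-mid : ∀ u {v} w → v ≈ ε → u · w ≈ u · v · w
  insert-mid u w p = ≈-sym (cancel-mid u w p)

  x²≈ε : ∀ i → x i · x i ≈ ε
  x²≈ε i = gen²≈ε (inj₁ i)
  y²≈ε : ∀ j → y j · y j ≈ ε
  y²≈ε j = gen²≈ε (inj₂ j)

  x-comm : ∀ i k → x i · x k ≈ x k · x i
  x-comm i k = commute-of-comm≈ε (x i) (x k) (≈-rel (r-xx i k))
  y-comm : ∀ i k → y i · y k ≈ y k · y i
  y-comm i k = commute-of-comm≈ε (y i) (y k) (≈-rel (r-yy i k))

  -- [x_i, y_j] and [[x_i, y_j], x_k] written without inverses, the generators being involutions.
  w : Fin n → Fin n → Word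
  w i j = x i · y j · x i · y j

  tw : Fin n → Fin n → Fin n → Word
  tw i j k = w i j · x k · w i j · x k

  comm-xy≈w : ∀ i j → ⟦ x i , y j ⟧ ≈ w i j
  comm-xy≈w i j = ≈-cong (letter≈gen (inj₁ i) true) (≈-cong (letter≈gen (inj₂ j) true) (≈-refl {x i · y j}))

  w²≈ε : ∀ i j → w i j · w i j ≈ ε
  w²≈ε i j = ≈-sym (≈-cong (comm-xy≈w i j) (comm-xy≈w i j)) ⟫ ≈-rel (r-xy² i j)

  inv-comm-xy≈w : ∀ i j → inv ⟦ x i , y j ⟧ ≈ w i j
  inv-comm-xy≈w i j = inv-of-involution ⟦ x i , y j ⟧ (≈-rel (r-xy² i j)) ⟫ comm-xy≈w i j

  comm3≈tw : ∀ i j k → ⟦ ⟦ x i , y j ⟧ , x k ⟧ ≈ tw i j k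
  comm3≈tw i j k = ≈-cong (≈-cong (≈-cong (inv-comm-xy≈w i j) (letter≈gen (inj₁ k) true)) (comm-xy≈w i j)) (≈-refl {x k})

  tw²≈ε : ∀ i j k → tw i j k · tw i j k ≈ ε
  tw²≈ε i j k = ≈-sym (≈-cong (comm3≈tw i j k) (comm3≈tw i j k)) ⟫ ≈-rel (r-xyz² i j (inj₁ k))

  tw-gen-comm : ∀ i j k z → tw i j k · gen z ≈ gen z · tw i j k
  tw-gen-comm i j k z = ·-congʳ (≈-sym (comm3≈tw i j k)) (gen z)
    ⟫ commute-of-comm≈ε ⟦ ⟦ x i , y j ⟧ , x k ⟧ (gen z) (≈-rel (r-zzzz (inj₁ i) (inj₂ j) (inj₁ k) z))
    ⟫ ·-congˡ (gen z) (comm3≈tw i j k)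

  Central : Word → Set
  Central u = ∀ v → u · v ≈ v · u

  central-from-gens : ∀ u → (∀ z → u · gen z ≈ gen z · u) → Central u
  central-from-gens u h [] = ·-identityʳ u
  central-from-gens u h ((z , b) ∷ v) =
    ·-congˡ u (·-congʳ (letter≈gen z b) v) ⟫ ·-assoc⁻ u (gen z) v ⟫ ·-congʳ (h z) v ⟫ ·-assoc (gen z) u v ⟫ ·-congˡ (gen z) (central-from-gens u h v)
    ⟫ ·-assoc⁻ (gen z) v u ⟫ ·-congʳ (·-congʳ (≈-sym (letter≈gen z b)) v) u

  tw-central : ∀ i j k → Central (tw i j k)
  tw-central i j k = central-from-gens (tw i j k) (tw-gen-comm i j k)

  yxyx≈w : ∀ i j → y j · x i · y j · x i ≈ w i j
  yxyx≈w i j = insert-mid (y j · x i · y j · x i) (ε) (w²≈ε i j)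
    ⟫ cancel-mid (y j · x i · y j) (y j · x i · y j · x i · y j · x i · y j) (x²≈ε i)
    ⟫ cancel-mid (y j · x i) (x i · y j · x i · y j · x i · y j) (y²≈ε j)
    ⟫ cancel-mid (y j) (y j · x i · y j · x i · y j) (x²≈ε i)
    ⟫ cancel-mid ε (x i · y j · x i · y j) (y²≈ε j)

  yx≈xyw : ∀ i j → y j · x i ≈ x i · y j · w i j
  yx≈xyw i j = insert-mid (y j · x i) ε (w²≈ε i j)
    ⟫ cancel-mid (y j) (y j · x i · y j · x i · y j · x i · y j) (x²≈ε i)
    ⟫ cancel-mid ε (x i · y j · x i · y j · x i · y j) (y²≈ε j)

  wx≈xwtw : ∀ i j k → w i j · x k ≈ x k · w i j · tw i j k
  wx≈xwtw i j k = ≈-sym (cancel-mid (x k) (x k · w i j · x k) (w²≈ε i j) ⟫ cancel-mid ε (w i j · x k) (x²≈ε k))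

  wy≈yw : ∀ i j l → w i j · y l ≈ y l · w i j
  wy≈yw i j l = ·-congʳ (≈-sym (c1 ⟫ yxyx≈w i j)) (y l) ⟫ commute-of-comm≈ε ⟦ y j , x i ⟧ (y l) (≈-rel (r-yxy j i l)) ⟫ ·-congˡ (y l) (c1 ⟫ yxyx≈w i j)
    where
    c1 : ⟦ y j , x i ⟧ ≈ y j · x i · y j · x i
    c1 = ≈-cong (letter≈gen (inj₂ j) true) (≈-cong (letter≈gen (inj₁ i) true) (≈-refl {y j · x i}))

  w-comm : ∀ i j k l → w i j · w k l ≈ w k l · w i j
  w-comm i j k l =
    ·-cong-mid ε (wx≈xwtw i j k) (y l · x k · y l)
    ⟫ ·-cong-mid (x k · w i j) (tw-central i j k (y l)) (x k · y l)
    ⟫ ·-cong-mid (x k) (wy≈yw i j l) (tw i j k · x k · y l)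
    ⟫ ·-cong-mid (x k · y l · w i j) (tw-central i j k (x k)) (y l)
    ⟫ ·-cong-mid (x k · y l) (wx≈xwtw i j k) (tw i j k · y l)
    ⟫ cancel-mid (x k · y l · x k · w i j) (y l) (tw²≈ε i j k)
    ⟫ ·-cong-mid (x k · y l · x k) (wy≈yw i j l) ε

  yxx≈xxyww-tw : ∀ i j k → y j · x i · x k ≈ x i · x k · y j · w k j · w i j · tw i j k
  yxx≈xxyww-tw i j k = ·-cong-mid ε (yx≈xyw i j) (x k) ⟫ ·-cong-mid (x i · y j) (wx≈xwtw i j k) ε ⟫ ·-cong-mid (x i) (yx≈xyw k j) (w i j · tw i j k)

  -- Collect y_j x_i x_k in two ways.
  tw-sym : ∀ i j k → tw i j k ≈ tw k j i
  tw-sym i j k = cancelˡ (x i · x k · y j · w k j · w i j)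
    (≈-sym (yxx≈xxyww-tw i j k) ⟫ ·-congˡ (y j) (x-comm i k) ⟫ yxx≈xxyww-tw k j i
     ⟫ ·-cong-mid ε (x-comm k i) (y j · w i j · w k j · tw k j i)
     ⟫ ·-cong-mid (x i · x k · y j) (w-comm i j k j) (tw k j i))

  tw-diag : ∀ i j → tw i j i ≈ ε
  tw-diag i j = ≈-sym (cancelˡ (y j)
    (insert-mid (y j) ε (x²≈ε i) ⟫ yxx≈xxyww-tw i j i ⟫ cancel-mid ε (y j · w i j · w i j · tw i j i) (x²≈ε i) ⟫ cancel-mid (y j) (tw i j i) (w²≈ε i j)))

module NormalForm (n : ℕ) where

  open LocalGroup
  open import Defs
  open import Data.Nat using (suc)
  open import Data.Fin using (Fin; toℕ)
  open import Data.Bool using (Bool; true; false; _xor_; _∧_; _∨_) renaming (T to Tt)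
  open import Data.Sum using (inj₁; inj₂)
  open import Data.Product using (_×_; _,_; proj₁; proj₂)
  open import Data.List using (List; []; _∷_; _++_; map; length; zipWith)
  open import Data.List.Relation.Unary.All using (All; []; _∷_)
  import Data.List.Relation.Unary.All as All
  open import Data.List.Relation.Unary.Any using (here; there)
  open import Data.List.Relation.Unary.Unique.Propositional using (Unique)
  open import Data.List.Relation.Unary.AllPairs using ([]; _∷_)
  open import Data.List.Membership.Propositional using (_∈_)
  open import Data.Empty using (⊥-elim)
  open import Relation.Nullary using (yes; no)
  open OrderedPairs
  open import Data.Fin.Properties using (_≟_)
  open import Data.List using (allFin; cartesianProduct; cartesianProductWith)
  open import Data.List.Relation.Unary.Unique.Propositional.Properties using (allFin⁺; cartesianProduct⁺; cartesianProductWith⁺)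
  open import Data.List.Membership.Propositional.Properties using (∈-map⁺; ∈-++⁺ˡ; ∈-++⁺ʳ; ∈-allFin; ∈-cartesianProduct⁺; ∈-cartesianProductWith⁺;
      ∈-cartesianProductWith⁻)
  open import Data.Nat.Properties using (<⇒<ᵇ; <-cmp; <-asym; <-irrefl)
  open import Data.Bool.Properties using (xor-same; ∧-comm; ∧-zeroʳ; xor-identityʳ)
  open import Data.Fin.Properties using (toℕ-injective)
  open import Relation.Binary.Definitions using (Tri; tri<; tri≈; tri>)
  open import Tactic.RingSolver using (solve-∀)
  open import Tactic.MonoidSolver using (solve)
  open import Data.List.Properties using (++-monoid)
  open import Relation.Nullary using (Dec)
  open import Data.List.Properties using (++-assoc)
  open import Relation.Binary.PropositionalEquality

  open Presentation n public

  module InvolutionProducts {I : Set} (eqI : I → I → Bool)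
            (eqI-refl : ∀ i → eqI i i ≡ true)
            (eqI-≢ : ∀ {i j} → i ≢ j → eqI i j ≡ false)
            (g : I → Word) (gc : ∀ i j → g i · g j ≈ g j · g i) (gs : ∀ i → g i · g i ≈ ε) where

    pow : Bool → I → Word
    pow true i = g i
    pow false i = ε

    ∏ᵇ : List I → List Bool → Word
    ∏ᵇ [] _ = ε
    ∏ᵇ (_ ∷ _) [] = ε
    ∏ᵇ (i ∷ E) (b ∷ bs) = pow b i · ∏ᵇ E bs

    ∏ : List I → (I → Bool) → Word
    ∏ E f = ∏ᵇ E (map f E)

    pow-comm : ∀ h → (∀ i → g i · h ≈ h · g i) → ∀ b i → pow b i · h ≈ h · pow b i
    pow-comm h hc true i = hc i
    pow-comm h hc false i = ≈-sym (·-identityʳ h)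

    ∏ᵇ-comm : ∀ h → (∀ i → g i · h ≈ h · g i) → ∀ E bs → ∏ᵇ E bs · h ≈ h · ∏ᵇ E bs
    ∏ᵇ-comm h hc [] _ = ≈-sym (·-identityʳ h)
    ∏ᵇ-comm h hc (_ ∷ _) [] = ≈-sym (·-identityʳ h)
    ∏ᵇ-comm h hc (i ∷ E) (b ∷ bs) = ·-assoc (pow b i) (∏ᵇ E bs) h ⟫ ·-congˡ (pow b i) (∏ᵇ-comm h hc E bs) ⟫ ·-assoc⁻ (pow b i) h (∏ᵇ E bs)
      ⟫ ·-congʳ (pow-comm h hc b i) (∏ᵇ E bs) ⟫ ·-assoc h (pow b i) (∏ᵇ E bs)

    pow-xor : ∀ b b' i → pow (b xor b') i ≈ pow b i · pow b' i
    pow-xor true true i = ≈-sym (gs i)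
    pow-xor true false i = ≈-sym (·-identityʳ (g i))
    pow-xor false b' i = ≈-refl

    ∏ᵇ-xor : ∀ E bs bs' → length bs ≡ length bs' → ∏ᵇ E (zipWith _xor_ bs bs') ≈ ∏ᵇ E bs · ∏ᵇ E bs'
    ∏ᵇ-xor [] bs bs' _ = ≈-refl
    ∏ᵇ-xor (i ∷ E) [] [] _ = ≈-refl
    ∏ᵇ-xor (i ∷ E) (b ∷ bs) (b' ∷ bs') eq =
      ≈-cong (pow-xor b b' i) (∏ᵇ-xor E bs bs' (cong Data.Nat.pred eq))
      ⟫ ·-assoc (pow b i) (pow b' i) (∏ᵇ E bs · ∏ᵇ E bs') ⟫ ·-congˡ (pow b i) (·-assoc⁻ (pow b' i) (∏ᵇ E bs) (∏ᵇ E bs')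
      ⟫ ·-congʳ (≈-sym (∏ᵇ-comm (pow b' i) (λ j → ≈-sym (pow-comm (g j) (λ k → gc k j) b' i)) E bs)) (∏ᵇ E bs') ⟫ ·-assoc (∏ᵇ E bs) (pow b' i) (∏ᵇ E bs'))
      ⟫ ·-assoc⁻ (pow b i) (∏ᵇ E bs) (pow b' i · ∏ᵇ E bs')

    map-xor : ∀ (E : List I) (f f' : I → Bool) → zipWith _xor_ (map f E) (map f' E) ≡ map (λ τ → f τ xor f' τ) E
    map-xor [] f f' = refl
    map-xor (i ∷ E) f f' = cong (_ ∷_) (map-xor E f f')

    length-map-same : ∀ (E : List I) (f f' : I → Bool) → length (map f E) ≡ length (map f' E)
    length-map-same [] f f' = refl
    length-map-same (i ∷ E) f f' = cong suc (length-map-same E f f')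

    ∏-xor : ∀ E f f' → ∏ E (λ τ → f τ xor f' τ) ≈ ∏ E f · ∏ E f'
    ∏-xor E f f' = ≡⇒≈ (cong (∏ᵇ E) (sym (map-xor E f f'))) ⟫ ∏ᵇ-xor E (map f E) (map f' E) (length-map-same E f f')

    ∏-ext : ∀ E {f f'} → All (λ τ → f τ ≡ f' τ) E → ∏ E f ≡ ∏ E f'
    ∏-ext [] [] = refl
    ∏-ext (i ∷ E) {f} {f'} (p ∷ ps) = cong₂ (λ b z → pow b i · z) p (∏-ext E ps)

    ∏-zero : ∀ E {f} → All (λ τ → f τ ≡ false) E → ∏ E f ≡ ε
    ∏-zero [] [] = refl
    ∏-zero (i ∷ E) {f} (p ∷ ps) rewrite p = ∏-zero E ps

    ∏-comm : ∀ h → (∀ i → g i · h ≈ h · g i) → ∀ E f → ∏ E f · h ≈ h · ∏ E f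
    ∏-comm h hc E f = ∏ᵇ-comm h hc E (map f E)

    ∏-δ : ∀ E i → Unique E → i ∈ E → ∏ E (eqI i) ≈ g i
    ∏-δ (e ∷ E) .e (ne ∷ u) (here refl) rewrite eqI-refl e =
      ≡⇒≈ (cong (g e ·_) (∏-zero E (All.map (λ {τ} p → eqI-≢ p) ne))) ⟫ ·-identityʳ (g e)
    ∏-δ (e ∷ E) i (ne ∷ u) (there m) rewrite eqI-≢ {i} {e} (λ q → All.lookup ne (subst (_∈ E) q m) refl) = ∏-δ E i u m

    ∏-toggle : ∀ E i → Unique E → i ∈ E → ∀ f → g i · ∏ E f ≈ ∏ E (λ τ → eqI i τ xor f τ)
    ∏-toggle E i u m f = ·-congʳ (≈-sym (∏-δ E i u m)) (∏ E f) ⟫ ≈-sym (∏-xor E (eqI i) f)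

    ∏ᵇ-in : ∀ {S : Pred} E bs → All (λ τ → ⟨ S ⟩ (g τ)) E → ⟨ S ⟩ (∏ᵇ E bs)
    ∏ᵇ-in [] _ _ = one
    ∏ᵇ-in (_ ∷ _) [] _ = one
    ∏ᵇ-in (e ∷ E) (true ∷ bs) (p ∷ ps) = mul p (∏ᵇ-in E bs ps)
    ∏ᵇ-in (e ∷ E) (false ∷ bs) (p ∷ ps) = ∏ᵇ-in E bs ps

    ∏ᵇ-in-gens : ∀ {S : Pred} → (∀ i → ⟨ S ⟩ (g i)) → ∀ E bs → ⟨ S ⟩ (∏ᵇ E bs)
    ∏ᵇ-in-gens h E bs = ∏ᵇ-in E bs (All.tabulate (λ {τ} _ → h τ))

    all∏ : List I → List Word
    all∏ [] = ε ∷ []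
    all∏ (e ∷ E) = map (g e ·_) (all∏ E) ++ all∏ E

    ∏∈all∏ : ∀ E f → ∏ E f ∈ all∏ E
    ∏∈all∏ [] f = here refl
    ∏∈all∏ (e ∷ E) f with f e
    ... | true = ∈-++⁺ˡ (∈-map⁺ (g e ·_) (∏∈all∏ E f))
    ... | false = ∈-++⁺ʳ (map (g e ·_) (all∏ E)) (∏∈all∏ E f)

  eqF-refl : ∀ i → eqF i i ≡ true
  eqF-refl i with i ≟ i
  ... | yes _ = refl
  ... | no ¬p = ⊥-elim (¬p refl)

  eqF-≢ : ∀ {i j} → i ≢ j → eqF i j ≡ false
  eqF-≢ {i} {j} ne with i ≟ j
  ... | yes p = ⊥-elim (ne p)
  ... | no _ = refl

  IW IT : Set
  IW = Fin n × Fin n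
  IT = Fin n × Fin n × Fin n

  eqW : IW → IW → Bool
  eqW (i , j) (p , q) = eqF i p ∧ eqF j q
  eqT : IT → IT → Bool
  eqT (i , j , k) (p , q , r) = eqF i p ∧ (eqF j q ∧ eqF k r)

  eqW-refl : ∀ σ → eqW σ σ ≡ true
  eqW-refl (i , j) rewrite eqF-refl i | eqF-refl j = refl
  eqT-refl : ∀ τ → eqT τ τ ≡ true
  eqT-refl (i , j , k) rewrite eqF-refl i | eqF-refl j | eqF-refl k = refl

  eqW-≢ : ∀ {σ σ'} → σ ≢ σ' → eqW σ σ' ≡ false
  eqW-≢ {i , j} {p , q} ne with i ≟ p | j ≟ q
  ... | yes refl | yes refl = ⊥-elim (ne refl)
  ... | yes refl | no _ = refl
  ... | no _ | _ = refl

  eqT-≢ : ∀ {τ τ'} → τ ≢ τ' → eqT τ τ' ≡ false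
  eqT-≢ {i , j , k} {p , q , r} ne with i ≟ p | j ≟ q | k ≟ r
  ... | yes refl | yes refl | yes refl = ⊥-elim (ne refl)
  ... | yes refl | yes refl | no _ = refl
  ... | yes refl | no _ | _ = refl
  ... | no _ | _ | _ = refl

  EX : List (Fin n)
  EX = allFin n
  EW : List IW
  EW = cartesianProduct EX EX
  triple : Fin n × Fin n → Fin n → IT
  triple p j = (proj₁ p , j , proj₂ p)
  ET : List IT
  ET = cartesianProductWith triple (orderedPairs n) EX

  EX-unique : Unique EX
  EX-unique = allFin⁺ n
  EW-unique : Unique EW
  EW-unique = cartesianProduct⁺ EX-unique EX-unique
  ET-unique : Unique ET
  ET-unique = cartesianProductWith⁺ triple inj (orderedPairs-unique n) EX-unique
    where
    inj : ∀ {w x y z} → triple w y ≡ triple x z → w ≡ x × y ≡ z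
    inj {w₁ , w₂} {x₁ , x₂} refl = refl , refl

  EX-∈ : ∀ i → i ∈ EX
  EX-∈ i = ∈-allFin i
  EW-∈ : ∀ σ → σ ∈ EW
  EW-∈ (i , j) = ∈-cartesianProduct⁺ (∈-allFin i) (∈-allFin j)
  ET-∈ : ∀ i j l → toℕ i Data.Nat.< toℕ l → (i , j , l) ∈ ET
  ET-∈ i j l h = ∈-cartesianProductWith⁺ triple (orderedPairs-∈ n h) (∈-allFin j)

  T→≡ : ∀ {b} → Tt b → b ≡ true
  T→≡ {true} _ = refl

  ET-ltᵇ : ∀ {τ} → τ ∈ ET → lt (proj₁ τ) (proj₂ (proj₂ τ)) ≡ true
  ET-ltᵇ {τ} h with ∈-cartesianProductWith⁻ triple (orderedPairs n) EX h
  ... | (i , l) , j , m , _ , refl = T→≡ (<⇒<ᵇ (orderedPairs-< n m))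

  module PX = InvolutionProducts eqF eqF-refl eqF-≢ x x-comm x²≈ε
  module PY = InvolutionProducts eqF eqF-refl eqF-≢ y y-comm y²≈ε
  gW : IW → Word
  gW (i , j) = w i j
  gT : IT → Word
  gT (i , j , k) = tw i j k
  module PW = InvolutionProducts eqW eqW-refl eqW-≢ gW (λ σ σ' → w-comm (proj₁ σ) (proj₂ σ) (proj₁ σ') (proj₂ σ')) (λ σ → w²≈ε (proj₁ σ) (proj₂ σ))
  module PT = InvolutionProducts eqT eqT-refl eqT-≢ gT (λ τ τ' → tw-central (proj₁ τ) (proj₁ (proj₂ τ)) (proj₂ (proj₂ τ)) (gT τ'))
                                         (λ τ → tw²≈ε (proj₁ τ) (proj₁ (proj₂ τ)) (proj₂ (proj₂ τ)))

  cW : M → IW → Bool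
  cW h (i , j) = c h i j
  tT : M → IT → Bool
  tT h (i , j , l) = t h i j l

  NF : M → Word
  NF h = PX.∏ EX (a h) · PY.∏ EX (b h) · PW.∏ EW (cW h) · PT.∏ ET (tT h)

  ET-< : ∀ {i j l} → (i , j , l) ∈ ET → toℕ i Data.Nat.< toℕ l
  ET-< h with ∈-cartesianProductWith⁻ triple (orderedPairs n) EX h
  ... | (i , l) , j , m , _ , refl = orderedPairs-< n m

  ∏T-central : ∀ f u → PT.∏ ET f · u ≈ u · PT.∏ ET f
  ∏T-central f u = PT.∏-comm u (λ τ → tw-central (proj₁ τ) (proj₁ (proj₂ τ)) (proj₂ (proj₂ τ)) u) ET f

  toggleT : Fin n → Fin n → Fin n → IT → Bool
  toggleT p q r (i , j , l) = eqF q j ∧ ((eqF p i ∧ eqF r l) xor (eqF p l ∧ eqF r i))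

  toggleT≡eqT : ∀ p q r i j l → toℕ p Data.Nat.< toℕ r → toℕ i Data.Nat.< toℕ l →
             toggleT p q r (i , j , l) ≡ eqT (p , q , r) (i , j , l)
  toggleT≡eqT p q r i j l p<r i<l =
    sym (trans (rearrange (eqF p i) (eqF q j) (eqF r l)) (cong (λ z → eqF q j ∧ ((eqF p i ∧ eqF r l) xor z)) crossed-false))
    where
    rearrange : ∀ a b c → a ∧ (b ∧ c) ≡ b ∧ ((a ∧ c) xor false)
    rearrange = solve-∀ Bool-ring
    crossed-false : false ≡ eqF p l ∧ eqF r i
    crossed-false with p ≟ l | r ≟ i
    ... | yes refl | yes refl = ⊥-elim (<-asym p<r i<l)
    ... | yes _ | no _ = refl
    ... | no _ | _ = refl

  tw-toggle< : ∀ p q r → toℕ p Data.Nat.< toℕ r → ∀ f → tw p q r · PT.∏ ET f ≈ PT.∏ ET (λ τ → toggleT p q r τ xor f τ)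
  tw-toggle< p q r lt f = PT.∏-toggle ET (p , q , r) ET-unique (ET-∈ p q r lt) f ⟫ ≡⇒≈ (PT.∏-ext ET (All.tabulate pt))
    where
    pt : ∀ {τ} → τ ∈ ET → eqT (p , q , r) τ xor f τ ≡ toggleT p q r τ xor f τ
    pt {i , j , l} m = cong (_xor f (i , j , l)) (sym (toggleT≡eqT p q r i j l lt (ET-< m)))

  tw-toggle≡ : ∀ p q f → tw p q p · PT.∏ ET f ≈ PT.∏ ET (λ τ → toggleT p q p τ xor f τ)
  tw-toggle≡ p q f = ·-congʳ (tw-diag p q) (PT.∏ ET f) ⟫ ≡⇒≈ (PT.∏-ext ET (All.tabulate pt))
    where
    pt : ∀ {τ} → τ ∈ ET → f τ ≡ toggleT p q p τ xor f τ
    pt {i , j , l} _ = sym (trans (cong (λ z → (eqF q j ∧ ((eqF p i ∧ eqF p l) xor z)) xor f (i , j , l)) (∧-comm (eqF p l) (eqF p i)))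
                         (cong (_xor f (i , j , l)) (trans (cong (eqF q j ∧_) (xor-same (eqF p i ∧ eqF p l))) (∧-zeroʳ (eqF q j)))))

  tw-toggle> : ∀ p q r → toℕ r Data.Nat.< toℕ p → ∀ f → tw p q r · PT.∏ ET f ≈ PT.∏ ET (λ τ → toggleT p q r τ xor f τ)
  tw-toggle> p q r gt f = ·-congʳ (tw-sym p q r) (PT.∏ ET f) ⟫ tw-toggle< r q p gt f ⟫ ≡⇒≈ (PT.∏-ext ET (All.tabulate pt))
    where
    pt : ∀ {τ} → τ ∈ ET → toggleT r q p τ xor f τ ≡ toggleT p q r τ xor f τ
    pt {i , j , l} _ = cong (_xor f (i , j , l)) (swap (eqF q j) (eqF r i) (eqF p l) (eqF r l) (eqF p i))
      where
      swap : ∀ a b c d e → a ∧ ((b ∧ c) xor (d ∧ e)) ≡ a ∧ ((e ∧ d) xor (c ∧ b))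
      swap = solve-∀ Bool-ring

  tw-toggle : ∀ p q r f → tw p q r · PT.∏ ET f ≈ PT.∏ ET (λ τ → toggleT p q r τ xor f τ)
  tw-toggle p q r f = go (<-cmp (toℕ p) (toℕ r))
    where
    go : Tri (toℕ p Data.Nat.< toℕ r) (toℕ p ≡ toℕ r) (toℕ r Data.Nat.< toℕ p) → tw p q r · PT.∏ ET f ≈ PT.∏ ET (λ τ → toggleT p q r τ xor f τ)
    go (tri< lt _ _) = tw-toggle< p q r lt f
    go (tri> _ _ gt) = tw-toggle> p q r gt f
    go (tri≈ _ eq _) = subst (λ r → tw p q r · PT.∏ ET f ≈ PT.∏ ET (λ τ → toggleT p q r τ xor f τ)) (toℕ-injective eq) (tw-toggle≡ p q f)

  ·-reassoc₁ : ∀ (Z A B C D : Word) → ((((Z · A) · B) · C) · D) ≡ Z · (((A · B) · C) · D)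
  ·-reassoc₁ Z A B C D = solve (++-monoid Letter)

  ·-reassoc₂ : ∀ (A Y Wr Tr B C T : Word) → ((((((A · Y) · Wr) · Tr) · B) · C) · T) ≡ A · (Y · (Wr · (Tr · (B · (C · T)))))
  ·-reassoc₂ A Y Wr Tr B C T = solve (++-monoid Letter)

  ·-reassoc₃ : ∀ (A Y B Wr C Tr T : Word) → A · (Y · (B · (Wr · (C · (Tr · T))))) ≡ A · ((Y · B) · ((Wr · C) · (Tr · T)))
  ·-reassoc₃ A Y B Wr C Tr T = solve (++-monoid Letter)

  ·-reassoc₄ : ∀ (A B C D : Word) → A · (B · (C · D)) ≡ A · B · C · D
  ·-reassoc₄ A B C D = solve (++-monoid Letter)

  -- Exponents created when collecting past ∏ x^a: wxT for w e k, yxW and yxT for y k.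
  wxT : Fin n → Fin n → List (Fin n) → (Fin n → Bool) → IT → Bool
  wxT k e [] a τ = false
  wxT k e (i ∷ E) a τ = (a i ∧ toggleT e k i τ) xor wxT k e E a τ

  yxW : Fin n → List (Fin n) → (Fin n → Bool) → IW → Bool
  yxW k [] a σ = false
  yxW k (i ∷ E) a σ = (a i ∧ eqW (i , k) σ) xor yxW k E a σ

  yxT : Fin n → List (Fin n) → (Fin n → Bool) → IT → Bool
  yxT k [] a τ = false
  yxT k (i ∷ E) a τ = (a i ∧ wxT k i E a τ) xor yxT k E a τ

  ∏T-zero : ∀ {f} → (∀ τ → f τ ≡ false) → PT.∏ ET f ≡ ε
  ∏T-zero h = PT.∏-zero ET (All.tabulate (λ {τ} _ → h τ))
  ∏W-zero : ∀ {f} → (∀ τ → f τ ≡ false) → PW.∏ EW f ≡ ε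
  ∏W-zero h = PW.∏-zero EW (All.tabulate (λ {τ} _ → h τ))

  w-past-x : ∀ k e E a → w e k · PX.∏ E a ≈ PX.∏ E a · w e k · PT.∏ ET (wxT k e E a)
  w-past-x k e [] a = ≡⇒≈ (cong (w e k ·_) (sym (∏T-zero (λ _ → refl))))
  w-past-x k e (i ∷ E) a = go (a i) refl
    where
    P : Word
    P = PX.∏ E a
    s : IT → Bool
    s = wxT k e E a
    go : ∀ b → a i ≡ b → w e k · (PX.pow (a i) i · P) ≈ PX.pow (a i) i · P · w e k · PT.∏ ET (wxT k e (i ∷ E) a)
    go true eq =
      ≡⇒≈ (cong (λ z → w e k · (PX.pow z i · P)) eq)
      ⟫ ·-congʳ (wx≈xwtw e k i) P
      ⟫ ·-congˡ (x i · w e k) (tw-central e k i P)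
      ⟫ ·-congˡ (x i) (·-congʳ (w-past-x k e E a) (tw e k i))
      ⟫ ·-congˡ (x i) (·-assoc (P · w e k) (PT.∏ ET s) (tw e k i))
      ⟫ ·-congˡ (x i) (·-congˡ (P · w e k) (≈-sym (tw-central e k i (PT.∏ ET s)) ⟫ tw-toggle e k i s))
      ⟫ ≡⇒≈ (cong (λ z → PX.pow z i · P · w e k · PT.∏ ET (λ τ → (z ∧ toggleT e k i τ) xor s τ)) (sym eq))
    go false eq =
      ≡⇒≈ (cong (λ z → w e k · (PX.pow z i · P)) eq) ⟫ w-past-x k e E a
      ⟫ ≡⇒≈ (cong (λ z → PX.pow z i · P · w e k · PT.∏ ET (λ τ → (z ∧ toggleT e k i τ) xor s τ)) (sym eq))

  ∏W-w-comm : ∀ i k f → PW.∏ EW f · w i k ≈ w i k · PW.∏ EW f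
  ∏W-w-comm i k f = PW.∏-comm (w i k) (λ σ → w-comm (proj₁ σ) (proj₂ σ) i k) EW f

  ∏W-y-comm : ∀ j f → PW.∏ EW f · y j ≈ y j · PW.∏ EW f
  ∏W-y-comm j f = PW.∏-comm (y j) (λ σ → wy≈yw (proj₁ σ) (proj₂ σ) j) EW f

  y-past-x : ∀ k E a → y k · PX.∏ E a ≈ PX.∏ E a · y k · PW.∏ EW (yxW k E a) · PT.∏ ET (yxT k E a)
  y-past-x k [] a = ≡⇒≈ (cong₂ (λ u v → y k · u · v) (sym (∏W-zero (λ _ → refl))) (sym (∏T-zero (λ _ → refl))))
  y-past-x k (i ∷ E) a = go (a i) refl
    where
    P Wr Tr Ts : Word
    r : IW → Bool
    rt s : IT → Bool
    P = PX.∏ E a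
    r = yxW k E a
    rt = yxT k E a
    s = wxT k i E a
    Wr = PW.∏ EW r
    Tr = PT.∏ ET rt
    Ts = PT.∏ ET s
    B≈ : Wr · Tr · w i k · Ts ≈ PW.∏ EW (λ σ → eqW (i , k) σ xor r σ) · PT.∏ ET (λ τ → s τ xor rt τ)
    B≈ = ·-congʳ (·-assoc Wr Tr (w i k)) Ts
      ⟫ ·-congʳ (·-congˡ Wr (∏T-central rt (w i k))) Ts
      ⟫ ·-congʳ (·-assoc⁻ Wr (w i k) Tr) Ts
      ⟫ ·-congʳ (·-congʳ (∏W-w-comm i k r) Tr) Ts
      ⟫ ·-assoc (w i k · Wr) Tr Ts
      ⟫ ·-congʳ (PW.∏-toggle EW (i , k) EW-unique (EW-∈ (i , k)) r) (Tr · Ts)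
      ⟫ ·-congˡ (PW.∏ EW (λ σ → eqW (i , k) σ xor r σ)) (∏T-central rt Ts ⟫ ≈-sym (PT.∏-xor ET s rt))
    go : ∀ b → a i ≡ b → y k · (PX.pow (a i) i · P) ≈ PX.pow (a i) i · P · y k · PW.∏ EW (yxW k (i ∷ E) a) · PT.∏ ET (yxT k (i ∷ E) a)
    go true eq =
      ≡⇒≈ (cong (λ z → y k · (PX.pow z i · P)) eq)
      ⟫ ·-congʳ (yx≈xyw i k) P
      ⟫ ·-congˡ (x i · y k) (w-past-x k i E a)
      ⟫ ·-congˡ (x i) (·-congʳ (·-congʳ (y-past-x k E a) (w i k)) Ts)
      ⟫ ·-congˡ (x i) (≡⇒≈ (·-reassoc₁ (P · y k) Wr Tr (w i k) Ts))
      ⟫ ·-congˡ (x i) (·-congˡ (P · y k) B≈)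
      ⟫ ≡⇒≈ (trans (sym (++-assoc (x i · P · y k) _ _))
             (cong (λ z → PX.pow z i · P · y k · PW.∏ EW (λ σ → (z ∧ eqW (i , k) σ) xor r σ) · PT.∏ ET (λ τ → (z ∧ s τ) xor rt τ)) (sym eq)))
    go false eq =
      ≡⇒≈ (cong (λ z → y k · (PX.pow z i · P)) eq) ⟫ y-past-x k E a
      ⟫ ≡⇒≈ (cong (λ z → PX.pow z i · P · y k · PW.∏ EW (λ σ → (z ∧ eqW (i , k) σ) xor r σ) · PT.∏ ET (λ τ → (z ∧ s τ) xor rt τ)) (sym eq))

  mem : List (Fin n) → Fin n → Bool
  mem [] p = false
  mem (e ∷ E) p = eqF e p ∨ mem E p

  mem-∉ : ∀ {e E} → All (e ≢_) E → mem E e ≡ false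
  mem-∉ [] = refl
  mem-∉ {e} (ne ∷ ns) rewrite eqF-≢ (λ q → ne (sym q)) | mem-∉ ns = refl

  mem-∈ : ∀ {p E} → p ∈ E → mem E p ≡ true
  mem-∈ {p} (here refl) rewrite eqF-refl p = refl
  mem-∈ {p} {e ∷ E} (there h) rewrite mem-∈ h = ∨-true (eqF e p)
    where ∨-true : ∀ b → b ∨ true ≡ true
          ∨-true true = refl
          ∨-true false = refl

  yxW-count : ∀ k E a p q → Unique E → yxW k E a (p , q) ≡ mem E p ∧ (a p ∧ eqF k q)
  yxW-count k [] a p q _ = refl
  yxW-count k (e ∷ E) a p q (ne ∷ u) = go (e ≟ p)
    where
    cW-same : ∀ ae K m → m ≡ false → (ae ∧ (true ∧ K)) xor (m ∧ (ae ∧ K)) ≡ true ∧ (ae ∧ K)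
    cW-same ae K .false refl = cw ae K
      where cw : ∀ ae K → (ae ∧ K) xor (false ∧ (ae ∧ K)) ≡ (ae ∧ K)
            cw = solve-∀ Bool-ring

    cW-diff : ∀ ae K X → (ae ∧ (false ∧ K)) xor X ≡ X
    cW-diff false K X = refl
    cW-diff true K X = refl
    go : Dec (e ≡ p) → yxW k (e ∷ E) a (p , q) ≡ mem (e ∷ E) p ∧ (a p ∧ eqF k q)
    go (yes refl) rewrite eqF-refl e | yxW-count k E a e q u = cW-same (a e) (eqF k q) (mem E e) (mem-∉ ne)
    go (no ne') rewrite eqF-≢ ne' | yxW-count k E a p q u = cW-diff (a e) (eqF k q) (mem E p ∧ (a p ∧ eqF k q))

  wxT-count : ∀ k e E a p q r → Unique E → wxT k e E a (p , q , r) ≡ eqF k q ∧ ((eqF e p ∧ (mem E r ∧ a r)) xor (eqF e r ∧ (mem E p ∧ a p)))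
  wxT-count k e [] a p q r _ = sym (z (eqF k q) (eqF e p) (eqF e r))
    where z : ∀ K Ep Er → K ∧ ((Ep ∧ false) xor (Er ∧ false)) ≡ false
          z = solve-∀ Bool-ring
  wxT-count k e (i ∷ E) a p q r (ni ∷ u) = go (i ≟ r) (i ≟ p)
    where
    sT-TT : ∀ ai K Ep Er → (ai ∧ (K ∧ ((Ep ∧ true) xor (Er ∧ true)))) xor (K ∧ ((Ep ∧ (false ∧ ai)) xor (Er ∧ (false ∧ ai))))
                          ≡ K ∧ ((Ep ∧ (true ∧ ai)) xor (Er ∧ (true ∧ ai)))
    sT-TT = solve-∀ Bool-ring
    sT-TF : ∀ ai K Ep Er mp ap → (ai ∧ (K ∧ ((Ep ∧ true) xor (Er ∧ false)))) xor (K ∧ ((Ep ∧ (false ∧ ai)) xor (Er ∧ (mp ∧ ap))))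
                          ≡ K ∧ ((Ep ∧ (true ∧ ai)) xor (Er ∧ (mp ∧ ap)))
    sT-TF = solve-∀ Bool-ring
    sT-FT : ∀ ai K Ep Er mr ar → (ai ∧ (K ∧ ((Ep ∧ false) xor (Er ∧ true)))) xor (K ∧ ((Ep ∧ (mr ∧ ar)) xor (Er ∧ (false ∧ ai))))
                          ≡ K ∧ ((Ep ∧ (mr ∧ ar)) xor (Er ∧ (true ∧ ai)))
    sT-FT = solve-∀ Bool-ring
    sT-FF : ∀ ai K Ep Er mr ar mp ap → (ai ∧ (K ∧ ((Ep ∧ false) xor (Er ∧ false)))) xor (K ∧ ((Ep ∧ (mr ∧ ar)) xor (Er ∧ (mp ∧ ap))))
                          ≡ K ∧ ((Ep ∧ (mr ∧ ar)) xor (Er ∧ (mp ∧ ap)))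
    sT-FF = solve-∀ Bool-ring
    IH : wxT k e E a (p , q , r) ≡ eqF k q ∧ ((eqF e p ∧ (mem E r ∧ a r)) xor (eqF e r ∧ (mem E p ∧ a p)))
    IH = wxT-count k e E a p q r u
    go : Dec (i ≡ r) → Dec (i ≡ p) → wxT k e (i ∷ E) a (p , q , r) ≡ eqF k q ∧ ((eqF e p ∧ (mem (i ∷ E) r ∧ a r)) xor (eqF e r ∧ (mem (i ∷ E) p ∧ a p)))
    go (yes refl) (yes refl) rewrite IH | eqF-refl i | mem-∉ ni = sT-TT (a i) (eqF k q) (eqF e i) (eqF e i)
    go (yes refl) (no np) rewrite IH | eqF-refl i | eqF-≢ np | mem-∉ ni = sT-TF (a i) (eqF k q) (eqF e p) (eqF e i) (mem E p) (a p)
    go (no nr) (yes refl) rewrite IH | eqF-refl i | eqF-≢ nr | mem-∉ ni = sT-FT (a i) (eqF k q) (eqF e i) (eqF e r) (mem E r) (a r)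
    go (no nr) (no np) rewrite IH | eqF-≢ np | eqF-≢ nr = sT-FF (a i) (eqF k q) (eqF e p) (eqF e r) (mem E r) (a r) (mem E p) (a p)

  yxT-count : ∀ k E a p q r → Unique E → p ≢ r → yxT k E a (p , q , r) ≡ eqF k q ∧ (mem E p ∧ (mem E r ∧ (a p ∧ a r)))
  yxT-count k [] a p q r _ _ = sym (∧-zeroʳ (eqF k q))
  yxT-count k (e ∷ E) a p q r (ne ∷ u) pr = go (e ≟ p) (e ≟ r)
    where
    rT-p : ∀ ap K mr ar → (ap ∧ (K ∧ ((true ∧ (mr ∧ ar)) xor (false ∧ (false ∧ ap))))) xor (K ∧ (false ∧ (mr ∧ (ap ∧ ar))))
                          ≡ K ∧ (true ∧ (mr ∧ (ap ∧ ar)))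
    rT-p = solve-∀ Bool-ring
    rT-r : ∀ ar K mp ap → (ar ∧ (K ∧ ((false ∧ (false ∧ ar)) xor (true ∧ (mp ∧ ap))))) xor (K ∧ (mp ∧ (false ∧ (ap ∧ ar))))
                          ≡ K ∧ (mp ∧ (true ∧ (ap ∧ ar)))
    rT-r = solve-∀ Bool-ring
    rT-n : ∀ ae K mr ar mp ap → (ae ∧ (K ∧ ((false ∧ (mr ∧ ar)) xor (false ∧ (mp ∧ ap))))) xor (K ∧ (mp ∧ (mr ∧ (ap ∧ ar))))
                          ≡ K ∧ (mp ∧ (mr ∧ (ap ∧ ar)))
    rT-n = solve-∀ Bool-ring
    IH : yxT k E a (p , q , r) ≡ eqF k q ∧ (mem E p ∧ (mem E r ∧ (a p ∧ a r)))
    IH = yxT-count k E a p q r u pr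
    S : wxT k e E a (p , q , r) ≡ eqF k q ∧ ((eqF e p ∧ (mem E r ∧ a r)) xor (eqF e r ∧ (mem E p ∧ a p)))
    S = wxT-count k e E a p q r u
    go : Dec (e ≡ p) → Dec (e ≡ r) → yxT k (e ∷ E) a (p , q , r) ≡ eqF k q ∧ (mem (e ∷ E) p ∧ (mem (e ∷ E) r ∧ (a p ∧ a r)))
    go (yes refl) (yes refl) = ⊥-elim (pr refl)
    go (yes refl) (no nr) rewrite IH | S | eqF-refl e | eqF-≢ nr | mem-∉ ne = rT-p (a e) (eqF k q) (mem E r) (a r)
    go (no np) (yes refl) rewrite IH | S | eqF-refl e | eqF-≢ np | mem-∉ ne = rT-r (a e) (eqF k q) (mem E p) (a p)
    go (no np) (no nr) rewrite IH | S | eqF-≢ np | eqF-≢ nr = rT-n (a e) (eqF k q) (mem E r) (a r) (mem E p) (a p)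

  ∏Y-∏W-comm : ∀ f g → PY.∏ EX g · PW.∏ EW f ≈ PW.∏ EW f · PY.∏ EX g
  ∏Y-∏W-comm f g = PY.∏-comm (PW.∏ EW f) (λ j → ≈-sym (∏W-y-comm j f)) EX g

  x·NF : ∀ k h → x k · NF h ≈ NF (genᴹ (inj₁ k) * h)
  x·NF k h = ·-congʳ (·-congʳ (·-congʳ (PX.∏-toggle EX k EX-unique (EX-∈ k) (a h)) (PY.∏ EX (b h))) (PW.∏ EW (cW h))) (PT.∏ ET (tT h))
    ⟫ ≡⇒≈ (cong₂ (λ u v → PX.∏ EX (λ τ → eqF k τ xor a h τ) · PY.∏ EX (b h) · u · v)
                (PW.∏-ext EW (All.tabulate (λ { {i , j} _ → c-unchanged (c h i j) (a h i) })))
                (PT.∏-ext ET (All.tabulate (λ { {i , j , l} m → t-unchanged (lt i l) (t h i j l) (a h i) (a h l) (ET-ltᵇ m) }))))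
    where
    c-unchanged : ∀ c a → c ≡ c xor (a ∧ false)
    c-unchanged c a = sym (trans (cong (c xor_) (∧-zeroʳ a)) (xor-identityʳ c))
    t-unchanged : ∀ L t a a' → L ≡ true → t ≡ L ∧ (t xor (a ∧ (a' ∧ false)))
    t-unchanged .true t a a' refl = trans (c-unchanged t a) (cong (λ z → t xor (a ∧ z)) (sym (∧-zeroʳ a')))

  toℕ<⇒≢ : ∀ {i l : Fin n} → toℕ i Data.Nat.< toℕ l → i ≢ l
  toℕ<⇒≢ lt refl = <-irrefl refl lt

  y·NF : ∀ k h → y k · NF h ≈ NF (genᴹ (inj₂ k) * h)
  y·NF k h =
    ·-congʳ (·-congʳ (·-congʳ (y-past-x k EX (a h)) B) C) Tt'
    ⟫ ≡⇒≈ (·-reassoc₂ A (y k) Wr Tr B C Tt')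
    ⟫ ·-congˡ A (·-congˡ (y k) (·-congˡ Wr X1))
    ⟫ ·-congˡ A (·-congˡ (y k) X2)
    ⟫ ≡⇒≈ (·-reassoc₃ A (y k) B Wr C Tr Tt')
    ⟫ ·-congˡ A (≈-cong (PY.∏-toggle EX k EX-unique (EX-∈ k) (b h)) (≈-cong (≈-sym (PW.∏-xor EW r (cW h))) (≈-sym (PT.∏-xor ET rt (tT h)))))
    ⟫ ≡⇒≈ (·-reassoc₄ A _ _ _)
    ⟫ ≡⇒≈ (cong₂ (λ u v → A · PY.∏ EX (λ τ → eqF k τ xor b h τ) · u · v)
                (PW.∏-ext EW (All.tabulate (λ { {i , j} _ → c-updated (r (i , j)) (c h i j) (a h i) (eqF k j)
                     (trans (yxW-count k EX (a h) i j EX-unique) (cong (_∧ (a h i ∧ eqF k j)) (mem-∈ (EX-∈ i)))) })))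
                (PT.∏-ext ET (All.tabulate (λ { {i , j , l} m → t-updated (lt i l) (rt (i , j , l)) (t h i j l) (a h i) (a h l) (eqF k j) (ET-ltᵇ m)
                     (trans (yxT-count k EX (a h) i j l EX-unique (toℕ<⇒≢ (ET-< m)))
                        (cong₂ (λ u v → eqF k j ∧ (u ∧ (v ∧ (a h i ∧ a h l)))) (mem-∈ (EX-∈ i)) (mem-∈ (EX-∈ l)))) }))))
    where
    c-updated : ∀ r c ai δ → r ≡ ai ∧ δ → r xor c ≡ c xor (ai ∧ δ)
    c-updated .(ai ∧ δ) c ai δ refl = bc' c ai δ
      where bc' : ∀ c ai δ → (ai ∧ δ) xor c ≡ c xor (ai ∧ δ)
            bc' = solve-∀ Bool-ring

    t-updated : ∀ L r t ap ar δ → L ≡ true → r ≡ δ ∧ (ap ∧ ar) → r xor t ≡ L ∧ (t xor (ap ∧ (ar ∧ δ)))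
    t-updated .true .(δ ∧ (ap ∧ ar)) t ap ar δ refl refl = bt' t ap ar δ
      where bt' : ∀ t ap ar δ → (δ ∧ (ap ∧ ar)) xor t ≡ t xor (ap ∧ (ar ∧ δ))
            bt' = solve-∀ Bool-ring
    A B C Tt' Wr Tr : Word
    r : IW → Bool
    rt : IT → Bool
    A = PX.∏ EX (a h)
    B = PY.∏ EX (b h)
    C = PW.∏ EW (cW h)
    Tt' = PT.∏ ET (tT h)
    r = yxW k EX (a h)
    rt = yxT k EX (a h)
    Wr = PW.∏ EW r
    Tr = PT.∏ ET rt
    X1 : Tr · (B · (C · Tt')) ≈ B · (C · (Tr · Tt'))
    X1 = ≡⇒≈ (cong (Tr ·_) (sym (++-assoc B C Tt'))) ⟫ ·-assoc⁻ Tr (B · C) Tt' ⟫ ·-congʳ (∏T-central rt (B · C)) Tt' ⟫ ·-assoc (B · C) Tr Tt'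
         ⟫ ≡⇒≈ (++-assoc B C (Tr · Tt'))
    X2 : Wr · (B · (C · (Tr · Tt'))) ≈ B · (Wr · (C · (Tr · Tt')))
    X2 = ·-assoc⁻ Wr B _ ⟫ ·-congʳ (≈-sym (∏Y-∏W-comm r (b h))) _ ⟫ ·-assoc B Wr _

  NF-ε : NF e ≡ ε
  NF-ε = cong₂ (λ u v → u · v) (cong₂ (λ u v → u · v) (cong₂ (λ u v → u · v) (PX.∏-zero EX (All.tabulate (λ _ → refl))) (PY.∏-zero EX (All.tabulate (λ _ → refl))))
                  (∏W-zero (λ _ → refl))) (∏T-zero (λ _ → refl))

  gen·NF : ∀ z h → gen z · NF h ≈ NF (genᴹ z * h)
  gen·NF (inj₁ k) = x·NF k
  gen·NF (inj₂ k) = y·NF k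

  NF-complete : ∀ u → u ≈ NF (φ u)
  NF-complete [] = ≡⇒≈ (sym NF-ε)
  NF-complete ((z , b) ∷ u) = ≈-cong (letter≈gen z b) (NF-complete u) ⟫ gen·NF z (φ u)

  NF-resp : ∀ {g h} → g ≐ h → NF g ≡ NF h
  NF-resp {g} {h} p = cong₂ (λ u v → u · v) (cong₂ (λ u v → u · v) (cong₂ (λ u v → u · v)
      (PX.∏-ext EX (All.tabulate (λ {i} _ → cong ai (p i i i))))
      (PY.∏-ext EX (All.tabulate (λ {j} _ → cong bj (p j j j)))))
      (PW.∏-ext EW (All.tabulate (λ { {i , j} _ → cong cij (p i j i) }))))
      (PT.∏-ext ET (All.tabulate (λ { {i , j , l} m → tq (lt i l) (t g i j l) (t h i j l) (ET-ltᵇ m) (cong tijl (p i j l)) })))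
    where
    tq : ∀ L u v → L ≡ true → L ∧ u ≡ L ∧ v → u ≡ v
    tq .true u v refl q = q

  φ-injective : ∀ {u v} → φ u ≐ φ v → u ≈ v
  φ-injective {u} {v} p = NF-complete u ⟫ ≡⇒≈ (NF-resp p) ⟫ ≈-sym (NF-complete v)

module Subgroups (n : ℕ) where

  open LocalGroup
  open OrderedPairs
  open import Defs
  open import Data.Nat using (zero; suc)
  import Data.Nat as Nat
  open import Data.Fin using (toℕ)
  open import Data.Bool using (Bool; true; false; not; _xor_; _∧_) renaming (T to Tt)
  open import Data.Unit using (tt)
  open import Data.Sum using (inj₁; inj₂)
  open import Data.Product using (_,_; proj₁; proj₂)
  open import Data.List using (List; map)
  open import Data.List.Relation.Unary.All using (All)
  import Data.List.Relation.Unary.All as All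
  open import Relation.Binary.PropositionalEquality hiding (resp)
  open import Relation.Nullary using (yes; no)
  import Data.List.Properties
  open import Data.Fin.Properties using (_≟_)

  open NormalForm n public

  Derᴹ-a : ∀ {g} → Derᴹ g → ∀ i → a g i ≡ false
  Derᴹ-a {g} p i = isD-ai (lt i i) (locOf g i i i) (p i i i)
  Derᴹ-b : ∀ {g} → Derᴹ g → ∀ j → b g j ≡ false
  Derᴹ-b {g} p j = isD-bj (lt j j) (locOf g j j j) (p j j j)
  LC₃ᴹ-c : ∀ {g} → LC₃ᴹ g → ∀ i j → c g i j ≡ false
  LC₃ᴹ-c {g} p i j = isL3-cij (lt i i) (locOf g i j i) (p i j i)
  LC₃ᴹ⇒Derᴹ : ∀ {g} → LC₃ᴹ g → Derᴹ g
  LC₃ᴹ⇒Derᴹ {g} p i j l = isL3→D (lt i l) (locOf g i j l) (p i j l)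
  Wᴹ⇒Derᴹ : ∀ {g} → Wᴹ g → Derᴹ g
  Wᴹ⇒Derᴹ {g} p i j l = isW→D (lt i l) (locOf g i j l) (p i j l)
  Wᴹ-t : ∀ {g} → Wᴹ g → ∀ i j l → lt i l ≡ true → t g i j l ≡ false
  Wᴹ-t {g} p i j l e = isW-t (locOf g i j l) (subst (λ z → Tt (isW z (locOf g i j l))) e (p i j l))
  Xᴹ-b : ∀ {g} → Xᴹ g → ∀ j → b g j ≡ false
  Xᴹ-b {g} p j = isX-bj (lt j j) (locOf g j j j) (p j j j)
  Xᴹ-c : ∀ {g} → Xᴹ g → ∀ i j → c g i j ≡ false
  Xᴹ-c {g} p i j = isX-cij (lt i i) (locOf g i j i) (p i j i)
  Xᴹ-t : ∀ {g} → Xᴹ g → ∀ i j l → lt i l ≡ true → t g i j l ≡ false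
  Xᴹ-t {g} p i j l e = isX-t (locOf g i j l) (subst (λ z → Tt (isX z (locOf g i j l))) e (p i j l))
  Yᴹ-a : ∀ {g} → Yᴹ g → ∀ i → a g i ≡ false
  Yᴹ-a {g} p i = isY-ai (lt i i) (locOf g i i i) (p i i i)
  Yᴹ-c : ∀ {g} → Yᴹ g → ∀ i j → c g i j ≡ false
  Yᴹ-c {g} p i j = isY-cij (lt i i) (locOf g i j i) (p i j i)
  Yᴹ-t : ∀ {g} → Yᴹ g → ∀ i j l → lt i l ≡ true → t g i j l ≡ false
  Yᴹ-t {g} p i j l e = isY-t (locOf g i j l) (subst (λ z → Tt (isY z (locOf g i j l))) e (p i j l))

  Locally-⟨⟩ : (P : Bool → Loc → Bool) (pm : ∀ b x → P b (mask b x) ≡ P b x)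
          (cl : ∀ g h → Locally P g → Locally P h → Locally P (g * h))
          (ic : ∀ g → Locally P g → Locally P (I g)) (pe : Locally P e)
          {S : Pred} (bs : ∀ w → S w → Locally P (φ w)) → ∀ {w} → ⟨ S ⟩ w → Locally P (φ w)
  Locally-⟨⟩ P pm cl ic pe bs (base s) = bs _ s
  Locally-⟨⟩ P pm cl ic pe bs one = pe
  Locally-⟨⟩ P pm cl ic pe bs (mul {u} {v} p q) =
    Locally-resp P pm {φ u * φ v} {φ (u · v)} (≐-sym {φ (u · v)} {φ u * φ v} (eval-· genᴹ u v))
        (cl (φ u) (φ v) (Locally-⟨⟩ P pm cl ic pe bs p) (Locally-⟨⟩ P pm cl ic pe bs q))
  Locally-⟨⟩ P pm cl ic pe bs (neg {u} p) =
    Locally-resp P pm {I (φ u)} {φ (inv u)} (≐-sym {φ (inv u)} {I (φ u)} (eval-inv genᴹ-admissible u)) (ic (φ u) (Locally-⟨⟩ P pm cl ic pe bs p))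
  Locally-⟨⟩ P pm cl ic pe bs (resp {u} {v} p q) = Locally-resp P pm {φ u} {φ v} (φ-resp q) (Locally-⟨⟩ P pm cl ic pe bs p)

  Xᴹ-e : Xᴹ e
  Xᴹ-e i j l = not-∧-false (lt i l)
  Yᴹ-e : Yᴹ e
  Yᴹ-e i j l = not-∧-false (lt i l)
  Wᴹ-e : Wᴹ e
  Wᴹ-e i j l = not-∧-false (lt i l)

  X⇒Xᴹ : ∀ {w} → X w → Xᴹ (φ w)
  X⇒Xᴹ = Locally-⟨⟩ isX isX-mask Xᴹ-* Xᴹ-I Xᴹ-e (λ { w (i , refl) → Xᴹ-* (genᴹ (inj₁ i)) e (Admissible.gx genᴹ-admissible i) Xᴹ-e })
  Y⇒Yᴹ : ∀ {w} → Y w → Yᴹ (φ w)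
  Y⇒Yᴹ = Locally-⟨⟩ isY isY-mask Yᴹ-* Yᴹ-I Yᴹ-e (λ { w (j , refl) → Yᴹ-* (genᴹ (inj₂ j)) e (Admissible.gy genᴹ-admissible j) Yᴹ-e })

  comm-Derᴹ : ∀ u v → Derᴹ (φ ⟦ u , v ⟧)
  comm-Derᴹ u v = Derᴹ-resp {commᴹ (φ u) (φ v)} {φ ⟦ u , v ⟧} (≐-sym {φ ⟦ u , v ⟧} {commᴹ (φ u) (φ v)} (eval-comm genᴹ-admissible u v)) (commᴹ-Der (φ u) (φ v))

  Der⇒Derᴹ : ∀ {w} → Der w → Derᴹ (φ w)
  Der⇒Derᴹ = Locally-⟨⟩ isD isD-mask Derᴹ-* Derᴹ-I (λ i j l → tt) (λ { w (u , v , _ , _ , refl) → comm-Derᴹ u v })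

  LC₃⇒LC₃ᴹ : ∀ {w} → LC₃ w → LC₃ᴹ (φ w)
  LC₃⇒LC₃ᴹ = Locally-⟨⟩ isL3 isL3-mask LC₃ᴹ-* LC₃ᴹ-I (λ i j l → tt)
    (λ { w (u , v , du , _ , refl) → LC₃ᴹ-resp {commᴹ (φ u) (φ v)} {φ ⟦ u , v ⟧} (≐-sym {φ ⟦ u , v ⟧} {commᴹ (φ u) (φ v)} (eval-comm genᴹ-admissible u v))
        (commᴹ-LC₃ (φ u) (φ v) (Der⇒Derᴹ du)) })

  n<ᵇn≡false : ∀ m → (m Nat.<ᵇ m) ≡ false
  n<ᵇn≡false zero = refl
  n<ᵇn≡false (suc m) = n<ᵇn≡false m

  not-both-ends : ∀ e p r → Tt (not (lt p r ∧ (eqF e p ∧ eqF e r)))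
  not-both-ends e p r with e ≟ p | e ≟ r
  ... | yes refl | yes refl rewrite n<ᵇn≡false (toℕ e) = tt
  ... | yes refl | no _ = not-∧-false (lt e r)
  ... | no _ | _ = not-∧-false (lt p r)

  comm-xy-Wᴹ : ∀ i j → Wᴹ (φ ⟦ x i , y j ⟧)
  comm-xy-Wᴹ i j p q r = mask-resp isW isW-mask (lt p r)
    (loc false false false ((eqF i p ∧ eqF j q) xor false) ((eqF i r ∧ eqF j q) xor false) false)
    (locOf (φ ⟦ x i , y j ⟧) p q r)
    (sym (loc-w·-eval (lt p r) (eqF i p) (eqF i r) (eqF j q) loc-ε (not-both-ends i p r) tt))
    (not-∧-false (lt p r))

  W⇒Wᴹ : ∀ {w} → W w → Wᴹ (φ w)
  W⇒Wᴹ = Locally-⟨⟩ isW isW-mask Wᴹ-* Wᴹ-I Wᴹ-e (λ { w (i , j , refl) → comm-xy-Wᴹ i j })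

  ∏X-zero : ∀ {f} → (∀ i → f i ≡ false) → PX.∏ EX f ≡ ε
  ∏X-zero h = PX.∏-zero EX (All.tabulate (λ {τ} _ → h τ))
  ∏Y-zero : ∀ {f} → (∀ i → f i ≡ false) → PY.∏ EX f ≡ ε
  ∏Y-zero h = PY.∏-zero EX (All.tabulate (λ {τ} _ → h τ))
  ∏T-coords-zero : ∀ {g} → (∀ i j l → lt i l ≡ true → t g i j l ≡ false) → PT.∏ ET (tT g) ≡ ε
  ∏T-coords-zero {g} h = PT.∏-zero ET (All.tabulate (λ { {i , j , l} m → h i j l (ET-ltᵇ m) }))
  ∏W-coords-zero : ∀ {g} → (∀ i j → c g i j ≡ false) → PW.∏ EW (cW g) ≡ ε
  ∏W-coords-zero {g} h = PW.∏-zero EW (All.tabulate (λ { {i , j} _ → h i j }))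

  NF-cong : ∀ {A B C D A' B' C' D' : Word} → A ≡ A' → B ≡ B' → C ≡ C' → D ≡ D' → A · B · C · D ≡ A' · B' · C' · D'
  NF-cong refl refl refl refl = refl

  NF-X : ∀ {g} → Xᴹ g → NF g ≡ PX.∏ EX (a g)
  NF-X {g} p = trans (NF-cong refl (∏Y-zero (Xᴹ-b {g} p)) (∏W-coords-zero {g} (Xᴹ-c {g} p)) (∏T-coords-zero {g} (Xᴹ-t {g} p)))
      (trans (Data.List.Properties.++-identityʳ _) (trans (Data.List.Properties.++-identityʳ _) (Data.List.Properties.++-identityʳ _)))
  NF-Y : ∀ {g} → Yᴹ g → NF g ≡ PY.∏ EX (b g)
  NF-Y {g} p = trans (NF-cong (∏X-zero (Yᴹ-a {g} p)) refl (∏W-coords-zero {g} (Yᴹ-c {g} p)) (∏T-coords-zero {g} (Yᴹ-t {g} p)))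
      (trans (Data.List.Properties.++-identityʳ _) (Data.List.Properties.++-identityʳ _))
  NF-W : ∀ {g} → Wᴹ g → NF g ≡ PW.∏ EW (cW g)
  NF-W {g} p = trans (NF-cong (∏X-zero (Derᴹ-a {g} (Wᴹ⇒Derᴹ {g} p))) (∏Y-zero (Derᴹ-b {g} (Wᴹ⇒Derᴹ {g} p))) refl (∏T-coords-zero {g} (Wᴹ-t {g} p)))
      (Data.List.Properties.++-identityʳ _)
  NF-D : ∀ {g} → Derᴹ g → NF g ≡ PW.∏ EW (cW g) · PT.∏ ET (tT g)
  NF-D {g} p = NF-cong (∏X-zero (Derᴹ-a {g} p)) (∏Y-zero (Derᴹ-b {g} p)) refl refl
  NF-L3 : ∀ {g} → LC₃ᴹ g → NF g ≡ PT.∏ ET (tT g)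
  NF-L3 {g} p = NF-cong (∏X-zero (Derᴹ-a {g} (LC₃ᴹ⇒Derᴹ {g} p))) (∏Y-zero (Derᴹ-b {g} (LC₃ᴹ⇒Derᴹ {g} p))) (∏W-coords-zero {g} (LC₃ᴹ-c {g} p)) refl

  w∈Der : ∀ i j → Der (w i j)
  w∈Der i j = resp (base (x i , y j , tt , tt , refl)) (comm-xy≈w i j)
  tw∈Der : ∀ i j k → Der (tw i j k)
  tw∈Der i j k = resp (base (⟦ x i , y j ⟧ , x k , tt , tt , refl)) (comm3≈tw i j k)
  tw∈LC₃ : ∀ i j k → LC₃ (tw i j k)
  tw∈LC₃ i j k = resp (base (⟦ x i , y j ⟧ , x k , base (x i , y j , tt , tt , refl) , tt , refl)) (comm3≈tw i j k)
  w∈W : ∀ i j → W (w i j)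
  w∈W i j = resp (base (i , j , refl)) (comm-xy≈w i j)

  Wᴹ⇒W : ∀ {w} → Wᴹ (φ w) → W w
  Wᴹ⇒W {w} p = resp (PW.∏ᵇ-in-gens (λ σ → w∈W (proj₁ σ) (proj₂ σ)) EW (map (cW (φ w)) EW)) (≈-sym (NF-complete w ⟫ ≡⇒≈ (NF-W p)))
  Derᴹ⇒Der : ∀ {w} → Derᴹ (φ w) → Der w
  Derᴹ⇒Der {w} p = resp (mul (PW.∏ᵇ-in-gens (λ σ → w∈Der (proj₁ σ) (proj₂ σ)) EW (map (cW (φ w)) EW))
                         (PT.∏ᵇ-in-gens (λ τ → tw∈Der (proj₁ τ) (proj₁ (proj₂ τ)) (proj₂ (proj₂ τ))) ET (map (tT (φ w)) ET)))
                    (≈-sym (NF-complete w ⟫ ≡⇒≈ (NF-D p)))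
  LC₃ᴹ⇒LC₃ : ∀ {w} → LC₃ᴹ (φ w) → LC₃ w
  LC₃ᴹ⇒LC₃ {w} p = resp (PT.∏ᵇ-in-gens (λ τ → tw∈LC₃ (proj₁ τ) (proj₁ (proj₂ τ)) (proj₂ (proj₂ τ))) ET (map (tT (φ w)) ET))
                    (≈-sym (NF-complete w ⟫ ≡⇒≈ (NF-L3 p)))

module Isomorphisms (n : ℕ) where

  open LocalGroup
  open OrderedPairs
  open import Defs
  open import Data.Nat using (ℕ; suc)
  import Data.Nat as Nat
  open import Data.Fin using (Fin; toℕ)
  open import Data.Bool using (Bool; true; false; _xor_; _∧_)
  open import Data.Unit using (⊤; tt)
  open import Data.Sum using (_⊎_; inj₁; inj₂)
  open import Data.Product using (Σ; _×_; _,_; proj₁; proj₂)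
  open import Data.List using (List; []; _∷_; _++_; map; length; zipWith)
  open import Data.List.Relation.Unary.All using (All; []; _∷_)
  import Data.List.Relation.Unary.All as All
  open import Data.List.Relation.Unary.Any using (here; there)
  open import Data.List.Membership.Propositional using (_∈_)
  open import Data.List.Relation.Unary.Unique.Propositional using (Unique)
  open import Data.List.Relation.Unary.AllPairs using ([]; _∷_)
  open import Data.Empty using (⊥)
  open import Relation.Binary.PropositionalEquality hiding (resp)
  import Data.List.Properties
  open import Tactic.RingSolver using (solve-∀)
  import Data.List.Relation.Unary.Unique.Propositional.Properties
  import Data.List.Membership.Propositional.Properties
  import Data.List.Relation.Unary.All.Properties
  import Data.Nat.Properties
  import Data.Nat.DivMod
  open import Data.Vec using (Vec; []; _∷_)
  import Data.Vec as Vec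
  import Data.Vec.Properties
  open import Data.Bool.Properties using (xor-identityʳ)

  open Subgroups n public

  toList-zipWith : ∀ {m} (f : Bool → Bool → Bool) (u v : Vec Bool m) → Vec.toList (Vec.zipWith f u v) ≡ zipWith f (Vec.toList u) (Vec.toList v)
  toList-zipWith f [] [] = refl
  toList-zipWith f (p ∷ u) (q ∷ v) = cong (f p q ∷_) (toList-zipWith f u v)

  length-toList≡ : ∀ {m} (u v : Vec Bool m) → length (Vec.toList u) ≡ length (Vec.toList v)
  length-toList≡ u v = trans (Data.Vec.Properties.length-toList u) (sym (Data.Vec.Properties.length-toList v))

  toList-injective : ∀ {m} (u v : Vec Bool m) → Vec.toList u ≡ Vec.toList v → u ≡ v
  toList-injective [] [] _ = refl
  toList-injective (p ∷ u) (q ∷ v) e = cong₂ _∷_ (Data.List.Properties.∷-injectiveˡ e) (toList-injective u v (Data.List.Properties.∷-injectiveʳ e))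

  fromList≡ : ∀ {m} (l : List Bool) → length l ≡ m → Vec Bool m
  fromList≡ [] refl = []
  fromList≡ {suc m} (b ∷ l) e = b ∷ fromList≡ l (Data.Nat.Properties.suc-injective e)

  toList-fromList≡ : ∀ {m} (l : List Bool) (e : length l ≡ m) → Vec.toList (fromList≡ l e) ≡ l
  toList-fromList≡ [] refl = refl
  toList-fromList≡ {suc m} (b ∷ l) e = cong (b ∷_) (toList-fromList≡ l (Data.Nat.Properties.suc-injective e))

  select : {I : Set} → (I → I → Bool) → List I → List Bool → I → Bool
  select eqI [] _ τ = false
  select eqI (_ ∷ _) [] τ = false
  select eqI (e ∷ E) (b ∷ bs) τ = (b ∧ eqI e τ) xor select eqI E bs τ

  module Selection {I : Set} (eqI : I → I → Bool) (eqI-refl : ∀ i → eqI i i ≡ true) (eqI-≢ : ∀ {i j} → i ≢ j → eqI i j ≡ false) where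
    private
      drop-∧false : ∀ b s → (b ∧ false) xor s ≡ s
      drop-∧false true s = refl
      drop-∧false false s = refl

      ∧true-injective : ∀ b b' → (b ∧ true) xor false ≡ (b' ∧ true) xor false → b ≡ b'
      ∧true-injective true true _ = refl
      ∧true-injective false false _ = refl

    select-∉ : ∀ {e} E' bs → All (e ≢_) E' → select eqI E' bs e ≡ false
    select-∉ [] bs _ = refl
    select-∉ (_ ∷ _) [] _ = refl
    select-∉ {e} (e' ∷ E') (b ∷ bs) (ne ∷ ns) rewrite eqI-≢ {e'} {e} (λ q → ne (sym q)) | select-∉ E' bs ns = drop-∧false b false

    select-injective : ∀ E' bs bs' → Unique E' → length bs ≡ length E' → length bs' ≡ length E' →
              (∀ τ → τ ∈ E' → select eqI E' bs τ ≡ select eqI E' bs' τ) → bs ≡ bs'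
    select-injective [] [] [] _ _ _ _ = refl
    select-injective (e ∷ E') (b ∷ bs) (b' ∷ bs') (ne ∷ u) l1 l2 h = cong₂ _∷_ hd tl
      where
      hd : b ≡ b'
      hd = ∧true-injective b b' (trans (sym (cong₂ (λ p q → (b ∧ p) xor q) (eqI-refl e) (select-∉ E' bs ne)))
                      (trans (h e (here refl)) (cong₂ (λ p q → (b' ∧ p) xor q) (eqI-refl e) (select-∉ E' bs' ne))))
      tl : bs ≡ bs'
      tl = select-injective E' bs bs' u (Data.Nat.Properties.suc-injective l1) (Data.Nat.Properties.suc-injective l2)
             (λ τ mτ → trans (sym (drop-∧false b _)) (trans (cong (λ z → (b ∧ z) xor select eqI E' bs τ) (sym (eqI-≢ (All.lookup ne mτ))))
                        (trans (h τ (there mτ)) (trans (cong (λ z → (b' ∧ z) xor select eqI E' bs' τ) (eqI-≢ (All.lookup ne mτ))) (drop-∧false b' _)))))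

    select-map : ∀ E (f : I → Bool) τ → Unique E → τ ∈ E → select eqI E (map f E) τ ≡ f τ
    select-map (e ∷ E) f .e (ne ∷ u) (here refl) rewrite eqI-refl e | select-∉ E (map f E) ne = fx (f e)
      where fx : ∀ b → (b ∧ true) xor false ≡ b
            fx true = refl
            fx false = refl
    select-map (e ∷ E) f τ (ne ∷ u) (there m) rewrite eqI-≢ (All.lookup ne m) = trans (drop-∧false (f e) _) (select-map E f τ u m)

    select-xor : ∀ E bs bs' τ → length bs ≡ length bs' → select eqI E (zipWith _xor_ bs bs') τ ≡ select eqI E bs τ xor select eqI E bs' τ
    select-xor [] bs bs' τ _ = refl
    select-xor (e ∷ E) [] [] τ _ = refl
    select-xor (e ∷ E) (p ∷ bs) (q ∷ bs') τ l rewrite select-xor E bs bs' τ (Data.Nat.Properties.suc-injective l) = sx p q (eqI e τ) (select eqI E bs τ)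
        (select eqI E bs' τ)
      where sx : ∀ p q e s s' → ((p xor q) ∧ e) xor (s xor s') ≡ ((p ∧ e) xor s) xor ((q ∧ e) xor s')
            sx = solve-∀ Bool-ring

  -- ⟨S⟩ is elementary abelian of rank |E| once it is spanned by commuting involutions g τ
  -- whose exponents in a product can be read back off a coordinate of the model.
  module ElementaryAbelian {I : Set} (eqI : I → I → Bool) (eqI-refl : ∀ i → eqI i i ≡ true) (eqI-≢ : ∀ {i j} → i ≢ j → eqI i j ≡ false)
                (g : I → Word) (gc : ∀ i j → g i · g j ≈ g j · g i) (gs : ∀ i → g i · g i ≈ ε)
                (E : List I) (uE : Unique E) (m : ℕ) (len : length E ≡ m)
                (S : Pred) (gS : All (λ τ → ⟨ S ⟩ (g τ)) E)
                (co : M → I → Bool) (co-resp : ∀ {h h'} → h ≐ h' → ∀ τ → τ ∈ E → co h τ ≡ co h' τ)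
                (co-Q : ∀ bs τ → τ ∈ E → co (φ (InvolutionProducts.∏ᵇ eqI eqI-refl eqI-≢ g gc gs E bs)) τ ≡ select eqI E bs τ)
                (compl' : ∀ w → ⟨ S ⟩ w → w ≈ InvolutionProducts.∏ eqI eqI-refl eqI-≢ g gc gs E (co (φ w))) where
    open InvolutionProducts eqI eqI-refl eqI-≢ g gc gs

    open Selection eqI eqI-refl eqI-≢

    iso : IsoC₂^ m ⟨ S ⟩ _≈_
    iso = record
      { ψ = λ v → ∏ᵇ E (Vec.toList v)
      ; into = λ v → ∏ᵇ-in E (Vec.toList v) gS
      ; hom = λ u v → ≡⇒≈ (cong (∏ᵇ E) (toList-zipWith _xor_ u v)) ⟫ ∏ᵇ-xor E (Vec.toList u) (Vec.toList v) (length-toList≡ u v)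
      ; inj = λ u v p → toList-injective u v (select-injective E (Vec.toList u) (Vec.toList v) uE (trans (Data.Vec.Properties.length-toList u) (sym len))
          (trans (Data.Vec.Properties.length-toList v) (sym len))
                 (λ τ mτ → trans (sym (co-Q (Vec.toList u) τ mτ)) (trans (co-resp (φ-resp p) τ mτ) (co-Q (Vec.toList v) τ mτ))))
      ; surj = λ w k → fromList≡ (map (co (φ w)) E) (trans (Data.List.Properties.length-map (co (φ w)) E) len)
                       , (≡⇒≈ (cong (∏ᵇ E) (toList-fromList≡ (map (co (φ w)) E) _)) ⟫ ≈-sym (compl' w k))
      }

  length-EX : length EX ≡ n
  length-EX = Data.List.Properties.length-tabulate {n = n} (λ i → i)

  length-cartesianProductWith : ∀ {A B C : Set} (f : A → B → C) (xs : List A) (ys : List B) →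
            length (Data.List.cartesianProductWith f xs ys) ≡ length xs Nat.* length ys
  length-cartesianProductWith f [] ys = refl
  length-cartesianProductWith f (x₁ ∷ xs) ys = trans (Data.List.Properties.length-++ (map (f x₁) ys))
                                 (cong₂ Nat._+_ (Data.List.Properties.length-map (f x₁) ys) (length-cartesianProductWith f xs ys))

  length-EW : length EW ≡ n Nat.* n
  length-EW = trans (length-cartesianProductWith _,_ EX EX) (cong₂ Nat._*_ length-EX length-EX)

  length-ET : length ET ≡ length (orderedPairs n) Nat.* n
  length-ET = trans (length-cartesianProductWith triple (orderedPairs n) EX) (cong (length (orderedPairs n) Nat.*_) length-EX)

  a-∏X : ∀ E bs τ → a (φ (PX.∏ᵇ E bs)) τ ≡ select eqF E bs τ
  a-∏X [] _ τ = refl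
  a-∏X (e ∷ E) [] τ = refl
  a-∏X (e ∷ E) (true ∷ bs) τ = cong (eqF e τ xor_) (a-∏X E bs τ)
  a-∏X (e ∷ E) (false ∷ bs) τ = a-∏X E bs τ

  b-∏Y : ∀ E bs τ → b (φ (PY.∏ᵇ E bs)) τ ≡ select eqF E bs τ
  b-∏Y [] _ τ = refl
  b-∏Y (e ∷ E) [] τ = refl
  b-∏Y (e ∷ E) (true ∷ bs) τ = cong (eqF e τ xor_) (b-∏Y E bs τ)
  b-∏Y (e ∷ E) (false ∷ bs) τ = b-∏Y E bs τ

  X-iso : ≅C₂^ X n
  X-iso = ElementaryAbelian.iso eqF eqF-refl eqF-≢ x x-comm x²≈ε EX EX-unique n length-EX X₀ (All.tabulate (λ {i} _ → base (i , refl)))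
            a (λ p τ _ → cong ai (p τ τ τ)) (λ bs τ _ → a-∏X EX bs τ) (λ w k → NF-complete w ⟫ ≡⇒≈ (NF-X (X⇒Xᴹ k)))

  Y-iso : ≅C₂^ Y n
  Y-iso = ElementaryAbelian.iso eqF eqF-refl eqF-≢ y y-comm y²≈ε EX EX-unique n length-EX Y₀ (All.tabulate (λ {i} _ → base (i , refl)))
            b (λ p τ _ → cong bj (p τ τ τ)) (λ bs τ _ → b-∏Y EX bs τ) (λ w k → NF-complete w ⟫ ≡⇒≈ (NF-Y (Y⇒Yᴹ k)))

  ∏W∈W : ∀ E bs → W (PW.∏ᵇ E bs)
  ∏W∈W E bs = PW.∏ᵇ-in-gens (λ σ → w∈W (proj₁ σ) (proj₂ σ)) E bs

  c-w· : ∀ e1 e2 R p q → Derᴹ (φ R) → c (φ (w e1 e2 · R)) p q ≡ (eqF e1 p ∧ eqF e2 q) xor c (φ R) p q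
  c-w· e1 e2 R p q RD = cong cij (loc-w·-eval (lt p p) (eqF e1 p) (eqF e1 p) (eqF e2 q) (locOf (φ R) p q p) (not-both-ends e1 p p) (RD p q p))

  c-∏W : ∀ E bs p q → c (φ (PW.∏ᵇ E bs)) p q ≡ select eqW E bs (p , q)
  c-∏W [] _ p q = refl
  c-∏W (σ ∷ E) [] p q = refl
  c-∏W ((e1 , e2) ∷ E) (true ∷ bs) p q = trans (c-w· e1 e2 (PW.∏ᵇ E bs) p q (Wᴹ⇒Derᴹ {φ (PW.∏ᵇ E bs)} (W⇒Wᴹ (∏W∈W E bs))))
      (cong ((eqF e1 p ∧ eqF e2 q) xor_) (c-∏W E bs p q))
  c-∏W (σ ∷ E) (false ∷ bs) p q = c-∏W E bs p q

  W-iso : ≅C₂^ W (n Nat.* n)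
  W-iso = ElementaryAbelian.iso eqW eqW-refl eqW-≢ gW (λ σ σ' → w-comm (proj₁ σ) (proj₂ σ) (proj₁ σ') (proj₂ σ')) (λ σ → w²≈ε (proj₁ σ) (proj₂ σ))
            EW EW-unique (n Nat.* n) length-EW _ (All.tabulate (λ {σ} _ → w∈W (proj₁ σ) (proj₂ σ)))
            cW (λ { p (i , j) _ → cong cij (p i j i) }) (λ { bs (p , q) _ → c-∏W EW bs p q }) (λ w k → NF-complete w ⟫ ≡⇒≈ (NF-W (W⇒Wᴹ k)))

  ltᵇ-cancel : ∀ {L u v} → L ≡ true → L ∧ u ≡ L ∧ v → u ≡ v
  ltᵇ-cancel refl q = q

  ∏T∈LC₃ : ∀ E bs → LC₃ (PT.∏ᵇ E bs)
  ∏T∈LC₃ E bs = PT.∏ᵇ-in-gens (λ τ → tw∈LC₃ (proj₁ τ) (proj₁ (proj₂ τ)) (proj₂ (proj₂ τ))) E bs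

  <⇒ltᵇ : ∀ {i l : Fin n} → toℕ i Nat.< toℕ l → lt i l ≡ true
  <⇒ltᵇ h = T→≡ (Data.Nat.Properties.<⇒<ᵇ h)

  t-tw· : ∀ e f g' R i j l → toℕ i Nat.< toℕ l → Derᴹ (φ R) → t (φ (tw e f g' · R)) i j l ≡ toggleT e f g' (i , j , l) xor t (φ R) i j l
  t-tw· e f g' R i j l h RD = ltᵇ-cancel (<⇒ltᵇ h) (cong tijl (loc-t·-eval (lt i l) (eqF e i) (eqF e l) (eqF f j) (eqF g' i) (eqF g' l) (locOf (φ R) i j l)
                                   (not-both-ends e i l) (not-both-ends g' i l) (RD i j l)))

  Ordered : IT → Set
  Ordered (e , f , g') = toℕ e Nat.< toℕ g'

  ET-ordered : All Ordered ET
  ET-ordered = All.tabulate (λ { {i , j , l} m → ET-< m })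

  t-∏T : ∀ E bs i j l → All Ordered E → toℕ i Nat.< toℕ l → t (φ (PT.∏ᵇ E bs)) i j l ≡ select eqT E bs (i , j , l)
  t-∏T [] _ i j l _ _ = refl
  t-∏T (σ ∷ E) [] i j l _ h = refl
  t-∏T ((e , f , g') ∷ E) (true ∷ bs) i j l (ok ∷ oks) h =
    trans (t-tw· e f g' (PT.∏ᵇ E bs) i j l h (LC₃ᴹ⇒Derᴹ {φ (PT.∏ᵇ E bs)} (LC₃⇒LC₃ᴹ (∏T∈LC₃ E bs))))
          (cong₂ _xor_ (toggleT≡eqT e f g' i j l ok h) (t-∏T E bs i j l oks h))
  t-∏T (σ ∷ E) (false ∷ bs) i j l (_ ∷ oks) h = t-∏T E bs i j l oks h

  LC₃-iso : ≅C₂^ LC₃ (n Nat.* n Nat.* (n Nat.∸ 1) Data.Nat.DivMod./ 2)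
  LC₃-iso = ElementaryAbelian.iso eqT eqT-refl eqT-≢ gT (λ τ τ' → tw-central (proj₁ τ) (proj₁ (proj₂ τ)) (proj₂ (proj₂ τ)) (gT τ'))
              (λ τ → tw²≈ε (proj₁ τ) (proj₁ (proj₂ τ)) (proj₂ (proj₂ τ)))
              ET ET-unique _ (trans length-ET (LC₃-dimension n (length (orderedPairs n)) (orderedPairs-length n))) _
              (All.tabulate (λ {τ} _ → tw∈LC₃ (proj₁ τ) (proj₁ (proj₂ τ)) (proj₂ (proj₂ τ))))
              tT (λ { p (i , j , l) m → ltᵇ-cancel (ET-ltᵇ m) (cong tijl (p i j l)) })
              (λ { bs (i , j , l) m → t-∏T ET bs i j l ET-ordered (ET-< m) })
              (λ w k → NF-complete w ⟫ ≡⇒≈ (NF-L3 (LC₃⇒LC₃ᴹ k)))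

  IS : Set
  IS = IW ⊎ IT

  eqS : IS → IS → Bool
  eqS (inj₁ σ) (inj₁ σ') = eqW σ σ'
  eqS (inj₂ τ) (inj₂ τ') = eqT τ τ'
  eqS (inj₁ _) (inj₂ _) = false
  eqS (inj₂ _) (inj₁ _) = false

  eqS-refl : ∀ s → eqS s s ≡ true
  eqS-refl (inj₁ σ) = eqW-refl σ
  eqS-refl (inj₂ τ) = eqT-refl τ

  eqS-≢ : ∀ {s s'} → s ≢ s' → eqS s s' ≡ false
  eqS-≢ {inj₁ σ} {inj₁ σ'} ne = eqW-≢ (λ q → ne (cong inj₁ q))
  eqS-≢ {inj₂ τ} {inj₂ τ'} ne = eqT-≢ (λ q → ne (cong inj₂ q))
  eqS-≢ {inj₁ _} {inj₂ _} ne = refl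
  eqS-≢ {inj₂ _} {inj₁ _} ne = refl

  gDer : IS → Word
  gDer (inj₁ σ) = gW σ
  gDer (inj₂ τ) = gT τ

  gDer-comm : ∀ s s' → gDer s · gDer s' ≈ gDer s' · gDer s
  gDer-comm (inj₁ σ) (inj₁ σ') = w-comm (proj₁ σ) (proj₂ σ) (proj₁ σ') (proj₂ σ')
  gDer-comm (inj₁ σ) (inj₂ τ) = ≈-sym (tw-central (proj₁ τ) (proj₁ (proj₂ τ)) (proj₂ (proj₂ τ)) (gW σ))
  gDer-comm (inj₂ τ) s' = tw-central (proj₁ τ) (proj₁ (proj₂ τ)) (proj₂ (proj₂ τ)) (gDer s')

  gDer²≈ε : ∀ s → gDer s · gDer s ≈ ε
  gDer²≈ε (inj₁ σ) = w²≈ε (proj₁ σ) (proj₂ σ)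
  gDer²≈ε (inj₂ τ) = tw²≈ε (proj₁ τ) (proj₁ (proj₂ τ)) (proj₂ (proj₂ τ))

  module PS = InvolutionProducts eqS eqS-refl eqS-≢ gDer gDer-comm gDer²≈ε

  ES : List IS
  ES = map inj₁ EW ++ map inj₂ ET

  ES-unique : Unique ES
  ES-unique = Data.List.Relation.Unary.Unique.Propositional.Properties.++⁺
           (Data.List.Relation.Unary.Unique.Propositional.Properties.map⁺ (λ { refl → refl }) EW-unique)
           (Data.List.Relation.Unary.Unique.Propositional.Properties.map⁺ (λ { refl → refl }) ET-unique) disj
    where
    disj : ∀ {v} → (v ∈ map inj₁ EW × v ∈ map inj₂ ET) → ⊥
    disj (m1 , m2) with Data.List.Membership.Propositional.Properties.∈-map⁻ inj₁ m1 | Data.List.Membership.Propositional.Properties.∈-map⁻ inj₂ m2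
    ... | _ , _ , e1 | _ , _ , e2 = nope (trans (sym e1) e2)
      where nope : ∀ {p q} → inj₁ p ≢ inj₂ q
            nope ()

  OrderedDer : IS → Set
  OrderedDer (inj₁ _) = ⊤
  OrderedDer (inj₂ τ) = Ordered τ

  ES-ordered : All OrderedDer ES
  ES-ordered = Data.List.Relation.Unary.All.Properties.++⁺
            (Data.List.Relation.Unary.All.Properties.map⁺ (All.tabulate (λ _ → tt)))
            (Data.List.Relation.Unary.All.Properties.map⁺ ET-ordered)

  coordDer : M → IS → Bool
  coordDer h (inj₁ σ) = cW h σ
  coordDer h (inj₂ τ) = tT h τ

  ∏S∈Der : ∀ E bs → Der (PS.∏ᵇ E bs)
  ∏S∈Der E bs = PS.∏ᵇ-in-gens (λ { (inj₁ σ) → w∈Der (proj₁ σ) (proj₂ σ) ; (inj₂ τ) → tw∈Der (proj₁ τ) (proj₁ (proj₂ τ)) (proj₂ (proj₂ τ)) }) E bs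

  coords-∏S : ∀ E bs s → All OrderedDer E → OrderedDer s → coordDer (φ (PS.∏ᵇ E bs)) s ≡ select eqS E bs s
  coords-∏S [] _ (inj₁ _) _ _ = refl
  coords-∏S [] _ (inj₂ _) _ _ = refl
  coords-∏S (_ ∷ _) [] (inj₁ _) _ _ = refl
  coords-∏S (_ ∷ _) [] (inj₂ _) _ _ = refl
  coords-∏S (s' ∷ E) (false ∷ bs) s (_ ∷ oks) os = coords-∏S E bs s oks os
  coords-∏S (inj₁ (e1 , e2) ∷ E) (true ∷ bs) (inj₁ (p , q)) (_ ∷ oks) os =
    trans (c-w· e1 e2 (PS.∏ᵇ E bs) p q (Der⇒Derᴹ (∏S∈Der E bs))) (cong ((eqF e1 p ∧ eqF e2 q) xor_) (coords-∏S E bs (inj₁ (p , q)) oks os))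
  coords-∏S (inj₁ (e1 , e2) ∷ E) (true ∷ bs) (inj₂ (i , j , l)) (_ ∷ oks) os =
    trans (ltᵇ-cancel (<⇒ltᵇ os) (cong tijl (loc-w·-eval (lt i l) (eqF e1 i) (eqF e1 l) (eqF e2 j) (locOf (φ (PS.∏ᵇ E bs)) i j l) (not-both-ends e1 i l)
        (Der⇒Derᴹ (∏S∈Der E bs) i j l))))
          (coords-∏S E bs (inj₂ (i , j , l)) oks os)
  coords-∏S (inj₂ (e , f , g') ∷ E) (true ∷ bs) (inj₁ (p , q)) (_ ∷ oks) os =
    trans (cong cij (loc-t·-eval (lt p p) (eqF e p) (eqF e p) (eqF f q) (eqF g' p) (eqF g' p) (locOf (φ (PS.∏ᵇ E bs)) p q p)
                      (not-both-ends e p p) (not-both-ends g' p p) (Der⇒Derᴹ (∏S∈Der E bs) p q p)))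
          (coords-∏S E bs (inj₁ (p , q)) oks os)
  coords-∏S (inj₂ (e , f , g') ∷ E) (true ∷ bs) (inj₂ (i , j , l)) (ok ∷ oks) os =
    trans (t-tw· e f g' (PS.∏ᵇ E bs) i j l os (Der⇒Derᴹ (∏S∈Der E bs)))
          (cong₂ _xor_ (toggleT≡eqT e f g' i j l ok os) (coords-∏S E bs (inj₂ (i , j , l)) oks os))

  pow-inj₁ : ∀ bb σ → PS.pow bb (inj₁ σ) ≡ PW.pow bb σ
  pow-inj₁ true σ = refl
  pow-inj₁ false σ = refl
  pow-inj₂ : ∀ bb τ → PS.pow bb (inj₂ τ) ≡ PT.pow bb τ
  pow-inj₂ true τ = refl
  pow-inj₂ false τ = refl

  PS-∏-++ : ∀ A B f → PS.∏ (A ++ B) f ≡ PS.∏ A f · PS.∏ B f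
  PS-∏-++ [] B f = refl
  PS-∏-++ (s ∷ A) B f = trans (cong (PS.pow (f s) s ·_) (PS-∏-++ A B f)) (sym (Data.List.Properties.++-assoc (PS.pow (f s) s) (PS.∏ A f) (PS.∏ B f)))
  PS-∏-inj₁ : ∀ A f → PS.∏ (map inj₁ A) f ≡ PW.∏ A (λ σ → f (inj₁ σ))
  PS-∏-inj₁ [] f = refl
  PS-∏-inj₁ (σ ∷ A) f = cong₂ _·_ (pow-inj₁ (f (inj₁ σ)) σ) (PS-∏-inj₁ A f)
  PS-∏-inj₂ : ∀ A f → PS.∏ (map inj₂ A) f ≡ PT.∏ A (λ τ → f (inj₂ τ))
  PS-∏-inj₂ [] f = refl
  PS-∏-inj₂ (τ ∷ A) f = cong₂ _·_ (pow-inj₂ (f (inj₂ τ)) τ) (PS-∏-inj₂ A f)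

  Der-iso : 1 Nat.≤ n → ≅C₂^ Der (n Nat.* n Nat.* (n Nat.+ 1) Data.Nat.DivMod./ 2)
  Der-iso h1 = ElementaryAbelian.iso eqS eqS-refl eqS-≢ gDer gDer-comm gDer²≈ε ES ES-unique _ len _
              (All.tabulate (λ { {inj₁ σ} _ → w∈Der (proj₁ σ) (proj₂ σ) ; {inj₂ τ} _ → tw∈Der (proj₁ τ) (proj₁ (proj₂ τ)) (proj₂ (proj₂ τ)) }))
              coordDer (λ { p (inj₁ (i , j)) _ → cong cij (p i j i) ; p (inj₂ (i , j , l)) m → ltᵇ-cancel (<⇒ltᵇ (All.lookup ES-ordered m)) (cong tijl (p i j l)) })
              (λ bs s m → coords-∏S ES bs s ES-ordered (All.lookup ES-ordered m))
              (λ w k → NF-complete w ⟫ ≡⇒≈ (trans (NF-D (Der⇒Derᴹ k)) (sym (trans (PS-∏-++ (map inj₁ EW) (map inj₂ ET) (coordDer (φ w)))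
                           (cong₂ _·_ (PS-∏-inj₁ EW (coordDer (φ w))) (PS-∏-inj₂ ET (coordDer (φ w))))))))
    where
    len : length ES ≡ n Nat.* n Nat.* (n Nat.+ 1) Data.Nat.DivMod./ 2
    len = trans (Data.List.Properties.length-++ (map inj₁ EW))
            (trans (cong₂ Nat._+_ (trans (Data.List.Properties.length-map inj₁ EW) length-EW) (trans (Data.List.Properties.length-map inj₂ ET) length-ET))
                   (Der-dimension n (length (orderedPairs n)) h1 (orderedPairs-length n)))

  φ-inv· : ∀ u v → φ (inv u · v) ≐ I (φ u) * φ v
  φ-inv· u v = eval-· genᴹ (inv u) v ⊚ *-congʳ {φ (inv u)} {I (φ u)} (eval-inv genᴹ-admissible u) (φ v)

  same-ab⇒Der : ∀ u v → (∀ i → a (φ u) i ≡ a (φ v) i) → (∀ j → b (φ u) j ≡ b (φ v) j) → Der (inv u · v)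
  same-ab⇒Der u v ha hb = Derᴹ⇒Der (Derᴹ-resp {I (φ u) * φ v} {φ (inv u · v)} (≐-sym {φ (inv u · v)} {I (φ u) * φ v} (φ-inv· u v))
                     (λ i j l → loc-same-ab-D (lt i l) (locOf (φ u) i j l) (locOf (φ v) i j l) (ha i) (ha l) (hb j)))

  Der⇒same-ab : ∀ u v → Der (inv u · v) → (∀ i → a (φ u) i ≡ a (φ v) i) × (∀ j → b (φ u) j ≡ b (φ v) j)
  Der⇒same-ab u v d =
      (λ i → loc-D-same-a (lt i i) (locOf (φ u) i i i) (locOf (φ v) i i i) (D' i i i))
    , (λ j → loc-D-same-b (lt j j) (locOf (φ u) j j j) (locOf (φ v) j j j) (D' j j j))
    where
    D' : Derᴹ (I (φ u) * φ v)
    D' = Derᴹ-resp {φ (inv u · v)} {I (φ u) * φ v} (φ-inv· u v) (Der⇒Derᴹ d)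

  take-++ : ∀ {m k} (A : Vec Bool m) (B : Vec Bool k) → Vec.take m (A Vec.++ B) ≡ A
  take-++ [] B = refl
  take-++ (p ∷ A) B = cong (p ∷_) (take-++ A B)
  drop-++ : ∀ {m k} (A : Vec Bool m) (B : Vec Bool k) → Vec.drop m (A Vec.++ B) ≡ B
  drop-++ [] B = refl
  drop-++ (p ∷ A) B = drop-++ A B

  ψ-ab : Vec Bool (n Nat.+ n) → Word
  ψ-ab v = PX.∏ᵇ EX (Vec.toList (Vec.take n v)) · PY.∏ᵇ EX (Vec.toList (Vec.drop n v))

  a-· : ∀ u v i → a (φ (u · v)) i ≡ a (φ u) i xor a (φ v) i
  a-· u v i = cong ai (eval-· genᴹ u v i i i)
  b-· : ∀ u v j → b (φ (u · v)) j ≡ b (φ u) j xor b (φ v) j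
  b-· u v j = cong bj (eval-· genᴹ u v j j j)

  a-ψ-ab : ∀ v i → a (φ (ψ-ab v)) i ≡ select eqF EX (Vec.toList (Vec.take n v)) i
  a-ψ-ab v i = trans (a-· (PX.∏ᵇ EX (Vec.toList (Vec.take n v))) (PY.∏ᵇ EX (Vec.toList (Vec.drop n v))) i)
             (trans (cong (a (φ (PX.∏ᵇ EX (Vec.toList (Vec.take n v)))) i xor_) (Yᴹ-a {φ (PY.∏ᵇ EX _)} (Y⇒Yᴹ (PY.∏ᵇ-in-gens (λ j → base (j , refl)) EX _)) i))
                    (trans (xor-identityʳ _) (a-∏X EX _ i)))
  b-ψ-ab : ∀ v j → b (φ (ψ-ab v)) j ≡ select eqF EX (Vec.toList (Vec.drop n v)) j
  b-ψ-ab v j = trans (b-· (PX.∏ᵇ EX (Vec.toList (Vec.take n v))) (PY.∏ᵇ EX (Vec.toList (Vec.drop n v))) j)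
             (trans (cong (_xor b (φ (PY.∏ᵇ EX (Vec.toList (Vec.drop n v)))) j) (Xᴹ-b {φ (PX.∏ᵇ EX _)} (X⇒Xᴹ (PX.∏ᵇ-in-gens (λ i → base (i , refl)) EX _)) j))
                    (b-∏Y EX _ j))

  module SelX = Selection eqF eqF-refl eqF-≢

  a-ψ-ab-⊕ : ∀ u v i → a (φ (ψ-ab (u ⊕ v))) i ≡ a (φ (ψ-ab u · ψ-ab v)) i
  a-ψ-ab-⊕ u v i =
    trans (a-ψ-ab (u ⊕ v) i) (trans (cong (λ z → select eqF EX (Vec.toList z) i) (Data.Vec.Properties.take-zipWith {m = n} _xor_ u v))
      (trans (cong (λ z → select eqF EX z i) (toList-zipWith _xor_ (Vec.take n u) (Vec.take n v)))
      (trans (SelX.select-xor EX _ _ i (length-toList≡ (Vec.take n u) (Vec.take n v)))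
      (sym (trans (a-· (ψ-ab u) (ψ-ab v) i) (cong₂ _xor_ (a-ψ-ab u i) (a-ψ-ab v i)))))))

  b-ψ-ab-⊕ : ∀ u v j → b (φ (ψ-ab (u ⊕ v))) j ≡ b (φ (ψ-ab u · ψ-ab v)) j
  b-ψ-ab-⊕ u v j =
    trans (b-ψ-ab (u ⊕ v) j) (trans (cong (λ z → select eqF EX (Vec.toList z) j) (Data.Vec.Properties.drop-zipWith {m = n} _xor_ u v))
      (trans (cong (λ z → select eqF EX z j) (toList-zipWith _xor_ (Vec.drop n u) (Vec.drop n v)))
      (trans (SelX.select-xor EX _ _ j (length-toList≡ (Vec.drop n u) (Vec.drop n v)))
      (sym (trans (b-· (ψ-ab u) (ψ-ab v) j) (cong₂ _xor_ (b-ψ-ab u j) (b-ψ-ab v j)))))))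

  select-EX-injective : ∀ (u v : Vec Bool n) → (∀ i → select eqF EX (Vec.toList u) i ≡ select eqF EX (Vec.toList v) i) → u ≡ v
  select-EX-injective u v h =
    toList-injective u v (SelX.select-injective EX _ _ EX-unique
      (trans (Data.Vec.Properties.length-toList u) (sym length-EX)) (trans (Data.Vec.Properties.length-toList v) (sym length-EX)) (λ i _ → h i))

  ψ-ab-injective : ∀ u v → Der (inv (ψ-ab u) · ψ-ab v) → u ≡ v
  ψ-ab-injective u v d =
    trans (sym (Data.Vec.Properties.take++drop≡id n u))
      (trans (cong₂ Vec._++_
        (select-EX-injective _ _ (λ i → trans (sym (a-ψ-ab u i)) (trans (proj₁ same i) (a-ψ-ab v i))))
        (select-EX-injective _ _ (λ j → trans (sym (b-ψ-ab u j)) (trans (proj₂ same j) (b-ψ-ab v j)))))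
      (Data.Vec.Properties.take++drop≡id n v))
    where
    same : (∀ i → a (φ (ψ-ab u)) i ≡ a (φ (ψ-ab v)) i) × (∀ j → b (φ (ψ-ab u)) j ≡ b (φ (ψ-ab v)) j)
    same = Der⇒same-ab (ψ-ab u) (ψ-ab v) d

  coordsEX : (Fin n → Bool) → Vec Bool n
  coordsEX f = fromList≡ (map f EX) (trans (Data.List.Properties.length-map f EX) length-EX)

  select-coordsEX : ∀ f i → select eqF EX (Vec.toList (coordsEX f)) i ≡ f i
  select-coordsEX f i = trans (cong (λ z → select eqF EX z i) (toList-fromList≡ _ _)) (SelX.select-map EX f i EX-unique (EX-∈ i))

  ψ-ab-surjective : ∀ w → Σ (Vec Bool (n Nat.+ n)) λ v → Der (inv (ψ-ab v) · w)
  ψ-ab-surjective w =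
    (A Vec.++ B) ,
    same-ab⇒Der (ψ-ab (A Vec.++ B)) w
      (λ i → trans (a-ψ-ab (A Vec.++ B) i) (trans (cong (λ z → select eqF EX (Vec.toList z) i) (take-++ A B)) (select-coordsEX (a (φ w)) i)))
      (λ j → trans (b-ψ-ab (A Vec.++ B) j) (trans (cong (λ z → select eqF EX (Vec.toList z) j) (drop-++ A B)) (select-coordsEX (b (φ w)) j)))
    where
    A B : Vec Bool n
    A = coordsEX (a (φ w))
    B = coordsEX (b (φ w))

  abelianisation-iso : IsoC₂^ (n Nat.+ n) Whole (ModN Der)
  abelianisation-iso = record
    { ψ = ψ-ab
    ; into = λ _ → tt
    ; hom = λ u v → same-ab⇒Der (ψ-ab (u ⊕ v)) (ψ-ab u · ψ-ab v) (a-ψ-ab-⊕ u v) (b-ψ-ab-⊕ u v)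
    ; inj = ψ-ab-injective
    ; surj = λ w _ → ψ-ab-surjective w
    }

module Properties (n : ℕ) where

  open LocalGroup
  open OrderedPairs
  open import Defs
  open import Data.Nat using (ℕ)
  open import Data.Fin using (Fin)
  open import Data.Bool using (true; false; _xor_; _∧_)
  open import Data.Unit using (tt)
  open import Data.Sum using (inj₁; inj₂)
  open import Data.Product using (Σ; _×_; _,_; proj₁; proj₂)
  open import Data.List using (List; []; _∷_; map; concat)
  open import Data.List.Relation.Unary.All using (All; []; _∷_)
  import Data.List.Relation.Unary.All as All
  open import Data.List.Relation.Unary.Any using (Any)
  open import Data.List.Membership.Propositional using (_∈_)
  open import Relation.Binary.PropositionalEquality hiding (resp)
  import Data.List.Properties
  import Data.List.Membership.Propositional.Properties
  open import Data.Bool.Properties using (∧-zeroʳ; xor-identityʳ; ∧-distribˡ-xor; ∧-distribʳ-xor)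

  open Isomorphisms n public

  cartesian· : List Word → List Word → List Word
  cartesian· = Data.List.cartesianProductWith _·_

  cartesian·-∈ : ∀ {u v us vs} → u ∈ us → v ∈ vs → (u · v) ∈ cartesian· us vs
  cartesian·-∈ = Data.List.Membership.Propositional.Properties.∈-cartesianProductWith⁺ _·_

  allWords : List Word
  allWords = cartesian· (cartesian· (cartesian· (PX.all∏ EX) (PY.all∏ EX)) (PW.all∏ EW)) (PT.all∏ ET)

  finite : Finite
  finite = allWords , λ w → Data.List.Relation.Unary.Any.map (λ {v} eq → NF-complete w ⟫ ≡⇒≈ eq)
             (cartesian·-∈ (cartesian·-∈ (cartesian·-∈ (PX.∏∈all∏ EX (a (φ w))) (PY.∏∈all∏ EX (b (φ w)))) (PW.∏∈all∏ EW (cW (φ w)))) (PT.∏∈all∏ ET (tT (φ w))))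

  generated-by-X∪Y : Whole ⊆ ⟨ X ∪ Y ⟩
  generated-by-X∪Y [] _ = one
  generated-by-X∪Y ((inj₁ i , false) ∷ u) _ = mul (base (inj₁ (base (i , refl)))) (generated-by-X∪Y u tt)
  generated-by-X∪Y ((inj₁ i , true) ∷ u) _ = mul (neg (base (inj₁ (base (i , refl))))) (generated-by-X∪Y u tt)
  generated-by-X∪Y ((inj₂ j , false) ∷ u) _ = mul (base (inj₂ (base (j , refl)))) (generated-by-X∪Y u tt)
  generated-by-X∪Y ((inj₂ j , true) ∷ u) _ = mul (neg (base (inj₂ (base (j , refl))))) (generated-by-X∪Y u tt)

  mixedDihedral : MixedDihedral n X Y
  mixedDihedral = finite , X-iso , Y-iso , generated-by-X∪Y , abelianisation-iso

  φ-conj : ∀ k u → φ (inv k · u · k) ≐ I (φ k) * φ u * φ k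
  φ-conj k u = eval-· genᴹ (inv k · u) k ⊚ *-congʳ {φ (inv k · u)} {I (φ k) * φ u} (φ-inv· k u) (φ k)

  W⊆Der : W ⊆ Der
  W⊆Der w p = Derᴹ⇒Der (Wᴹ⇒Derᴹ {φ w} (W⇒Wᴹ p))

  LC₃⊆Der : LC₃ ⊆ Der
  LC₃⊆Der w p = Derᴹ⇒Der (LC₃ᴹ⇒Derᴹ {φ w} (LC₃⇒LC₃ᴹ p))

  W-normal : NormalIn W Der
  W-normal u k wu dk =
    Wᴹ⇒W (Wᴹ-resp {I (φ k) * φ u * φ k} {φ (inv k · u · k)} (≐-sym {φ (inv k · u · k)} {I (φ k) * φ u * φ k} (φ-conj k u))
      (λ i j l → loc-conj-W (lt i l) (locOf (φ u) i j l) (locOf (φ k) i j l) (W⇒Wᴹ wu i j l) (Der⇒Derᴹ dk i j l)))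

  LC₃-normal : NormalIn LC₃ Der
  LC₃-normal u k lu _ =
    LC₃ᴹ⇒LC₃ (LC₃ᴹ-resp {I (φ k) * φ u * φ k} {φ (inv k · u · k)} (≐-sym {φ (inv k · u · k)} {I (φ k) * φ u * φ k} (φ-conj k u))
      (λ i j l → loc-conj-L3 (lt i l) (locOf (φ u) i j l) (locOf (φ k) i j l) (LC₃⇒LC₃ᴹ lu i j l)))

  W∩LC₃-trivial : ∀ w → W w → LC₃ w → w ≈ ε
  W∩LC₃-trivial w p q = φ-injective {w} {ε} (λ i j l → loc-W∩L3-trivial (lt i l) (locOf (φ w) i j l) (W⇒Wᴹ p i j l) (LC₃⇒LC₃ᴹ q i j l))

  Der⊆W·LC₃ : ∀ w → Der w → Σ Word λ u → Σ Word λ v → W u × LC₃ v × (w ≈ u · v)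
  Der⊆W·LC₃ w p = PW.∏ EW (cW (φ w)) , PT.∏ ET (tT (φ w)) , ∏W∈W EW _ , ∏T∈LC₃ ET _ , (NF-complete w ⟫ ≡⇒≈ (NF-D (Der⇒Derᴹ p)))

  Der≅W×LC₃ : InternalDirectProduct Der W LC₃
  Der≅W×LC₃ = W⊆Der , LC₃⊆Der , W-normal , LC₃-normal , W∩LC₃-trivial , Der⊆W·LC₃

  LC₃⊆T : LC₃ ⊆ 𝓗.T n
  LC₃⊆T w p = resp (PT.∏ᵇ-in ET _ (All.tabulate (λ { {i , j , l} m → resp (base (i , j , l , ET-< m , refl)) (comm3≈tw i j l) })))
                   (≈-sym (NF-complete w ⟫ ≡⇒≈ (NF-L3 (LC₃⇒LC₃ᴹ p))))

  ⟨⟩-mono : ∀ {S S' : Pred} → (∀ w → S w → ⟨ S' ⟩ w) → ∀ w → ⟨ S ⟩ w → ⟨ S' ⟩ w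
  ⟨⟩-mono h w (base s) = h w s
  ⟨⟩-mono h _ one = one
  ⟨⟩-mono h _ (mul p q) = mul (⟨⟩-mono h _ p) (⟨⟩-mono h _ q)
  ⟨⟩-mono h _ (neg p) = neg (⟨⟩-mono h _ p)
  ⟨⟩-mono h _ (resp p q) = resp (⟨⟩-mono h _ p) q

  T⊆LC₃ : 𝓗.T n ⊆ LC₃
  T⊆LC₃ = ⟨⟩-mono (λ { w (i , j , k , _ , refl) → base (⟦ x i , y j ⟧ , x k , base (x i , y j , tt , tt , refl) , tt , refl) })

  LC₃⊆Z : LC₃ ⊆ Z
  LC₃⊆Z w p v = φ-injective {w · v} {v · w} (eval-· genᴹ w v ⊚ LC₃ᴹ-central (φ w) (φ v) (LC₃⇒LC₃ᴹ p) ⊚ ≐-sym {φ (v · w)} {φ v * φ w} (eval-· genᴹ v w))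

  comm3-symmetric : ∀ (i i' j : Fin n) → ⟦ ⟦ x i , y j ⟧ , x i' ⟧ ≈ ⟦ ⟦ x i' , y j ⟧ , x i ⟧
  comm3-symmetric i i' j = comm3≈tw i j i' ⟫ tw-sym i j i' ⟫ ≈-sym (comm3≈tw i' j i)

  comm-with-Y-trivial : ∀ u v v' → Y v → Y v' → (⟦ ⟦ v , u ⟧ , v' ⟧ ≈ ε) × (⟦ ⟦ u , v ⟧ , v' ⟧ ≈ ε)
  comm-with-Y-trivial u v v' yv yv' =
      φ-injective {⟦ ⟦ v , u ⟧ , v' ⟧} {ε} (eval-comm genᴹ-admissible ⟦ v , u ⟧ v' ⊚ commᴹ-Der-Y (φ ⟦ v , u ⟧) (φ v') (comm-Derᴹ v u) (Y⇒Yᴹ yv'))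
    , φ-injective {⟦ ⟦ u , v ⟧ , v' ⟧} {ε} (eval-comm genᴹ-admissible ⟦ u , v ⟧ v' ⊚ commᴹ-Der-Y (φ ⟦ u , v ⟧) (φ v') (comm-Derᴹ u v) (Y⇒Yᴹ yv'))

  c-·-Der : ∀ U V p q → Derᴹ (φ V) → c (φ (U · V)) p q ≡ c (φ U) p q xor c (φ V) p q
  c-·-Der U V p q d = trans (cong cij (eval-· genᴹ U V p q p))
                    (cong (c (φ U) p q xor_) (trans (cong (λ z → c (φ V) p q xor (z ∧ b (φ U) q)) (Derᴹ-a {φ V} d p)) (xor-identityʳ _)))

  commRow : Fin n → List (Fin n) → Word
  commRow i js = concat (map (λ j → ⟦ x i , y j ⟧) js)

  commRow∈Der : ∀ i js → Der (commRow i js)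
  commRow∈Der i [] = one
  commRow∈Der i (j ∷ js) = mul (base (x i , y j , tt , tt , refl)) (commRow∈Der i js)

  prodComm∈Der : ∀ is js → Der (prodComm is js)
  prodComm∈Der [] js = one
  prodComm∈Der (i ∷ is) js = mul (commRow∈Der i js) (prodComm∈Der is js)

  c-comm-X-Y : ∀ u v p q → X u → Y v → c (φ ⟦ u , v ⟧) p q ≡ a (φ u) p ∧ b (φ v) q
  c-comm-X-Y u v p q xu yv = trans (cong cij (eval-comm genᴹ-admissible u v p q p))
                        (loc-comm-X-Y-c (lt p p) (locOf (φ u) p q p) (locOf (φ v) p q p) (X⇒Xᴹ xu p q p) (Y⇒Yᴹ yv p q p))

  c-commRow : ∀ i js p q → c (φ (commRow i js)) p q ≡ eqF i p ∧ b (φ (prodY js)) q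
  c-commRow i [] p q = sym (∧-zeroʳ (eqF i p))
  c-commRow i (j ∷ js) p q =
    trans (c-·-Der ⟦ x i , y j ⟧ (commRow i js) p q (Der⇒Derᴹ (commRow∈Der i js)))
      (trans (cong₂ _xor_ (trans (c-comm-X-Y (x i) (y j) p q (base (i , refl)) (base (j , refl)))
          (cong₂ _∧_ (xor-identityʳ (eqF i p)) (xor-identityʳ (eqF j q)))) (c-commRow i js p q))
             (sym (∧-distribˡ-xor (eqF i p) (eqF j q) (b (φ (prodY js)) q))))

  c-prodComm : ∀ is js p q → c (φ (prodComm is js)) p q ≡ a (φ (prodX is)) p ∧ b (φ (prodY js)) q
  c-prodComm [] js p q = refl
  c-prodComm (i ∷ is) js p q =
    trans (c-·-Der (commRow i js) (prodComm is js) p q (Der⇒Derᴹ (prodComm∈Der is js)))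
      (trans (cong₂ _xor_ (c-commRow i js p q) (c-prodComm is js p q)) (sym (∧-distribʳ-xor (b (φ (prodY js)) q) (eqF i p) (a (φ (prodX is)) p))))

  prodX∈X : ∀ is → X (prodX is)
  prodX∈X [] = one
  prodX∈X (i ∷ is) = mul (base (i , refl)) (prodX∈X is)
  prodY∈Y : ∀ js → Y (prodY js)
  prodY∈Y [] = one
  prodY∈Y (j ∷ js) = mul (base (j , refl)) (prodY∈Y js)

  comm-prod-mod-LC₃ : ∀ (is js : List (Fin n)) → ModN LC₃ ⟦ prodX is , prodY js ⟧ (prodComm is js)
  comm-prod-mod-LC₃ is js = LC₃ᴹ⇒LC₃ (LC₃ᴹ-resp {I (φ C) * φ PC} {φ (inv C · PC)} (≐-sym {φ (inv C · PC)} {I (φ C) * φ PC} (φ-inv· C PC))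
                  (λ i j l → loc-same-c-L3 (lt i l) (locOf (φ C) i j l) (locOf (φ PC) i j l)
                     (comm-Derᴹ (prodX is) (prodY js) i j l) (Der⇒Derᴹ (prodComm∈Der is js) i j l) (ceq i j) (ceq l j)))
    where
    C PC : Word
    C = ⟦ prodX is , prodY js ⟧
    PC = prodComm is js
    ceq : ∀ p q → c (φ C) p q ≡ c (φ PC) p q
    ceq p q = trans (c-comm-X-Y (prodX is) (prodY js) p q (prodX∈X is) (prodY∈Y js)) (sym (c-prodComm is js p q))

  subst-gens : (Fin n → Word) → (Fin n → Word) → Word → Word
  subst-gens gx gy [] = []
  subst-gens gx gy ((inj₁ i , _) ∷ u) = gx i · subst-gens gx gy u
  subst-gens gx gy ((inj₂ j , _) ∷ u) = gy j · subst-gens gx gy u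

  subst-gens-· : ∀ gx gy u v → subst-gens gx gy (u · v) ≡ subst-gens gx gy u · subst-gens gx gy v
  subst-gens-· gx gy [] v = refl
  subst-gens-· gx gy ((inj₁ i , _) ∷ u) v = trans (cong (gx i ·_) (subst-gens-· gx gy u v)) (sym (Data.List.Properties.++-assoc (gx i) _ _))
  subst-gens-· gx gy ((inj₂ j , _) ∷ u) v = trans (cong (gy j ·_) (subst-gens-· gx gy u v)) (sym (Data.List.Properties.++-assoc (gy j) _ _))

  genImageᴹ : (Fin n → Word) → (Fin n → Word) → Gen → M
  genImageᴹ gx gy (inj₁ i) = φ (gx i)
  genImageᴹ gx gy (inj₂ j) = φ (gy j)

  φ-subst-gens : ∀ gx gy u → φ (subst-gens gx gy u) ≐ eval (genImageᴹ gx gy) u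
  φ-subst-gens gx gy [] = ≐-refl {e}
  φ-subst-gens gx gy ((inj₁ i , _) ∷ u) = eval-· genᴹ (gx i) (subst-gens gx gy u) ⊚ *-congˡ (φ (gx i)) {φ (subst-gens gx gy u)} {eval (genImageᴹ gx gy) u}
      (φ-subst-gens gx gy u)
  φ-subst-gens gx gy ((inj₂ j , _) ∷ u) = eval-· genᴹ (gy j) (subst-gens gx gy u) ⊚ *-congˡ (φ (gy j)) {φ (subst-gens gx gy u)} {eval (genImageᴹ gx gy) u}
      (φ-subst-gens gx gy u)

  module SubstitutionLemmas (gx gy : Fin n → Word) (hx : ∀ i → X (gx i)) (hy : ∀ j → Y (gy j)) where
    G : Admissible (genImageᴹ gx gy)
    G = admissible (λ i → X⇒Xᴹ (hx i)) (λ j → Y⇒Yᴹ (hy j))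

    subst-gens-resp : ∀ {u v} → u ≈ v → subst-gens gx gy u ≈ subst-gens gx gy v
    subst-gens-resp {u} {v} p = φ-injective {subst-gens gx gy u} {subst-gens gx gy v}
      (φ-subst-gens gx gy u ⊚ eval-resp G p ⊚ ≐-sym {φ (subst-gens gx gy v)} {eval (genImageᴹ gx gy) v} (φ-subst-gens gx gy v))

    subst-gens-inv : ∀ u → subst-gens gx gy (inv u) ≈ inv (subst-gens gx gy u)
    subst-gens-inv u = φ-injective {subst-gens gx gy (inv u)} {inv (subst-gens gx gy u)}
      (φ-subst-gens gx gy (inv u) ⊚ eval-inv G u ⊚ I-cong {eval (genImageᴹ gx gy) u} {φ (subst-gens gx gy u)}
          (≐-sym {φ (subst-gens gx gy u)} {eval (genImageᴹ gx gy) u} (φ-subst-gens gx gy u))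
       ⊚ ≐-sym {φ (inv (subst-gens gx gy u))} {I (φ (subst-gens gx gy u))} (eval-inv genᴹ-admissible (subst-gens gx gy u)))

    subst-gens-X : ∀ {u} → X u → X (subst-gens gx gy u)
    subst-gens-X (base (i , refl)) = resp (hx i) (≈-sym (·-identityʳ (gx i)))
    subst-gens-X one = one
    subst-gens-X (mul {u} {v} p q) = resp (mul (subst-gens-X p) (subst-gens-X q)) (≡⇒≈ (sym (subst-gens-· gx gy u v)))
    subst-gens-X (neg {u} p) = resp (neg (subst-gens-X p)) (≈-sym (subst-gens-inv u))
    subst-gens-X (resp p q) = resp (subst-gens-X p) (subst-gens-resp q)

    subst-gens-Y : ∀ {u} → Y u → Y (subst-gens gx gy u)
    subst-gens-Y (base (j , refl)) = resp (hy j) (≈-sym (·-identityʳ (gy j)))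
    subst-gens-Y one = one
    subst-gens-Y (mul {u} {v} p q) = resp (mul (subst-gens-Y p) (subst-gens-Y q)) (≡⇒≈ (sym (subst-gens-· gx gy u v)))
    subst-gens-Y (neg {u} p) = resp (neg (subst-gens-Y p)) (≈-sym (subst-gens-inv u))
    subst-gens-Y (resp p q) = resp (subst-gens-Y p) (subst-gens-resp q)

  subst-gens-∘ : ∀ ax ay bx by' u → subst-gens ax ay (subst-gens bx by' u) ≡ subst-gens (λ i → subst-gens ax ay (bx i)) (λ j → subst-gens ax ay (by' j)) u
  subst-gens-∘ ax ay bx by' [] = refl
  subst-gens-∘ ax ay bx by' ((inj₁ i , _) ∷ u) = trans (subst-gens-· ax ay (bx i) (subst-gens bx by' u)) (cong (subst-gens ax ay (bx i) ·_) (subst-gens-∘ ax ay bx by' u))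
  subst-gens-∘ ax ay bx by' ((inj₂ j , _) ∷ u) = trans (subst-gens-· ax ay (by' j) (subst-gens bx by' u))
      (cong (subst-gens ax ay (by' j) ·_) (subst-gens-∘ ax ay bx by' u))

  subst-gens-id : ∀ hx hy → (∀ i → hx i ≈ x i) → (∀ j → hy j ≈ y j) → ∀ u → subst-gens hx hy u ≈ u
  subst-gens-id hx hy ex ey [] = ≈-refl
  subst-gens-id hx hy ex ey ((inj₁ i , b') ∷ u) = ≈-cong (ex i ⟫ ≈-sym (letter≈gen (inj₁ i) b')) (subst-gens-id hx hy ex ey u)
  subst-gens-id hx hy ex ey ((inj₂ j , b') ∷ u) = ≈-cong (ey j ⟫ ≈-sym (letter≈gen (inj₂ j) b')) (subst-gens-id hx hy ex ey u)

  module AgreeOnGenerators {S₀ : Pred} (gK : (w : Word) → ⟨ S₀ ⟩ w → Word) (A : IsAut ⟨ S₀ ⟩ gK)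
            (F : Word → Word) (F-· : ∀ u v → F (u · v) ≡ F u · F v) (F-resp : ∀ {u v} → u ≈ v → F u ≈ F v)
            (F-inv : ∀ u → F (inv u) ≈ inv (F u)) (F-base : ∀ w (s : S₀ w) → F w ≈ gK w (base s)) where
    open IsAut A
    gK-ε : gK ε one ≈ ε
    gK-ε = ≈-sym (cancelˡ (gK ε one) (·-identityʳ (gK ε one) ⟫ hom ε ε one one one))
    gK-inv : ∀ u (p : ⟨ S₀ ⟩ u) → gK (inv u) (neg p) ≈ inv (gK u p)
    gK-inv u p = inverse-unique (≈-sym (hom (inv u) u (neg p) p (mul (neg p) p)) ⟫ respects (inv u · u) ε (mul (neg p) p) one (inverseˡ u) ⟫ gK-ε)
    agree : ∀ w (p : ⟨ S₀ ⟩ w) → F w ≈ gK w p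
    agree w (base s) = F-base w s
    agree _ one = ≈-sym (cancelˡ (F ε) (·-identityʳ (F ε) ⟫ ≡⇒≈ (F-· ε ε))) ⟫ ≈-sym gK-ε
    agree _ (mul {u} {v} p q) = ≡⇒≈ (F-· u v) ⟫ ≈-cong (agree u p) (agree v q) ⟫ ≈-sym (hom u v p q (mul p q))
    agree _ (neg {u} p) = F-inv u ⟫ inv-resp (agree u p) ⟫ ≈-sym (gK-inv u p)
    agree _ (resp {u} {v} p q) = F-resp (≈-sym q) ⟫ agree u p ⟫ respects u v p (resp p q) q

  -- Substituting the images of the generators is well defined because they lie in X and Y,
  -- so they satisfy the relators (an Admissible assignment); substituting preimages inverts it.
  module ExtendAutomorphisms (g₁ : (w : Word) → X w → Word) (g₂ : (w : Word) → Y w → Word)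
                             (A₁ : IsAut X g₁) (A₂ : IsAut Y g₂) where
    gx gy : Fin n → Word
    gx i = g₁ (x i) (base (i , refl))
    gy j = g₂ (y j) (base (j , refl))
    hx : ∀ i → X (gx i)
    hx i = IsAut.into A₁ (x i) (base (i , refl))
    hy : ∀ j → Y (gy j)
    hy j = IsAut.into A₂ (y j) (base (j , refl))
    ux uy : Fin n → Word
    ux i = proj₁ (IsAut.surj A₁ (x i) (base (i , refl)))
    uy j = proj₁ (IsAut.surj A₂ (y j) (base (j , refl)))
    px : ∀ i → X (ux i)
    px i = proj₁ (proj₂ (IsAut.surj A₁ (x i) (base (i , refl))))
    py : ∀ j → Y (uy j)
    py j = proj₁ (proj₂ (IsAut.surj A₂ (y j) (base (j , refl))))
    ex : ∀ i → g₁ (ux i) (px i) ≈ x i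
    ex i = proj₂ (proj₂ (IsAut.surj A₁ (x i) (base (i , refl))))
    ey : ∀ j → g₂ (uy j) (py j) ≈ y j
    ey j = proj₂ (proj₂ (IsAut.surj A₂ (y j) (base (j , refl))))
    module S1 = SubstitutionLemmas gx gy hx hy
    module S2 = SubstitutionLemmas ux uy px py
    agree-X : ∀ w (p : X w) → subst-gens gx gy w ≈ g₁ w p
    agree-X = AgreeOnGenerators.agree g₁ A₁ (subst-gens gx gy) (subst-gens-· gx gy) S1.subst-gens-resp S1.subst-gens-inv (λ { w (i , refl) → ·-identityʳ (gx i) })
    agree-Y : ∀ w (p : Y w) → subst-gens gx gy w ≈ g₂ w p
    agree-Y = AgreeOnGenerators.agree g₂ A₂ (subst-gens gx gy) (subst-gens-· gx gy) S1.subst-gens-resp S1.subst-gens-inv (λ { w (j , refl) → ·-identityʳ (gy j) })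
    subst-gens-rightInverse : ∀ w → subst-gens gx gy (subst-gens ux uy w) ≈ w
    subst-gens-rightInverse w = ≡⇒≈ (subst-gens-∘ gx gy ux uy w) ⟫ subst-gens-id _ _ (λ i → agree-X (ux i) (px i) ⟫ ex i) (λ j → agree-Y (uy j) (py j) ⟫ ey j) w
    bx : ∀ i → subst-gens ux uy (gx i) ≈ x i
    bx i = IsAut.inj A₁ (subst-gens ux uy (gx i)) (x i) (S2.subst-gens-X (hx i)) (base (i , refl))
        (≈-sym (agree-X _ (S2.subst-gens-X (hx i))) ⟫ subst-gens-rightInverse (gx i))
    by' : ∀ j → subst-gens ux uy (gy j) ≈ y j
    by' j = IsAut.inj A₂ (subst-gens ux uy (gy j)) (y j) (S2.subst-gens-Y (hy j)) (base (j , refl))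
        (≈-sym (agree-Y _ (S2.subst-gens-Y (hy j))) ⟫ subst-gens-rightInverse (gy j))
    subst-gens-leftInverse : ∀ w → subst-gens ux uy (subst-gens gx gy w) ≈ w
    subst-gens-leftInverse w = ≡⇒≈ (subst-gens-∘ ux uy gx gy w) ⟫ subst-gens-id _ _ bx by' w
    isaut : IsAut Whole (λ w _ → subst-gens gx gy w)
    isaut = record
      { into = λ _ _ → tt
      ; respects = λ u v _ _ q → S1.subst-gens-resp q
      ; hom = λ u v _ _ _ → ≡⇒≈ (subst-gens-· gx gy u v)
      ; inj = λ u v _ _ q → ≈-sym (subst-gens-leftInverse u) ⟫ S2.subst-gens-resp q ⟫ subst-gens-leftInverse v
      ; surj = λ w _ → subst-gens ux uy w , tt , subst-gens-rightInverse w
      }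

  automorphisms-extend : ∀ (g₁ : (w : Word) → X w → Word) (g₂ : (w : Word) → Y w → Word) →
          IsAut X g₁ → IsAut Y g₂ →
          Σ ((w : Word) → Whole w → Word) λ F →
            IsAut Whole F
            × (∀ i → F (x i) tt ≈ g₁ (x i) (base (i , refl)))
            × (∀ i → F (y i) tt ≈ g₂ (y i) (base (i , refl)))
  automorphisms-extend g₁ g₂ A₁ A₂ = (λ w _ → subst-gens gx gy w) , isaut , (λ i → ·-identityʳ (gx i)) , (λ j → ·-identityʳ (gy j))
    where open ExtendAutomorphisms g₁ g₂ A₁ A₂

open import Defs
open import Data.Nat using (ℕ; _≤_; _*_; _+_; _∸_; s≤s; z≤n)
open import Data.Nat.DivMod using (_/_)
open import Data.Nat.Properties using (≤-trans)
open import Data.Fin using (Fin)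
open import Data.List using (List; length)
open import Data.Product using (_×_; Σ; _,_)
open import Relation.Binary.PropositionalEquality using (refl)
open import Data.Unit using (tt)

theorem4p5 : (n : ℕ) → 2 ≤ n → let open 𝓗 n in
  -- (1)
  (∀ (i i' j : Fin n) → ⟦ ⟦ x i , y j ⟧ , x i' ⟧ ≈ ⟦ ⟦ x i' , y j ⟧ , x i ⟧)
  -- (2)
  × IsoC₂^ (n + n) Whole (ModN Der)
  × MixedDihedral n X Y
  -- (3)
  × InternalDirectProduct Der W LC₃
  × ≅C₂^ Der (n * n * (n + 1) / 2)
  × ≅C₂^ W (n * n)
  × (LC₃ ⊆ T) × (T ⊆ LC₃)
  × ≅C₂^ LC₃ (n * n * (n ∸ 1) / 2)
  × (LC₃ ⊆ Z)
  -- (4)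
  × (∀ a b b' → Y b → Y b' → (⟦ ⟦ b , a ⟧ , b' ⟧ ≈ ε) × (⟦ ⟦ a , b ⟧ , b' ⟧ ≈ ε))
  -- (5)
  × (∀ (g₁ : (w : Word) → X w → Word) (g₂ : (w : Word) → Y w → Word) →
       IsAut X g₁ → IsAut Y g₂ →
       Σ ((w : Word) → Whole w → Word) λ F →
         IsAut Whole F
         × (∀ i → F (x i) tt ≈ g₁ (x i) (base (i , refl)))
         × (∀ i → F (y i) tt ≈ g₂ (y i) (base (i , refl))))
  -- (6)
  × (∀ (is js : List (Fin n)) →
       (∀ is' → prodX is ≈ prodX is' → length is ≤ length is') →
       (∀ js' → prodY js ≈ prodY js' → length js ≤ length js') →
       ModN LC₃ ⟦ prodX is , prodY js ⟧ (prodComm is js))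
theorem4p5 n 2≤n =
  comm3-symmetric , abelianisation-iso , mixedDihedral , Der≅W×LC₃ , Der-iso (≤-trans (s≤s z≤n) 2≤n) ,
  W-iso , LC₃⊆T , T⊆LC₃ , LC₃-iso , LC₃⊆Z , comm-with-Y-trivial , automorphisms-extend ,
  -- the congruence in (6) holds for all words, minimal or not
  λ is js _ _ → comm-prod-mod-LC₃ is js
  where open Properties n
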